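{- For every $i\in\{0,\dots,n\}$ there exists a bijection $\Phi$ from $\mathcal{P}^{\gg}_{c_{b_i}}$ to $\mathcal{P}_{i,\rho}\times\mathcal{P}$, where $\mathcal{P}$ is the set of ordinary integer partitions, such that if $\Phi(\lambda)=(\mu,\nu)$ then $|\lambda|=|\mu|+|\nu|$, $\ell(\lambda)=\ell(\mu)+\ell(\nu)$, and the product of the colours of the parts of $\lambda$ whose colour is not in $\{c_{b_k}:k\in\{0,\dots,n\}\}$ equals the corresponding product for $\mu$.
   Context: $\overline{[n]}=\{1,\dots,n,\overline n,\dots,\overline 1\}$ with order $1<\dots<n<\overline n<\dots<\overline 1$, $\overline{\overline k}=k$. $\mathcal{B}=\{\emptyset\}\sqcup\{(x,y):x\le y\in\overline{[n]}\}$; energy $H$: $H(\emptyset\otimes\emptyset)=0$, $H(\emptyset\otimes(x,y))=H((x,y)\otimes\emptyset)=1$, and for $x\le y$, $x'\le y'$, $H((x,y)\otimes(x',y'))=\chi(x\ge x')+\chi(y\ge y')-\chi(y\ge y'>x\ge x')$ if $\overline{y'}\ne x$ and $=\chi(x>x')+\chi(y>y')-\chi(y>y'>x>x')$ if $\overline{y'}=x$, where $\chi(P)\in\{0,1\}$ is the truth value of $P$. Colours are distinct formal symbols $c_b$ ($b\in\mathcal B$), written $c_{x,y}$ for $c_{(x,y)}$; coloured integers $k_c$ ($k\in\mathbb Z$). $b_0=\emptyset$, $b_k=(k,\overline k)$ for $k\ge1$. $\mathcal{P}^{\gg}_{c_{b_i}}$ is the set of finite sequences $(\pi_0,\dots,\pi_s)$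 of coloured integers with colours $c_b$ such that $\pi_s=0_{c_{b_i}}$, $\pi_{s-1}\ne0_{c_{b_i}}$ if $s>0$, and for $j<s$, writing $\pi_j=k_{c_b}$, $\pi_{j+1}=k'_{c_{b'}}$, $k-k'\ge H(b'\otimes b)$. Let $\mathcal S=\{c_{x,y}:x\le y\in\overline{[n]}\}$ and $c_\infty$ a new colour. Define $\rho_i$ on $\mathcal S\times(\mathcal S\sqcup\{c_\infty\})$ by $\rho_i(c_{b_i},c_\infty)=1$ (when $i\ge1$), $\rho_i(c_b,c_\infty)=H(b_i\otimes b)$ for $c_b\in\mathcal S\setminus\{c_{b_i}\}$, and $\rho_i(c_{x',y'},c_{x,y})=\chi(x\ge x')+\chi(y\ge y')-\chi(y\ge y'>x\ge x')$. $\tilde{\mathcal P}^{c_\infty}_{\rho_i}$ is the set of sequences $(\pi_0,\dots,\pi_{s-1},\pi_s=0_{c_\infty})$ with $c(\pi_j)\in\mathcal S$ for $j<s$ and $|\pi_j|-|\pi_{j+1}|\ge\rho_i(c(\pi_j),c(\pi_{j+1}))$ for all $j<s$; $\mathcal P_{i,\rho}$ is obtained from it by replacing the final part $0_{c_\infty}$ by $0_{c_{b_i}}$. For such sequences, $|\cdot|$ is the sum of sizes and $\ell(\cdot)$ the number of parts; for $\nu\in\mathcal P$ these are the usual size and number of parts. -}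

module Defs where

open import Data.Nat as ℕ using (ℕ; zero; suc; _∸_)
import Data.Nat.Properties as ℕP
open import Data.Fin as Fin using (Fin; toℕ; opposite; _↑ˡ_; _≤_; _<_; _≤?_; _<?_)
open import Data.Fin.Properties using (toℕ<n; toℕ-↑ˡ; opposite-prop; toℕ-injective) renaming (_≟_ to _≟F_)
open import Data.Integer as ℤ using (ℤ; +_)
open import Data.Bool using (Bool; true; false; if_then_else_)
open import Data.Product using (Σ; ∃; _×_; _,_; proj₁; proj₂)
open import Data.Maybe using (Maybe; just; nothing)
open import Data.List using (List; []; _∷_; _∷ʳ_; map; length; filter; foldr)
open import Data.List.Relation.Unary.All using (All)
open import Data.List.Relation.Unary.Linked using (Linked)
open import Relation.Nullary using (Dec; yes; no; does; ¬_)
open import Relation.Nullary.Decidable using (_×-dec_; ¬?)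
open import Relation.Binary.PropositionalEquality using (_≡_; _≢_; refl; cong; subst)
open import Data.Fin.Properties using (any?)

-- The alphabet  [n]‾ = {1,…,n,n‾,…,1‾}  is encoded as  Fin (n + n):
-- index j < n  stands for the letter j+1, index j ≥ n stands for the
-- barred letter (2n - j)‾.  The order of [n]‾ is the order of Fin, and
-- the bar involution is  Fin.opposite.

Letter : ℕ → Set
Letter n = Fin (n ℕ.+ n)

bar : ∀ {n} → Letter n → Letter n
bar = opposite

record Pair (n : ℕ) : Set where
  constructor ⟨_,_∣_⟩
  field
    fst : Letter n
    snd : Letter n
    .ord : fst ≤ snd
open Pair public

-- The set 𝓑 = {∅} ⊔ {(x,y) : x ≤ y}.  Colours c_b are identified with b.
data Tile (n : ℕ) : Set where
  ∅    : Tile n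
  tile : Pair n → Tile n

pair-≡ : ∀ {n} {p q : Pair n} → fst p ≡ fst q → snd p ≡ snd q → p ≡ q
pair-≡ {p = ⟨ x , y ∣ _ ⟩} {⟨ .x , .y ∣ _ ⟩} refl refl = refl

_≟P_ : ∀ {n} (p q : Pair n) → Dec (p ≡ q)
p ≟P q with fst p ≟F fst q | snd p ≟F snd q
... | yes e₁ | yes e₂ = yes (pair-≡ e₁ e₂)
... | no ne  | _      = no (λ e → ne (cong fst e))
... | yes _  | no ne  = no (λ e → ne (cong snd e))

_≟T_ : ∀ {n} (s t : Tile n) → Dec (s ≡ t)
∅ ≟T ∅ = yes refl
∅ ≟T tile _ = no (λ ())
tile _ ≟T ∅ = no (λ ())
tile p ≟T tile q with p ≟P q
... | yes refl = yes refl
... | no ne = no (λ { refl → ne refl })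

private
  bk-ord : ∀ {n} (k : Fin n) → (k ↑ˡ n) ≤ opposite (k ↑ˡ n)
  bk-ord {n} k = conv (ℕP.≤-trans (ℕP.<⇒≤ (toℕ<n k)) (ℕP.m+n≤o⇒m≤o∸n n (ℕP.+-monoʳ-≤ n (toℕ<n k))))
    where
      conv : toℕ k ℕ.≤ (n ℕ.+ n) ∸ suc (toℕ k) → toℕ (k ↑ˡ n) ℕ.≤ toℕ (opposite (k ↑ˡ n))
      conv h rewrite opposite-prop (k ↑ˡ n) | toℕ-↑ˡ k n = h

b : ∀ {n} → Fin (suc n) → Tile n
b Fin.zero = ∅
b {n} (Fin.suc k) = tile ⟨ k ↑ˡ n , opposite (k ↑ˡ n) ∣ bk-ord k ⟩

χ : ∀ {p} {P : Set p} → Dec P → ℕ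
χ d = if does d then 1 else 0

weakH : ∀ {n} (x y x' y' : Letter n) → ℕ
weakH {n} x y x' y' =
  (χ (_≤?_ {n ℕ.+ n} x' x) ℕ.+ χ (_≤?_ {n ℕ.+ n} y' y)) ∸ χ (_≤?_ {n ℕ.+ n} y' y ×-dec (_<?_ {n ℕ.+ n} x y' ×-dec _≤?_ {n ℕ.+ n} x' x))

strictH : ∀ {n} (x y x' y' : Letter n) → ℕ
strictH {n} x y x' y' =
  (χ (_<?_ {n ℕ.+ n} x' x) ℕ.+ χ (_<?_ {n ℕ.+ n} y' y)) ∸ χ (_<?_ {n ℕ.+ n} y' y ×-dec (_<?_ {n ℕ.+ n} x y' ×-dec _<?_ {n ℕ.+ n} x' x))

H : ∀ {n} → Tile n → Tile n → ℕ
H ∅ ∅ = 0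
H ∅ (tile _) = 1
H (tile _) ∅ = 1
H {n} (tile ⟨ x , y ∣ _ ⟩) (tile ⟨ x' , y' ∣ _ ⟩) =
  if does (bar {n} y' ≟F x) then strictH {n} x y x' y' else weakH {n} x y x' y'

CInt : ℕ → Set
CInt n = ℤ × Tile n

size : ∀ {A : Set} → List (ℤ × A) → ℤ
size = foldr (λ p s → proj₁ p ℤ.+ s) (+ 0)

GgRel : ∀ {n} → CInt n → CInt n → Set
GgRel (k , t) (k' , t') = + H t' t ℤ.≤ k ℤ.- k'

record IsGg {n : ℕ} (i : Fin (suc n)) (π : List (CInt n)) : Set where
  field
    front   : List (CInt n)
    ends    : π ≡ front ∷ʳ (+ 0 , b i)
    penult  : ∀ zs z → front ≡ zs ∷ʳ z → z ≢ (+ 0 , b i)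
    chain   : Linked GgRel π

Pgg : ∀ {n} → Fin (suc n) → Set
Pgg {n} i = Σ (List (CInt n)) (IsGg i)

-- ρ_i on 𝓢 × (𝓢 ⊔ {c_∞}); 𝓢 = Pair n, c_∞ = nothing.
ρ : ∀ {n} → Fin (suc n) → Pair n → Maybe (Pair n) → ℕ
ρ i p nothing = if does (tile p ≟T b i) then 1 else H (b i) (tile p)
ρ {n} i ⟨ x' , y' ∣ _ ⟩ (just ⟨ x , y ∣ _ ⟩) = weakH {n} x y x' y'

ρRel : ∀ {n} → Fin (suc n) → ℤ × Maybe (Pair n) → ℤ × Maybe (Pair n) → Set
ρRel i (k , nothing) _ = ⊥'
  where open import Data.Empty using () renaming (⊥ to ⊥')
ρRel i (k , just p) (k' , c') = + ρ i p c' ℤ.≤ k ℤ.- k'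

tildeSeq : ∀ {n} → List (ℤ × Pair n) → List (ℤ × Maybe (Pair n))
tildeSeq ys = map (λ { (k , p) → (k , just p) }) ys ∷ʳ (+ 0 , nothing)

IsTilde : ∀ {n} → Fin (suc n) → List (ℤ × Pair n) → Set
IsTilde i ys = Linked (ρRel i) (tildeSeq ys)

replaceSeq : ∀ {n} → Fin (suc n) → List (ℤ × Pair n) → List (CInt n)
replaceSeq i ys = map (λ { (k , p) → (k , tile p) }) ys ∷ʳ (+ 0 , b i)

Pρ : ∀ {n} → Fin (suc n) → Set
Pρ {n} i = Σ (List (CInt n)) λ μ → ∃ λ ys → IsTilde i ys × μ ≡ replaceSeq i ys

IsPartition : List ℕ → Set
IsPartition ν = Linked (λ a c → c ℕ.≤ a) ν × All (λ a → 1 ℕ.≤ a) ν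

Partition : Set
Partition = Σ (List ℕ) IsPartition

sumℕ : List ℕ → ℕ
sumℕ = foldr ℕ._+_ 0

isSpecial? : ∀ {n} (t : Tile n) → Dec (∃ λ (k : Fin (suc n)) → t ≡ b k)
isSpecial? t = any? (λ k → t ≟T b k)

nonSpecialColours : ∀ {n} → List (CInt n) → List (Tile n)
nonSpecialColours π = filter (λ t → ¬? (isSpecial? t)) (map proj₂ π)

-- Sort the parts of λ into runs of equal size. Inside a run consecutive colours have energy 0,
-- which for pairs means componentwise descent, strict except across a pair whose x is the bar of
-- the previous y. Hence a run contains at most one special colour b_k, as a block of copies, with
-- the pairs above the antidiagonal before it and those below after it. Deleting these copies (and
-- b_k itself unless it descends strictly from its neighbours) leaves a strictly descending run,
-- i.e. one of ρ-energy 0, and the deleted parts, together with the parts coloured ∅, become parts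
-- of ν of the same size. The special pair is determined by its neighbours (it shares the y of the
-- last pair above or the x of the first pair below the antidiagonal), so the deletion can be
-- undone. Deletion keeps the first x and the last y of every run, which is all that the energy
-- conditions between runs of sizes differing by one, and with the final part, depend on.

module Submission where

open import Level using (0ℓ)
open import Data.Nat using (ℕ; zero; suc; _∸_; _+_; _≤_; _<_; _≤ᵇ_; _<ᵇ_; z≤n; s≤s)
import Data.Nat.Properties as ℕP
import Data.Nat.ListAction.Properties as ListAction
open import Data.Integer as ℤ using (ℤ; +_; ∣_∣)
import Data.Integer.Properties as ℤP
open import Data.Bool using (Bool; true; false; if_then_else_; _∧_)
open import Data.Unit using (⊤; tt)
open import Data.Empty using (⊥; ⊥-elim)
open import Data.Fin as Fin using (Fin; toℕ; opposite; _↑ˡ_)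
open import Data.Fin.Properties using (toℕ<n; toℕ-↑ˡ; opposite-prop; toℕ-injective; toℕ-fromℕ<) renaming (_≟_ to _≟F_)
open import Data.Product using (Σ; ∃; ∃₂; _×_; _,_; proj₁; proj₂; map₁; map₂; uncurry)
open import Data.Sum using (_⊎_; inj₁; inj₂)
open import Data.Maybe using (Maybe; just; nothing)
open import Data.These using (These; this; that; these)
open import Data.List using (List; []; _∷_; _++_; map; replicate; length; filter; span; break; _∷ʳ_; initLast; _∷ʳ′_)
import Data.List.Properties as ListP
open import Data.List.NonEmpty as List⁺ using (List⁺; _∷_; toList)
open import Data.List.Relation.Unary.All as All using (All; []; _∷_)
import Data.List.Relation.Unary.All.Properties as AllP
open import Data.List.Relation.Unary.Linked as Linked using (Linked; []; [-]; _∷_)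
import Data.List.Relation.Unary.Linked.Properties as LinkedP
open import Data.List.Relation.Binary.Permutation.Propositional using (_↭_; ↭-reflexive)
import Data.List.Relation.Binary.Permutation.Propositional.Properties as Perm
open import Function using (_∘_; const)
open import Relation.Nullary using (Dec; yes; no; ¬_; contradiction)
open import Relation.Nullary.Reflects using (ofʸ; ofⁿ)
open import Relation.Nullary.Decidable using (recompute; decidable-stable; ¬?; _×-dec_)
open import Relation.Unary using (Pred; Decidable)
open import Relation.Binary using (Rel; Transitive; Tri; tri<; tri≈; tri>)
open import Relation.Binary.PropositionalEquality
open import Defs

-- Energy formulas

indicator : Bool → ℕ
indicator c = if c then 1 else 0

indicator≤1 : ∀ c → indicator c ≤ 1
indicator≤1 true = s≤s z≤n
indicator≤1 false = z≤n

-- Defs.weakH and Defs.strictH on the indices toℕ of the letters: H computes to these.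
weakEnergy strictEnergy : ℕ → ℕ → ℕ → ℕ → ℕ
weakEnergy x y x′ y′ =
  (indicator (x′ ≤ᵇ x) + indicator (y′ ≤ᵇ y)) ∸ indicator ((y′ ≤ᵇ y) ∧ ((x <ᵇ y′) ∧ (x′ ≤ᵇ x)))
strictEnergy x y x′ y′ =
  (indicator (x′ <ᵇ x) + indicator (y′ <ᵇ y)) ∸ indicator ((y′ <ᵇ y) ∧ ((x <ᵇ y′) ∧ (x′ <ᵇ x)))

module _ (x y x′ y′ : ℕ) where

  weakEnergy≡0⇒ : weakEnergy x y x′ y′ ≡ 0 → x < x′ × y < y′
  weakEnergy≡0⇒ h with x′ ≤ᵇ x | ℕP.≤ᵇ-reflects-≤ x′ x | y′ ≤ᵇ y | ℕP.≤ᵇ-reflects-≤ y′ y | x <ᵇ y′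
  ... | false | ofⁿ x′≰x | false | ofⁿ y′≰y | _ = ℕP.≰⇒> x′≰x , ℕP.≰⇒> y′≰y
  weakEnergy≡0⇒ () | true | _ | true | _ | true
  weakEnergy≡0⇒ () | true | _ | true | _ | false
  weakEnergy≡0⇒ () | true | _ | false | _ | _
  weakEnergy≡0⇒ () | false | _ | true | _ | true
  weakEnergy≡0⇒ () | false | _ | true | _ | false

  <×<⇒weakEnergy≡0 : x < x′ → y < y′ → weakEnergy x y x′ y′ ≡ 0
  <×<⇒weakEnergy≡0 x<x′ y<y′
    with x′ ≤ᵇ x | ℕP.≤ᵇ-reflects-≤ x′ x | y′ ≤ᵇ y | ℕP.≤ᵇ-reflects-≤ y′ y | x <ᵇ y′
  ... | true | ofʸ x′≤x | _ | _ | _ = ⊥-elim (ℕP.<⇒≱ x<x′ x′≤x)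
  ... | false | _ | true | ofʸ y′≤y | _ = ⊥-elim (ℕP.<⇒≱ y<y′ y′≤y)
  ... | false | _ | false | _ | true = refl
  ... | false | _ | false | _ | false = refl

  weakEnergy≤1⇒ : weakEnergy x y x′ y′ ≤ 1 → x′ ≤ y′ → x ≤ y → x < y′
  weakEnergy≤1⇒ h x′≤y′ x≤y with x <ᵇ y′ | ℕP.<ᵇ-reflects-< x y′
  ... | true | ofʸ x<y′ = x<y′
  ... | false | ofⁿ x≮y′ with x′ ≤ᵇ x | ℕP.≤ᵇ-reflects-≤ x′ x | y′ ≤ᵇ y | ℕP.≤ᵇ-reflects-≤ y′ y
  ...   | true | _ | true | _ = ⊥-elim (ℕP.<⇒≱ (s≤s (s≤s z≤n)) h)
  ...   | true | _ | false | ofⁿ y′≰y = ⊥-elim (y′≰y (ℕP.≤-trans (ℕP.≮⇒≥ x≮y′) x≤y))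
  ...   | false | ofⁿ x′≰x | _ | _ = ⊥-elim (x′≰x (ℕP.≤-trans x′≤y′ (ℕP.≮⇒≥ x≮y′)))

  <⇒weakEnergy≤1 : x < y′ → weakEnergy x y x′ y′ ≤ 1
  <⇒weakEnergy≤1 x<y′ with x <ᵇ y′ | ℕP.<ᵇ-reflects-< x y′
  ... | false | ofⁿ x≮y′ = ⊥-elim (x≮y′ x<y′)
  ... | true | _ with x′ ≤ᵇ x | y′ ≤ᵇ y
  ...   | true | true = s≤s z≤n
  ...   | true | false = s≤s z≤n
  ...   | false | true = s≤s z≤n
  ...   | false | false = z≤n

  weakEnergy≤2 : weakEnergy x y x′ y′ ≤ 2
  weakEnergy≤2 = ℕP.≤-trans
    (ℕP.m∸n≤m (indicator (x′ ≤ᵇ x) + indicator (y′ ≤ᵇ y)) (indicator ((y′ ≤ᵇ y) ∧ ((x <ᵇ y′) ∧ (x′ ≤ᵇ x)))))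
    (ℕP.+-mono-≤ (indicator≤1 (x′ ≤ᵇ x)) (indicator≤1 (y′ ≤ᵇ y)))

  strictEnergy≡0⇒ : strictEnergy x y x′ y′ ≡ 0 → x ≤ x′ × y ≤ y′
  strictEnergy≡0⇒ h with x′ <ᵇ x | ℕP.<ᵇ-reflects-< x′ x | y′ <ᵇ y | ℕP.<ᵇ-reflects-< y′ y | x <ᵇ y′
  ... | false | ofⁿ x′≮x | false | ofⁿ y′≮y | _ = ℕP.≮⇒≥ x′≮x , ℕP.≮⇒≥ y′≮y
  strictEnergy≡0⇒ () | true | _ | true | _ | true
  strictEnergy≡0⇒ () | true | _ | true | _ | false
  strictEnergy≡0⇒ () | true | _ | false | _ | _
  strictEnergy≡0⇒ () | false | _ | true | _ | true
  strictEnergy≡0⇒ () | false | _ | true | _ | false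

  ≤×≤⇒strictEnergy≡0 : x ≤ x′ → y ≤ y′ → strictEnergy x y x′ y′ ≡ 0
  ≤×≤⇒strictEnergy≡0 x≤x′ y≤y′
    with x′ <ᵇ x | ℕP.<ᵇ-reflects-< x′ x | y′ <ᵇ y | ℕP.<ᵇ-reflects-< y′ y | x <ᵇ y′
  ... | true | ofʸ x′<x | _ | _ | _ = ⊥-elim (ℕP.<⇒≱ x′<x x≤x′)
  ... | false | _ | true | ofʸ y′<y | _ = ⊥-elim (ℕP.<⇒≱ y′<y y≤y′)
  ... | false | _ | false | _ | true = refl
  ... | false | _ | false | _ | false = refl

  strictEnergy≤1⇒ : strictEnergy x y x′ y′ ≤ 1 → x′ ≤ y′ → x ≤ y → x ≢ y′ → x < y′
  strictEnergy≤1⇒ h x′≤y′ x≤y x≢y′ with x <ᵇ y′ | ℕP.<ᵇ-reflects-< x y′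
  ... | true | ofʸ x<y′ = x<y′
  ... | false | ofⁿ x≮y′ with x′ <ᵇ x | ℕP.<ᵇ-reflects-< x′ x | y′ <ᵇ y | ℕP.<ᵇ-reflects-< y′ y
  ...   | true | _ | true | _ = ⊥-elim (ℕP.<⇒≱ (s≤s (s≤s z≤n)) h)
  ...   | true | _ | false | ofⁿ y′≮y =
    ⊥-elim (x≢y′ (ℕP.≤-antisym (ℕP.≤-trans x≤y (ℕP.≮⇒≥ y′≮y)) (ℕP.≮⇒≥ x≮y′)))
  ...   | false | ofⁿ x′≮x | _ | _ =
    ⊥-elim (x≢y′ (ℕP.≤-antisym (ℕP.≤-trans (ℕP.≮⇒≥ x′≮x) x′≤y′) (ℕP.≮⇒≥ x≮y′)))

  <⇒strictEnergy≤1 : x < y′ → strictEnergy x y x′ y′ ≤ 1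
  <⇒strictEnergy≤1 x<y′ with x <ᵇ y′ | ℕP.<ᵇ-reflects-< x y′
  ... | false | ofⁿ x≮y′ = ⊥-elim (x≮y′ x<y′)
  ... | true | _ with x′ <ᵇ x | y′ <ᵇ y
  ...   | true | true = s≤s z≤n
  ...   | true | false = s≤s z≤n
  ...   | false | true = s≤s z≤n
  ...   | false | false = z≤n

  strictEnergy≤2 : strictEnergy x y x′ y′ ≤ 2
  strictEnergy≤2 = ℕP.≤-trans
    (ℕP.m∸n≤m (indicator (x′ <ᵇ x) + indicator (y′ <ᵇ y)) (indicator ((y′ <ᵇ y) ∧ ((x <ᵇ y′) ∧ (x′ <ᵇ x)))))
    (ℕP.+-mono-≤ (indicator≤1 (x′ <ᵇ x)) (indicator≤1 (y′ <ᵇ y)))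

-- Lists and runs

module _ {A : Set} where

  lastOf : A → List A → A
  lastOf x [] = x
  lastOf _ (y ∷ ys) = lastOf y ys

  lastOf-++ : ∀ x xs y ys → lastOf x (xs ++ y ∷ ys) ≡ lastOf y ys
  lastOf-++ x [] y ys = refl
  lastOf-++ x (x′ ∷ xs) y ys = lastOf-++ x′ xs y ys

  lastOf-replicate : ∀ x k ys → lastOf x (replicate k x ++ ys) ≡ lastOf x ys
  lastOf-replicate x zero ys = refl
  lastOf-replicate x (suc k) ys = lastOf-replicate x k ys

  All-lastOf : ∀ {P : Pred A 0ℓ} x xs → All P (x ∷ xs) → P (lastOf x xs)
  All-lastOf x [] (px ∷ _) = px
  All-lastOf x (y ∷ ys) (_ ∷ pys) = All-lastOf y ys pys

  All-∷ʳ⁻ : ∀ {P : Pred A 0ℓ} xs {z} → All P (xs ∷ʳ z) → P z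
  All-∷ʳ⁻ [] (pz ∷ _) = pz
  All-∷ʳ⁻ (_ ∷ xs) (_ ∷ ps) = All-∷ʳ⁻ xs ps

  LastRel : Rel A 0ℓ → List A → A → Set
  LastRel R [] y = ⊤
  LastRel R (x ∷ xs) y = R (lastOf x xs) y

  HeadRel : Rel A 0ℓ → A → List A → Set
  HeadRel R y [] = ⊤
  HeadRel R y (z ∷ _) = R y z

  Cross : Rel A 0ℓ → List A → List A → Set
  Cross R (x ∷ xs) (y ∷ _) = R (lastOf x xs) y
  Cross R _ _ = ⊤

  module _ {R : Rel A 0ℓ} where

    LastRel-map : ∀ {S : Rel A 0ℓ} → (∀ {x y} → R x y → S x y) → ∀ xs {y} → LastRel R xs y → LastRel S xs y
    LastRel-map f [] _ = tt
    LastRel-map f (_ ∷ _) r = f r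

    HeadRel-map : ∀ {S : Rel A 0ℓ} → (∀ {x y} → R x y → S x y) → ∀ {y} zs → HeadRel R y zs → HeadRel S y zs
    HeadRel-map f [] _ = tt
    HeadRel-map f (_ ∷ _) r = f r

    Linked-∷⁺ : ∀ {x} xs → HeadRel R x xs → Linked R xs → Linked R (x ∷ xs)
    Linked-∷⁺ [] _ _ = [-]
    Linked-∷⁺ (_ ∷ _) r l = r ∷ l

    Linked-headRel : ∀ {x} xs → Linked R (x ∷ xs) → HeadRel R x xs
    Linked-headRel [] _ = tt
    Linked-headRel (_ ∷ _) (r ∷ _) = r

    Linked-split : ∀ xs {y ys} → Linked R (xs ++ y ∷ ys) → Linked R xs × LastRel R xs y × Linked R (y ∷ ys)
    Linked-split [] l = [] , tt , l
    Linked-split (x ∷ []) (r ∷ l) = [-] , r , l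
    Linked-split (x ∷ x′ ∷ xs) (r ∷ l) with Linked-split (x′ ∷ xs) l
    ... | l₁ , r′ , l₂ = r ∷ l₁ , r′ , l₂

    Linked-join : ∀ xs {y ys} → Linked R xs → LastRel R xs y → Linked R (y ∷ ys) → Linked R (xs ++ y ∷ ys)
    Linked-join [] _ _ l = l
    Linked-join (x ∷ []) _ r l = r ∷ l
    Linked-join (x ∷ x′ ∷ xs) (r ∷ l₁) r′ l₂ = r ∷ Linked-join (x′ ∷ xs) l₁ r′ l₂

    Linked-++⁻ˡ : ∀ xs {ys} → Linked R (xs ++ ys) → Linked R xs
    Linked-++⁻ˡ [] _ = []
    Linked-++⁻ˡ (x ∷ []) _ = [-]
    Linked-++⁻ˡ (x ∷ x′ ∷ xs) (r ∷ l) = r ∷ Linked-++⁻ˡ (x′ ∷ xs) l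

    Linked-++⁻ʳ : ∀ xs {ys} → Linked R (xs ++ ys) → Linked R ys
    Linked-++⁻ʳ [] l = l
    Linked-++⁻ʳ (x ∷ xs) l = Linked-++⁻ʳ xs (Linked.tail l)

    Linked-cross : ∀ xs ys → Linked R (xs ++ ys) → Cross R xs ys
    Linked-cross [] _ _ = tt
    Linked-cross (_ ∷ _) [] _ = tt
    Linked-cross (x ∷ xs) (y ∷ ys) l = proj₁ (proj₂ (Linked-split (x ∷ xs) l))

    Linked-++⁺ : ∀ xs ys → Linked R xs → Cross R xs ys → Linked R ys → Linked R (xs ++ ys)
    Linked-++⁺ [] _ _ _ l = l
    Linked-++⁺ (x ∷ xs) [] l _ _ rewrite ListP.++-identityʳ xs = l
    Linked-++⁺ (x ∷ xs) (y ∷ ys) l₁ c l₂ = Linked-join (x ∷ xs) l₁ c l₂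

    Linked-replicate-split : ∀ {y} m zs → Linked R (y ∷ replicate m y ++ zs) → HeadRel R y zs × Linked R zs
    Linked-replicate-split zero [] l = tt , []
    Linked-replicate-split zero (z ∷ zs) (r ∷ l) = r , l
    Linked-replicate-split (suc m) zs (_ ∷ l) = Linked-replicate-split m zs l

    Linked-replicate-join : ∀ {y} m zs → R y y → HeadRel R y zs → Linked R zs → Linked R (y ∷ replicate m y ++ zs)
    Linked-replicate-join zero zs _ h l = Linked-∷⁺ zs h l
    Linked-replicate-join (suc m) zs r h l = r ∷ Linked-replicate-join m zs r h l

    Linked-∷ʳ⁺ : ∀ xs {z} → Linked R xs → All (λ x → R x z) xs → Linked R (xs ∷ʳ z)
    Linked-∷ʳ⁺ [] _ _ = [-]
    Linked-∷ʳ⁺ (x ∷ []) _ (r ∷ _) = r ∷ [-]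
    Linked-∷ʳ⁺ (x ∷ x′ ∷ xs) (r ∷ l) (_ ∷ rs) = r ∷ Linked-∷ʳ⁺ (x′ ∷ xs) l rs

    module _ (trans : Transitive R) where

      Linked⇒All-head : ∀ {y} ys → Linked R (y ∷ ys) → All (R y) ys
      Linked⇒All-head [] _ = []
      Linked⇒All-head (_ ∷ _) (r ∷ l) = LinkedP.Linked⇒All trans r l

      Linked⇒All-before : ∀ xs {y ys} → Linked R (xs ++ y ∷ ys) → All (λ x → R x y) xs
      Linked⇒All-before [] _ = []
      Linked⇒All-before (x ∷ xs) {y} {ys} l with AllP.++⁻ʳ xs (Linked⇒All-head (xs ++ y ∷ ys) l)
      ... | rxy ∷ _ = rxy ∷ Linked⇒All-before xs (Linked.tail l)

lastOf-map : ∀ {A B : Set} (f : A → B) x xs → lastOf (f x) (map f xs) ≡ f (lastOf x xs)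
lastOf-map f x [] = refl
lastOf-map f x (y ∷ ys) = lastOf-map f y ys

lastOf⁺ : {A : Set} → List⁺ A → A
lastOf⁺ (x ∷ xs) = lastOf x xs

module _ {A : Set} {Q : Pred A 0ℓ} (Q? : Decidable Q) where

  HeadNot : List A → Set
  HeadNot [] = ⊤
  HeadNot (x ∷ _) = ¬ Q x

  span-++ : ∀ xs ys → All Q xs → HeadNot ys → span Q? (xs ++ ys) ≡ (xs , ys)
  span-++ [] [] _ _ = refl
  span-++ [] (y ∷ ys) _ ¬qy with Q? y
  ... | yes qy = contradiction qy ¬qy
  ... | no _ = refl
  span-++ (x ∷ xs) ys (qx ∷ qxs) h with Q? x
  ... | yes _ = cong (λ (u , v) → (x ∷ u , v)) (span-++ xs ys qxs h)
  ... | no ¬qx = contradiction qx ¬qx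

  span-decomposition : ∀ zs → ∃₂ λ xs ys → zs ≡ xs ++ ys × All Q xs × HeadNot ys
  span-decomposition [] = [] , [] , refl , [] , tt
  span-decomposition (z ∷ zs) with Q? z
  ... | no ¬qz = [] , z ∷ zs , refl , [] , ¬qz
  ... | yes qz with span-decomposition zs
  ...   | xs , ys , refl , qxs , h = z ∷ xs , ys , refl , qz ∷ qxs , h

All≡⇒replicate : ∀ {A : Set} {b : A} xs → All (_≡ b) xs → xs ≡ replicate (length xs) b
All≡⇒replicate [] _ = refl
All≡⇒replicate (x ∷ xs) (refl ∷ eqs) = cong (x ∷_) (All≡⇒replicate xs eqs)

replicate-length : ∀ (ts : List ⊤) → replicate (length ts) tt ≡ ts
replicate-length [] = refl
replicate-length (tt ∷ ts) = cong (tt ∷_) (replicate-length ts)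

keys : {A : Set} → List (ℕ × A) → List ℕ
keys = map proj₁

interchange : ∀ {A : Set} (a b c d : List A) → (a ++ b) ++ (c ++ d) ↭ (a ++ c) ++ (b ++ d)
interchange a b c d = begin
  (a ++ b) ++ (c ++ d) ≡⟨ ListP.++-assoc a b (c ++ d) ⟩
  a ++ (b ++ (c ++ d)) ↭⟨ Perm.++⁺ˡ a (Perm.shifts b c) ⟩
  a ++ (c ++ (b ++ d)) ≡⟨ ListP.++-assoc a c (b ++ d) ⟨
  (a ++ c) ++ (b ++ d) ∎
  where open Data.List.Relation.Binary.Permutation.Propositional.PermutationReasoning

replicate-+ : ∀ {A : Set} m k (v : A) → replicate (m + k) v ≡ replicate m v ++ replicate k v
replicate-+ zero k v = refl
replicate-+ (suc m) k v = cong (v ∷_) (replicate-+ m k v)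

Descending : {B : Set} → List (ℕ × B) → Set
Descending = Linked (λ x y → proj₁ y < proj₁ x)

Descending-map₂ : ∀ {A B : Set} {f : A → B} xs → Descending xs → Descending (map (map₂ f) xs)
Descending-map₂ [] [] = []
Descending-map₂ (_ ∷ []) [-] = [-]
Descending-map₂ (_ ∷ _ ∷ _) (k ∷ d) = k ∷ Descending-map₂ _ d

module _ {B : Set} where

  Descending⇒All< : ∀ (x : ℕ × B) xs → Descending (x ∷ xs) → All (λ y → proj₁ y < proj₁ x) xs
  Descending⇒All< x = Linked⇒All-head (λ p q → ℕP.<-trans q p)

Run : Set → Set
Run A = ℕ × List⁺ A

module _ {A : Set} where

  keyed : ℕ → List A → List (ℕ × A)
  keyed v = map (v ,_)

  keys-keyed : ∀ v xs → keys (keyed v xs) ≡ replicate (length xs) v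
  keys-keyed v [] = refl
  keys-keyed v (x ∷ xs) = cong (v ∷_) (keys-keyed v xs)

  colours-keyed : ∀ v xs → map proj₂ (keyed v xs) ≡ xs
  colours-keyed v [] = refl
  colours-keyed v (x ∷ xs) = cong (x ∷_) (colours-keyed v xs)

  runList : Run A → List (ℕ × A)
  runList (v , c ∷ cs) = (v , c) ∷ keyed v cs

  ungroup : List (Run A) → List (ℕ × A)
  ungroup [] = []
  ungroup (r ∷ rs) = runList r ++ ungroup rs

  prepend : ℕ → A → List (Run A) → List (Run A)
  prepend v a [] = (v , a ∷ []) ∷ []
  prepend v a ((w , c ∷ cs) ∷ rs) with v ℕP.≟ w
  ... | yes _ = (w , a ∷ c ∷ cs) ∷ rs
  ... | no _ = (v , a ∷ []) ∷ (w , c ∷ cs) ∷ rs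

  group : List (ℕ × A) → List (Run A)
  group [] = []
  group ((v , a) ∷ xs) = prepend v a (group xs)

  ungroup-prepend : ∀ v a rs → ungroup (prepend v a rs) ≡ (v , a) ∷ ungroup rs
  ungroup-prepend v a [] = refl
  ungroup-prepend v a ((w , c ∷ cs) ∷ rs) with v ℕP.≟ w
  ... | yes refl = refl
  ... | no _ = refl

  ungroup-group : ∀ xs → ungroup (group xs) ≡ xs
  ungroup-group [] = refl
  ungroup-group ((v , a) ∷ xs) = trans (ungroup-prepend v a (group xs)) (cong ((v , a) ∷_) (ungroup-group xs))

  KeyAbove : ℕ → List (Run A) → Set
  KeyAbove v [] = ⊤
  KeyAbove v ((w , _) ∷ _) = w < v

  prepend-fresh : ∀ v a rs → KeyAbove v rs → prepend v a rs ≡ (v , a ∷ []) ∷ rs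
  prepend-fresh v a [] _ = refl
  prepend-fresh v a ((w , c ∷ cs) ∷ rs) w<v with v ℕP.≟ w
  ... | yes refl = ⊥-elim (ℕP.<-irrefl refl w<v)
  ... | no _ = refl

  group-run : ∀ v c cs ys → KeyAbove v (group ys) → group (runList (v , c ∷ cs) ++ ys) ≡ (v , c ∷ cs) ∷ group ys
  group-run v c [] ys h = prepend-fresh v c (group ys) h
  group-run v c (c′ ∷ cs) ys h rewrite group-run v c′ cs ys h with v ℕP.≟ v
  ... | yes _ = refl
  ... | no v≢v = ⊥-elim (v≢v refl)

  group-ungroup : ∀ rs → Descending rs → group (ungroup rs) ≡ rs
  group-ungroup [] _ = refl
  group-ungroup (r ∷ []) _ = group-run (proj₁ r) _ _ [] tt
  group-ungroup ((v , c ∷ cs) ∷ r ∷ rs) (r<v ∷ d) =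
    trans (group-run v c cs (ungroup (r ∷ rs)) (subst (KeyAbove v) (sym ih) r<v)) (cong ((v , c ∷ cs) ∷_) ih)
    where ih = group-ungroup (r ∷ rs) d

  KeyBelow : ℕ → List (Run A) → Set
  KeyBelow v [] = ⊤
  KeyBelow v ((w , _) ∷ _) = w ≤ v

  prepend-descending : ∀ v a rs → Descending rs → KeyBelow v rs → Descending (prepend v a rs)
  prepend-descending v a [] _ _ = [-]
  prepend-descending v a ((w , c ∷ cs) ∷ rs) d w≤v with v ℕP.≟ w
  ... | yes refl = relabel d
    where
    relabel : ∀ {cs′} → Descending ((w , cs′) ∷ rs) → Descending ((w , a ∷ c ∷ cs) ∷ rs)
    relabel [-] = [-]
    relabel (r ∷ l) = r ∷ l
  ... | no v≢w = ℕP.≤∧≢⇒< w≤v (λ w≡v → v≢w (sym w≡v)) ∷ d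

  prepend-keyBelow : ∀ v a rs {u} → v ≤ u → KeyBelow u (prepend v a rs)
  prepend-keyBelow v a [] v≤u = v≤u
  prepend-keyBelow v a ((w , c ∷ cs) ∷ rs) v≤u with v ℕP.≟ w
  ... | yes refl = v≤u
  ... | no _ = v≤u

  group-descending : ∀ xs → Linked (λ x y → proj₁ y ≤ proj₁ x) xs → Descending (group xs)
  group-descending [] _ = []
  group-descending ((v , a) ∷ []) _ = [-]
  group-descending ((v , a) ∷ (w , a′) ∷ xs) (w≤v ∷ l) =
    prepend-descending v a (group ((w , a′) ∷ xs)) (group-descending ((w , a′) ∷ xs) l)
      (prepend-keyBelow w a′ (group xs) w≤v)

  Within : Rel (ℕ × A) 0ℓ → Run A → Set
  Within R (v , c ∷ cs) = Linked (λ x y → R (v , x) (v , y)) (c ∷ cs)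

  Between : Rel (ℕ × A) 0ℓ → Run A → Run A → Set
  Between R (v , c ∷ cs) (v′ , c′ ∷ _) = R (v , lastOf c cs) (v′ , c′)

  module _ {R : Rel (ℕ × A) 0ℓ} where

    lastOf-runList : ∀ v c cs → lastOf (v , c) (keyed v cs) ≡ (v , lastOf c cs)
    lastOf-runList v c [] = refl
    lastOf-runList v c (c′ ∷ cs) = lastOf-runList v c′ cs

    Linked-ungroup⁺ : ∀ rs → All (Within R) rs → Linked (Between R) rs → Linked R (ungroup rs)
    Linked-ungroup⁺ [] _ _ = []
    Linked-ungroup⁺ ((v , c ∷ cs) ∷ rs) (w ∷ ws) bs =
      Linked-++⁺ (runList (v , c ∷ cs)) (ungroup rs) (LinkedP.map⁺ w) (cross rs bs) (Linked-ungroup⁺ rs ws (Linked.tail bs))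
      where
      cross : ∀ rs → Linked (Between R) ((v , c ∷ cs) ∷ rs) → Cross R (runList (v , c ∷ cs)) (ungroup rs)
      cross [] _ = tt
      cross ((v′ , c′ ∷ cs′) ∷ rs) (b ∷ _) = subst (λ z → R z (v′ , c′)) (sym (lastOf-runList v c cs)) b

    Linked-ungroup⁻ : ∀ rs → Linked R (ungroup rs) → All (Within R) rs × Linked (Between R) rs
    Linked-ungroup⁻ [] _ = [] , []
    Linked-ungroup⁻ ((v , c ∷ cs) ∷ rs) l with Linked-ungroup⁻ rs (Linked-++⁻ʳ (runList (v , c ∷ cs)) l)
    ... | ws , bs =
      LinkedP.map⁻ (Linked-++⁻ˡ (runList (v , c ∷ cs)) l) ∷ ws ,
      between rs bs (Linked-cross (runList (v , c ∷ cs)) (ungroup rs) l)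
      where
      between : ∀ rs → Linked (Between R) rs → Cross R (runList (v , c ∷ cs)) (ungroup rs) →
        Linked (Between R) ((v , c ∷ cs) ∷ rs)
      between [] _ _ = [-]
      between ((v′ , c′ ∷ cs′) ∷ rs) bs x = subst (λ z → R z (v′ , c′)) (lastOf-runList v c cs) x ∷ bs

  RunAll : Pred (ℕ × A) 0ℓ → Run A → Set
  RunAll P (v , cs) = All (λ c → P (v , c)) (toList cs)

  module _ {P : Pred (ℕ × A) 0ℓ} where

    All-ungroup⁺ : ∀ rs → All (RunAll P) rs → All P (ungroup rs)
    All-ungroup⁺ [] _ = []
    All-ungroup⁺ ((v , c ∷ cs) ∷ rs) ((p ∷ ps) ∷ qs) = p ∷ AllP.++⁺ (AllP.map⁺ ps) (All-ungroup⁺ rs qs)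

    All-ungroup⁻ : ∀ rs → All P (ungroup rs) → All (RunAll P) rs
    All-ungroup⁻ [] _ = []
    All-ungroup⁻ ((v , c ∷ cs) ∷ rs) (p ∷ ps) =
      (p ∷ AllP.map⁻ (AllP.++⁻ˡ (keyed v cs) ps)) ∷ All-ungroup⁻ rs (AllP.++⁻ʳ (keyed v cs) ps)

Stacked : {A : Set} → Rel A 0ℓ → Rel (ℕ × A) 0ℓ
Stacked R (a , x) (a′ , x′) = a′ ≤ a × (a ≡ a′ → R x x′)

module _ {A : Set} {R : Rel A 0ℓ} where

  stacked-runs : ∀ xs → Linked (Stacked R) xs → Descending (group xs) × All (λ r → Linked R (toList (proj₂ r))) (group xs)
  stacked-runs xs l =
    group-descending xs (Linked.map proj₁ l) ,
    All.map within (proj₁ (Linked-ungroup⁻ (group xs) (subst (Linked (Stacked R)) (sym (ungroup-group xs)) l)))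
    where
    within : ∀ {r} → Within (Stacked R) r → Linked R (toList (proj₂ r))
    within {v , c ∷ cs} w = Linked.map (λ s → proj₂ s refl) w

Descent : {A : Set} → Rel A 0ℓ → Rel A 0ℓ → Rel (ℕ × A) 0ℓ
Descent S O (a , x) (a′ , x′) = a′ ≤ a × (a ≡ a′ → S x x′) × (a ≡ suc a′ → O x x′)

module _ {A : Set} {S O : Rel A 0ℓ} where

  Descent⇒Stacked : ∀ {x y} → Descent S O x y → Stacked S x y
  Descent⇒Stacked (a′≤a , same , _) = a′≤a , same

  Descent-trans : Transitive S → (∀ {x y z} → S x y → O y z → O x z) → (∀ {x y z} → O x y → S y z → O x z) →
    Transitive (Descent S O)
  Descent-trans S-trans SO⇒O OS⇒O {a , x} {b , y} {c , z} (b≤a , s₁ , o₁) (c≤b , s₂ , o₂) =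
    ℕP.≤-trans c≤b b≤a , same , one
    where
    same : a ≡ c → S x z
    same refl = let a≡b = ℕP.≤-antisym b≤a c≤b in S-trans (s₁ (sym a≡b)) (s₂ a≡b)
    one : a ≡ suc c → O x z
    one refl with ℕP.m≤n⇒m<n∨m≡n b≤a
    ... | inj₂ b≡a = SO⇒O (s₁ (sym b≡a)) (o₂ b≡a)
    ... | inj₁ b<a = OS⇒O (o₁ (cong suc (sym b≡c))) (s₂ b≡c)
      where
      b≡c : b ≡ c
      b≡c = ℕP.≤-antisym (ℕP.≤-pred b<a) c≤b

module _ {A : Set} where

  ungroup-nonIncreasing : ∀ (rs : List (Run A)) → Descending rs → Linked (λ x y → proj₁ y ≤ proj₁ x) (ungroup rs)
  ungroup-nonIncreasing rs d = Linked-ungroup⁺ rs (All.universal within rs) (Linked.map (λ {r} {r′} → between r r′) d)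
    where
    within : ∀ r → Within (λ x y → proj₁ y ≤ proj₁ x) r
    within (v , c ∷ cs) = constant c cs
      where
      constant : ∀ c cs → Linked (λ x y → v ≤ v) (c ∷ cs)
      constant c [] = [-]
      constant c (c′ ∷ cs) = ℕP.≤-refl ∷ constant c′ cs
    between : ∀ r r′ → proj₁ r′ < proj₁ r → Between (λ x y → proj₁ y ≤ proj₁ x) r r′
    between (v , _ ∷ _) (v′ , _ ∷ _) v′<v = ℕP.<⇒≤ v′<v

-- Merging runs

module _ {X Y : Set} where

  -- merge avoids `with`, which would hide its lexicographic recursion from the termination checker.
  private
    byComparison : ∀ {v w} {L : Set} → Tri (v < w) (v ≡ w) (w < v) → L → L → L → L
    byComparison (tri< _ _ _) l _ _ = l
    byComparison (tri≈ _ _ _) _ l _ = l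
    byComparison (tri> _ _ _) _ _ l = l

    byComparison-elim : ∀ {v w} {L : Set} (P : L → Set) (t : Tri (v < w) (v ≡ w) (w < v)) {l₁ l₂ l₃} →
      (v < w → P l₁) → (v ≡ w → P l₂) → (w < v → P l₃) → P (byComparison t l₁ l₂ l₃)
    byComparison-elim P (tri< v<w _ _) f _ _ = f v<w
    byComparison-elim P (tri≈ _ v≡w _) _ f _ = f v≡w
    byComparison-elim P (tri> _ _ w<v) _ _ f = f w<v

  merge : List (ℕ × X) → List (ℕ × Y) → List (ℕ × These X Y)
  merge [] ys = map (map₂ that) ys
  merge xs@(_ ∷ _) [] = map (map₂ this) xs
  merge xxs@((v , x) ∷ xs) yys@((w , y) ∷ ys) = byComparison (ℕP.<-cmp v w)
    ((w , that y) ∷ merge xxs ys) ((v , these x y) ∷ merge xs ys) ((v , this x) ∷ merge xs yys)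

  lefts : List (ℕ × These X Y) → List (ℕ × X)
  lefts [] = []
  lefts ((v , this x) ∷ es) = (v , x) ∷ lefts es
  lefts ((v , that _) ∷ es) = lefts es
  lefts ((v , these x _) ∷ es) = (v , x) ∷ lefts es

  rights : List (ℕ × These X Y) → List (ℕ × Y)
  rights [] = []
  rights ((v , this _) ∷ es) = rights es
  rights ((v , that y) ∷ es) = (v , y) ∷ rights es
  rights ((v , these _ y) ∷ es) = (v , y) ∷ rights es

  lefts-that : ∀ ys → lefts (map (map₂ that) ys) ≡ []
  lefts-that [] = refl
  lefts-that (_ ∷ ys) = lefts-that ys

  lefts-this : ∀ xs → lefts (map (map₂ this) xs) ≡ xs
  lefts-this [] = refl
  lefts-this (x ∷ xs) = cong (x ∷_) (lefts-this xs)

  rights-that : ∀ ys → rights (map (map₂ that) ys) ≡ ys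
  rights-that [] = refl
  rights-that (y ∷ ys) = cong (y ∷_) (rights-that ys)

  rights-this : ∀ xs → rights (map (map₂ this) xs) ≡ []
  rights-this [] = refl
  rights-this (_ ∷ xs) = rights-this xs

  lefts-merge : ∀ xs ys → lefts (merge xs ys) ≡ xs
  lefts-merge [] ys = lefts-that ys
  lefts-merge (x ∷ xs) [] = lefts-this (x ∷ xs)
  lefts-merge ((v , x) ∷ xs) ((w , y) ∷ ys) = byComparison-elim (λ l → lefts l ≡ (v , x) ∷ xs) (ℕP.<-cmp v w)
    (λ _ → lefts-merge ((v , x) ∷ xs) ys)
    (λ _ → cong ((v , x) ∷_) (lefts-merge xs ys))
    (λ _ → cong ((v , x) ∷_) (lefts-merge xs ((w , y) ∷ ys)))

  rights-merge : ∀ xs ys → rights (merge xs ys) ≡ ys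
  rights-merge [] ys = rights-that ys
  rights-merge (x ∷ xs) [] = rights-this (x ∷ xs)
  rights-merge ((v , x) ∷ xs) ((w , y) ∷ ys) = byComparison-elim (λ l → rights l ≡ (w , y) ∷ ys) (ℕP.<-cmp v w)
    (λ _ → cong ((w , y) ∷_) (rights-merge ((v , x) ∷ xs) ys))
    (λ v≡w → cong₂ (λ u → (u , y) ∷_) v≡w (rights-merge xs ys))
    (λ _ → rights-merge xs ((w , y) ∷ ys))

  Sides : Pred (ℕ × X) 0ℓ → Pred (ℕ × Y) 0ℓ → Pred (ℕ × These X Y) 0ℓ
  Sides P Q (v , this x) = P (v , x)
  Sides P Q (v , that y) = Q (v , y)
  Sides P Q (v , these x y) = P (v , x) × Q (v , y)

  module _ {P : Pred (ℕ × X) 0ℓ} {Q : Pred (ℕ × Y) 0ℓ} where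

    merge-Sides : ∀ xs ys → All P xs → All Q ys → All (Sides P Q) (merge xs ys)
    merge-Sides [] ys _ qs = AllP.map⁺ qs
    merge-Sides (x ∷ xs) [] ps _ = AllP.map⁺ ps
    merge-Sides ((v , x) ∷ xs) ((w , y) ∷ ys) (p ∷ ps) (q ∷ qs) = byComparison-elim (All (Sides P Q)) (ℕP.<-cmp v w)
      (λ _ → q ∷ merge-Sides ((v , x) ∷ xs) ys (p ∷ ps) qs)
      (λ v≡w → (p , subst (λ u → Q (u , y)) (sym v≡w) q) ∷ merge-Sides xs ys ps qs)
      (λ _ → p ∷ merge-Sides xs ((w , y) ∷ ys) ps (q ∷ qs))

    lefts-Sides : ∀ es → All (Sides P Q) es → All P (lefts es)
    lefts-Sides [] _ = []
    lefts-Sides ((v , this x) ∷ es) (p ∷ ss) = p ∷ lefts-Sides es ss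
    lefts-Sides ((v , that y) ∷ es) (_ ∷ ss) = lefts-Sides es ss
    lefts-Sides ((v , these x y) ∷ es) ((p , _) ∷ ss) = p ∷ lefts-Sides es ss

    rights-Sides : ∀ es → All (Sides P Q) es → All Q (rights es)
    rights-Sides [] _ = []
    rights-Sides ((v , this x) ∷ es) (_ ∷ ss) = rights-Sides es ss
    rights-Sides ((v , that y) ∷ es) (q ∷ ss) = q ∷ rights-Sides es ss
    rights-Sides ((v , these x y) ∷ es) ((_ , q) ∷ ss) = q ∷ rights-Sides es ss

  KeyPred : {B : Set} → Pred ℕ 0ℓ → Pred (ℕ × B) 0ℓ
  KeyPred K (v , _) = K v

  All-keys : ∀ {K : Pred ℕ 0ℓ} es → All (KeyPred K) es → All (Sides (KeyPred K) (KeyPred K)) es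
  All-keys [] _ = []
  All-keys ((v , this x) ∷ es) (k ∷ ks) = k ∷ All-keys es ks
  All-keys ((v , that y) ∷ es) (k ∷ ks) = k ∷ All-keys es ks
  All-keys ((v , these x y) ∷ es) (k ∷ ks) = (k , k) ∷ All-keys es ks

  Sides-keys : ∀ {K : Pred ℕ 0ℓ} es → All (Sides (KeyPred K) (KeyPred K)) es → All (KeyPred K) es
  Sides-keys [] _ = []
  Sides-keys ((v , this x) ∷ es) (k ∷ ks) = k ∷ Sides-keys es ks
  Sides-keys ((v , that y) ∷ es) (k ∷ ks) = k ∷ Sides-keys es ks
  Sides-keys ((v , these x y) ∷ es) ((k , _) ∷ ks) = k ∷ Sides-keys es ks

  keysBelow-merge : ∀ {u} xs ys → All (KeyPred (_< u)) xs → All (KeyPred (_< u)) ys → All (KeyPred (_< u)) (merge xs ys)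
  keysBelow-merge xs ys kx ky = Sides-keys (merge xs ys) (merge-Sides xs ys kx ky)

  keysBelow⇒HeadRel : ∀ {B : Set} {u} {b : B} es → All (KeyPred (_< u)) es → HeadRel (λ a c → proj₁ c < proj₁ a) (u , b) es
  keysBelow⇒HeadRel [] _ = tt
  keysBelow⇒HeadRel (_ ∷ _) (k ∷ _) = k

  merge-descending : ∀ xs ys → Descending xs → Descending ys → Descending (merge xs ys)
  merge-descending [] ys _ dy = LinkedP.map⁺ dy
  merge-descending (x ∷ xs) [] dx _ = LinkedP.map⁺ dx
  merge-descending ((v , x) ∷ xs) ((w , y) ∷ ys) dx dy = byComparison-elim Descending (ℕP.<-cmp v w)
    (λ v<w → Linked-∷⁺ _ (keysBelow⇒HeadRel (merge ((v , x) ∷ xs) ys)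
       (keysBelow-merge ((v , x) ∷ xs) ys (v<w ∷ All.map (λ z<v → ℕP.<-trans z<v v<w) (Descending⇒All< _ xs dx))
         (Descending⇒All< _ ys dy)))
       (merge-descending ((v , x) ∷ xs) ys dx (Linked.tail dy)))
    (λ v≡w → Linked-∷⁺ _ (keysBelow⇒HeadRel (merge xs ys) (keysBelow-merge xs ys (Descending⇒All< _ xs dx)
       (subst (λ u → All (KeyPred (_< u)) ys) (sym v≡w) (Descending⇒All< _ ys dy))))
       (merge-descending xs ys (Linked.tail dx) (Linked.tail dy)))
    (λ w<v → Linked-∷⁺ _ (keysBelow⇒HeadRel (merge xs ((w , y) ∷ ys))
       (keysBelow-merge xs ((w , y) ∷ ys) (Descending⇒All< _ xs dx)
         (w<v ∷ All.map (λ z<w → ℕP.<-trans z<w w<v) (Descending⇒All< _ ys dy))))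
       (merge-descending xs ((w , y) ∷ ys) (Linked.tail dx) dy))

  merge-[]ʳ : ∀ xs → merge xs [] ≡ map (map₂ this) xs
  merge-[]ʳ [] = refl
  merge-[]ʳ (_ ∷ _) = refl

  merge-thisFirst : ∀ v x xs ys → All (KeyPred (_< v)) ys → merge ((v , x) ∷ xs) ys ≡ (v , this x) ∷ merge xs ys
  merge-thisFirst v x xs [] _ = cong ((v , this x) ∷_) (sym (merge-[]ʳ xs))
  merge-thisFirst v x xs ((w , y) ∷ ys) (w<v ∷ _) with ℕP.<-cmp v w
  ... | tri< _ _ w≮v = ⊥-elim (w≮v w<v)
  ... | tri≈ _ _ w≮v = ⊥-elim (w≮v w<v)
  ... | tri> _ _ _ = refl

  merge-thatFirst : ∀ w y xs ys → All (KeyPred (_< w)) xs → merge xs ((w , y) ∷ ys) ≡ (w , that y) ∷ merge xs ys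
  merge-thatFirst w y [] ys _ = refl
  merge-thatFirst w y ((v , x) ∷ xs) ys (v<w ∷ _) with ℕP.<-cmp v w
  ... | tri< _ _ _ = refl
  ... | tri≈ v≮w _ _ = ⊥-elim (v≮w v<w)
  ... | tri> v≮w _ _ = ⊥-elim (v≮w v<w)

  merge-theseFirst : ∀ v x y xs ys → merge ((v , x) ∷ xs) ((v , y) ∷ ys) ≡ (v , these x y) ∷ merge xs ys
  merge-theseFirst v x y xs ys with ℕP.<-cmp v v
  ... | tri< v<v _ _ = ⊥-elim (ℕP.<-irrefl refl v<v)
  ... | tri≈ _ _ _ = refl
  ... | tri> _ _ v<v = ⊥-elim (ℕP.<-irrefl refl v<v)

  lefts-keysBelow : ∀ {u} es → All (KeyPred (_< u)) es → All (KeyPred (_< u)) (lefts es)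
  lefts-keysBelow es k = lefts-Sides es (All-keys es k)

  rights-keysBelow : ∀ {u} es → All (KeyPred (_< u)) es → All (KeyPred (_< u)) (rights es)
  rights-keysBelow es k = rights-Sides es (All-keys es k)

  merge-lefts-rights : ∀ es → Descending es → merge (lefts es) (rights es) ≡ es
  merge-lefts-rights [] _ = refl
  merge-lefts-rights ((v , this x) ∷ es) d =
    trans (merge-thisFirst v x (lefts es) (rights es) (rights-keysBelow es (Descending⇒All< _ es d)))
          (cong ((v , this x) ∷_) (merge-lefts-rights es (Linked.tail d)))
  merge-lefts-rights ((v , that y) ∷ es) d =
    trans (merge-thatFirst v y (lefts es) (rights es) (lefts-keysBelow es (Descending⇒All< _ es d)))
          (cong ((v , that y) ∷_) (merge-lefts-rights es (Linked.tail d)))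
  merge-lefts-rights ((v , these x y) ∷ es) d =
    trans (merge-theseFirst v x y (lefts es) (rights es))
          (cong ((v , these x y) ∷_) (merge-lefts-rights es (Linked.tail d)))

  lefts-descending : ∀ es → Descending es → Descending (lefts es)
  lefts-descending [] _ = []
  lefts-descending ((v , this x) ∷ es) d =
    Linked-∷⁺ (lefts es) (keysBelow⇒HeadRel (lefts es) (lefts-keysBelow es (Descending⇒All< _ es d)))
      (lefts-descending es (Linked.tail d))
  lefts-descending ((v , that y) ∷ es) d = lefts-descending es (Linked.tail d)
  lefts-descending ((v , these x y) ∷ es) d =
    Linked-∷⁺ (lefts es) (keysBelow⇒HeadRel (lefts es) (lefts-keysBelow es (Descending⇒All< _ es d)))
      (lefts-descending es (Linked.tail d))

  rights-descending : ∀ es → Descending es → Descending (rights es)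
  rights-descending [] _ = []
  rights-descending ((v , this x) ∷ es) d = rights-descending es (Linked.tail d)
  rights-descending ((v , that y) ∷ es) d =
    Linked-∷⁺ (rights es) (keysBelow⇒HeadRel (rights es) (rights-keysBelow es (Descending⇒All< _ es d)))
      (rights-descending es (Linked.tail d))
  rights-descending ((v , these x y) ∷ es) d =
    Linked-∷⁺ (rights es) (keysBelow⇒HeadRel (rights es) (rights-keysBelow es (Descending⇒All< _ es d)))
      (rights-descending es (Linked.tail d))

Gap : {A : Set} → Rel A 0ℓ → Rel (ℕ × A) 0ℓ
Gap C (v , x) (v′ , x′) = v′ < v × (v ≡ suc v′ → C x x′)

module _ {X Y : Set} where

  leftPart : These X Y → Maybe X
  leftPart (this x) = just x
  leftPart (that _) = nothing
  leftPart (these x _) = just x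

  BothPresent : Rel X 0ℓ → Rel (Maybe X) 0ℓ
  BothPresent C (just x) (just x′) = C x x′
  BothPresent C _ _ = ⊤

  OnLefts : Rel X 0ℓ → Rel (These X Y) 0ℓ
  OnLefts C t t′ = BothPresent C (leftPart t) (leftPart t′)

  module _ {C : Rel X 0ℓ} where

    OnLefts-thatʳ : ∀ t y → OnLefts C t (that y)
    OnLefts-thatʳ (this _) _ = tt
    OnLefts-thatʳ (that _) _ = tt
    OnLefts-thatʳ (these _ _) _ = tt

    private
      skipThat : ∀ {e v′ y es} → Linked (Gap (OnLefts C)) (e ∷ (v′ , that y) ∷ es) → Linked (Gap (OnLefts C)) (e ∷ es)
      skipThat {v , t} (_ ∷ [-]) = [-]
      skipThat {v , t} {v′} ((v′<v , _) ∷ (v″<v′ , _) ∷ l) =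
        (ℕP.<-trans v″<v′ v′<v ,
         λ v≡1+v″ → ⊥-elim (ℕP.<⇒≱ v″<v′ (ℕP.≤-pred (subst (v′ <_) v≡1+v″ v′<v)))) ∷ l

      leftHead : ∀ {v t x} es → leftPart t ≡ just x → Linked (Gap (OnLefts C)) ((v , t) ∷ es) →
        HeadRel (Gap C) (v , x) (lefts es)
      leftHead [] _ _ = tt
      leftHead ((v′ , that y) ∷ es) eq l = leftHead es eq (skipThat l)
      leftHead ((v′ , this x′) ∷ es) eq ((v′<v , f) ∷ _) = v′<v , λ e → subst (λ m → BothPresent C m (just x′)) eq (f e)
      leftHead ((v′ , these x′ _) ∷ es) eq ((v′<v , f) ∷ _) = v′<v , λ e → subst (λ m → BothPresent C m (just x′)) eq (f e)

    lefts-Gap : ∀ es → Linked (Gap (OnLefts C)) es → Linked (Gap C) (lefts es)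
    lefts-Gap [] _ = []
    lefts-Gap ((v , this x) ∷ es) l = Linked-∷⁺ (lefts es) (leftHead es refl l) (lefts-Gap es (Linked.tail l))
    lefts-Gap ((v , that y) ∷ es) l = lefts-Gap es (Linked.tail l)
    lefts-Gap ((v , these x y) ∷ es) l = Linked-∷⁺ (lefts es) (leftHead es refl l) (lefts-Gap es (Linked.tail l))

    private
      leftsTail : ∀ {R : Rel (ℕ × X) 0ℓ} (e : ℕ × These X Y) es → Linked R (lefts (e ∷ es)) → Linked R (lefts es)
      leftsTail (v , this x) es l = Linked.tail l
      leftsTail (v , that y) es l = l
      leftsTail (v , these x y) es l = Linked.tail l

      adjacentLefts : ∀ {v v′} (t t′ : These X Y) es → Linked (Gap C) (lefts ((v , t) ∷ (v′ , t′) ∷ es)) →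
        v ≡ suc v′ → OnLefts C t t′
      adjacentLefts (that _) _ _ _ _ = tt
      adjacentLefts (this _) (that _) _ _ _ = tt
      adjacentLefts (these _ _) (that _) _ _ _ = tt
      adjacentLefts (this _) (this _) _ (g ∷ _) = proj₂ g
      adjacentLefts (this _) (these _ _) _ (g ∷ _) = proj₂ g
      adjacentLefts (these _ _) (this _) _ (g ∷ _) = proj₂ g
      adjacentLefts (these _ _) (these _ _) _ (g ∷ _) = proj₂ g

    Gap-onLefts : ∀ es → Descending es → Linked (Gap C) (lefts es) → Linked (Gap (OnLefts C)) es
    Gap-onLefts [] _ _ = []
    Gap-onLefts (_ ∷ []) _ _ = [-]
    Gap-onLefts ((v , t) ∷ (v′ , t′) ∷ es) (v′<v ∷ d) l =
      (v′<v , adjacentLefts t t′ es l) ∷ Gap-onLefts ((v′ , t′) ∷ es) d (leftsTail (v , t) ((v′ , t′) ∷ es) l)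

-- Pairs of letters

odd≢even : ∀ a m → suc (a + a) ≢ m + m
odd≢even zero zero ()
odd≢even zero (suc m) e rewrite ℕP.+-suc m m with e
... | ()
odd≢even (suc a) zero ()
odd≢even (suc a) (suc m) e rewrite ℕP.+-suc a a | ℕP.+-suc m m = odd≢even a m (ℕP.suc-injective (ℕP.suc-injective e))

module Coordinates (n : ℕ) where

  P : Set
  P = Pair n

  X Y : P → ℕ
  X p = toℕ (fst p)
  Y p = toℕ (snd p)

  X≤Y : ∀ p → X p ≤ Y p
  X≤Y ⟨ x , y ∣ x≤y ⟩ = recompute (toℕ x ℕP.≤? toℕ y) x≤y

  pair-≡ℕ : ∀ {p q} → X p ≡ X q → Y p ≡ Y q → p ≡ q
  pair-≡ℕ x≡ y≡ = pair-≡ (toℕ-injective x≡) (toℕ-injective y≡)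

  -- Mirror a b: the letters of indices a and b are each other's bar.
  record Mirror (a b : ℕ) : Set where
    constructor mirror
    field mirror-sum : suc (a + b) ≡ n + n
  open Mirror public

  mirror-opposite : ∀ (y : Letter n) → Mirror (toℕ (opposite y)) (toℕ y)
  mirror-opposite y = mirror (begin
      suc (toℕ (opposite y) + toℕ y) ≡⟨ cong (λ z → suc (z + toℕ y)) (opposite-prop y) ⟩
      suc ((n + n ∸ suc (toℕ y)) + toℕ y) ≡⟨ ℕP.+-suc (n + n ∸ suc (toℕ y)) (toℕ y) ⟨
      (n + n ∸ suc (toℕ y)) + suc (toℕ y) ≡⟨ ℕP.m∸n+n≡m (toℕ<n y) ⟩
      n + n ∎)
    where open ≡-Reasoning

  mirror⇒opposite : ∀ (y x : Letter n) → Mirror (toℕ x) (toℕ y) → opposite y ≡ x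
  mirror⇒opposite y x (mirror s) = toℕ-injective (begin
      toℕ (opposite y) ≡⟨ opposite-prop y ⟩
      n + n ∸ suc (toℕ y) ≡⟨ cong (_∸ suc (toℕ y)) s ⟨
      suc (toℕ x + toℕ y) ∸ suc (toℕ y) ≡⟨ ℕP.m+n∸n≡m (toℕ x) (toℕ y) ⟩
      toℕ x ∎)
    where open ≡-Reasoning

  mirror-sym : ∀ {a b} → Mirror a b → Mirror b a
  mirror-sym {a} {b} (mirror s) = mirror (trans (cong suc (ℕP.+-comm b a)) s)

  mirror-≢ : ∀ {a b} → Mirror a b → a ≢ b
  mirror-≢ {a} (mirror s) refl = odd≢even a n s

  mirror-injˡ : ∀ {a a′ c} → Mirror a c → Mirror a′ c → a ≡ a′
  mirror-injˡ {a} {a′} {c} (mirror s) (mirror s′) = ℕP.+-cancelʳ-≡ c a a′ (ℕP.suc-injective (trans s (sym s′)))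

  mirror-injʳ : ∀ {a c c′} → Mirror a c → Mirror a c′ → c ≡ c′
  mirror-injʳ {a} {c} {c′} (mirror s) (mirror s′) = ℕP.+-cancelˡ-≡ a c c′ (ℕP.suc-injective (trans s (sym s′)))

  mirror-antitone : ∀ {a c a′ c′} → Mirror a c → Mirror a′ c′ → a ≤ a′ → c′ ≤ c
  mirror-antitone {a} {c} {a′} {c′} (mirror s) (mirror s′) a≤a′ =
    ℕP.+-cancelˡ-≤ a c′ c
      (ℕP.≤-trans (ℕP.+-monoˡ-≤ c′ a≤a′) (ℕP.≤-reflexive (ℕP.suc-injective (trans s′ (sym s)))))

  mirror-strictlyAntitone : ∀ {a c a′ c′} → Mirror a c → Mirror a′ c′ → a < a′ → c′ < c
  mirror-strictlyAntitone m m′ a<a′ =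
    ℕP.≰⇒> (λ c≤c′ → ℕP.<⇒≱ a<a′ (mirror-antitone (mirror-sym m) (mirror-sym m′) c≤c′))

  -- The pairs (k , k̄), i.e. the colours b₁ … bₙ.
  Special : P → Set
  Special p = Mirror (X p) (Y p)

  Special? : ∀ p → Dec (Special p)
  Special? p with suc (X p + Y p) ℕP.≟ n + n
  ... | yes s = yes (mirror s)
  ... | no ¬s = no (λ m → ¬s (mirror-sum m))

  Above : P → Set
  Above p = n + n ≤ X p + Y p

  Above? : ∀ p → Dec (Above p)
  Above? p = n + n ℕP.≤? X p + Y p

  Above⇒¬Special : ∀ {p} → Above p → ¬ Special p
  Above⇒¬Special {p} ab (mirror s) = ℕP.<⇒≱ (subst (X p + Y p <_) s (ℕP.n<1+n _)) ab

  -- Relations are oriented along the sequences: a part e is followed by l, of energy H (l ⊗ e).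
  infix 4 _≻_ _⊒_ _⊳_

  record _≻_ (e l : P) : Set where
    constructor _,_
    field
      X< : X l < X e
      Y< : Y l < Y e

  record _⊒_ (e l : P) : Set where
    constructor _,_
    field
      X≤ : X l ≤ X e
      Y≤ : Y l ≤ Y e

  data _⊳_ (e l : P) : Set where
    strict : e ≻ l → e ⊳ l
    mirrored : Mirror (X l) (Y e) → e ⊒ l → e ⊳ l

  _≻?_ : ∀ e l → Dec (e ≻ l)
  e ≻? l with X l ℕP.<? X e | Y l ℕP.<? Y e
  ... | yes x< | yes y< = yes (x< , y<)
  ... | no x≮ | _ = no (λ s → x≮ (_≻_.X< s))
  ... | yes _ | no y≮ = no (λ s → y≮ (_≻_.Y< s))

  ≻-trans : ∀ {a b c} → a ≻ b → b ≻ c → a ≻ c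
  ≻-trans (x₁ , y₁) (x₂ , y₂) = ℕP.<-trans x₂ x₁ , ℕP.<-trans y₂ y₁

  ⊒-refl : ∀ {p} → p ⊒ p
  ⊒-refl = ℕP.≤-refl , ℕP.≤-refl

  ⊒-trans : ∀ {a b c} → a ⊒ b → b ⊒ c → a ⊒ c
  ⊒-trans (x₁ , y₁) (x₂ , y₂) = ℕP.≤-trans x₂ x₁ , ℕP.≤-trans y₂ y₁

  ⊒-antisym : ∀ {p q} → p ⊒ q → q ⊒ p → p ≡ q
  ⊒-antisym (x₁ , y₁) (x₂ , y₂) = pair-≡ℕ (ℕP.≤-antisym x₂ x₁) (ℕP.≤-antisym y₂ y₁)

  ≻⇒⊒ : ∀ {e l} → e ≻ l → e ⊒ l
  ≻⇒⊒ (x< , y<) = ℕP.<⇒≤ x< , ℕP.<⇒≤ y<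

  ⊳⇒⊒ : ∀ {e l} → e ⊳ l → e ⊒ l
  ⊳⇒⊒ (strict s) = ≻⇒⊒ s
  ⊳⇒⊒ (mirrored _ c) = c

  ⊳-refl : ∀ {b} → Special b → b ⊳ b
  ⊳-refl sb = mirrored sb ⊒-refl

  ⊳-trans : ∀ {e c l} → e ⊳ c → c ⊳ l → e ⊳ l
  ⊳-trans (strict s) (strict s′) = strict (≻-trans s s′)
  ⊳-trans (strict (x< , y<)) (mirrored _ (x≤ , y≤)) = strict (ℕP.≤-<-trans x≤ x< , ℕP.≤-<-trans y≤ y<)
  ⊳-trans (mirrored _ (x≤ , y≤)) (strict (x< , y<)) = strict (ℕP.<-≤-trans x< x≤ , ℕP.<-≤-trans y< y≤)
  ⊳-trans {e} {c} {l} (mirrored m₁ ec@(x≤₁ , y≤₁)) (mirrored m₂ cl@(x≤₂ , y≤₂)) with e ≻? l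
  ... | yes s = strict s
  ... | no ¬s = mirrored (subst (λ z → Mirror z (Y e)) (sym Xl≡Xc) m₁) (⊒-trans ec cl)
    where
    Xl≡Xc : X l ≡ X c
    Xl≡Xc with X l ℕP.<? X e
    ... | no Xl≮Xe = ℕP.≤-antisym x≤₂ (ℕP.≤-trans x≤₁ (ℕP.≮⇒≥ Xl≮Xe))
    ... | yes Xl<Xe = mirror-injˡ m₂ (subst (Mirror (X c)) (sym Yc≡Ye) m₁)
      where
      Yc≡Ye : Y c ≡ Y e
      Yc≡Ye = ℕP.≤-antisym y≤₁ (ℕP.≤-trans (ℕP.≮⇒≥ (λ y< → ¬s (Xl<Xe , y<))) y≤₂)

  H-tiles : ∀ e l → (Mirror (X l) (Y e) × H (tile l) (tile e) ≡ strictEnergy (X l) (Y l) (X e) (Y e))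
                  ⊎ (¬ Mirror (X l) (Y e) × H (tile l) (tile e) ≡ weakEnergy (X l) (Y l) (X e) (Y e))
  H-tiles e l with opposite (snd e) ≟F fst l
  ... | yes eq = inj₁ (subst (λ z → Mirror (toℕ z) (Y e)) eq (mirror-opposite (snd e)) , refl)
  ... | no ne = inj₂ ((λ m → ne (mirror⇒opposite (snd e) (fst l) m)) , refl)

  H≡0⇒⊳ : ∀ e l → H (tile l) (tile e) ≡ 0 → e ⊳ l
  H≡0⇒⊳ e l h with H-tiles e l
  ... | inj₁ (m , eq) = let (x≤ , y≤) = strictEnergy≡0⇒ (X l) (Y l) (X e) (Y e) (trans (sym eq) h) in mirrored m (x≤ , y≤)
  ... | inj₂ (_ , eq) = let (x< , y<) = weakEnergy≡0⇒ (X l) (Y l) (X e) (Y e) (trans (sym eq) h) in strict (x< , y<)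

  ⊳⇒H≡0 : ∀ e l → e ⊳ l → H (tile l) (tile e) ≡ 0
  ⊳⇒H≡0 e l el with H-tiles e l | el
  ... | inj₁ (_ , eq) | strict (x< , y<) = trans eq (≤×≤⇒strictEnergy≡0 (X l) (Y l) (X e) (Y e) (ℕP.<⇒≤ x<) (ℕP.<⇒≤ y<))
  ... | inj₁ (_ , eq) | mirrored _ (x≤ , y≤) = trans eq (≤×≤⇒strictEnergy≡0 (X l) (Y l) (X e) (Y e) x≤ y≤)
  ... | inj₂ (_ , eq) | strict (x< , y<) = trans eq (<×<⇒weakEnergy≡0 (X l) (Y l) (X e) (Y e) x< y<)
  ... | inj₂ (¬m , _) | mirrored m _ = ⊥-elim (¬m m)

  H≤1⇒ : ∀ e l → H (tile l) (tile e) ≤ 1 → X l < Y e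
  H≤1⇒ e l h with H-tiles e l
  ... | inj₁ (m , eq) = strictEnergy≤1⇒ (X l) (Y l) (X e) (Y e) (subst (_≤ 1) eq h) (X≤Y e) (X≤Y l) (mirror-≢ m)
  ... | inj₂ (_ , eq) = weakEnergy≤1⇒ (X l) (Y l) (X e) (Y e) (subst (_≤ 1) eq h) (X≤Y e) (X≤Y l)

  <⇒H≤1 : ∀ e l → X l < Y e → H (tile l) (tile e) ≤ 1
  <⇒H≤1 e l Xl<Ye with H-tiles e l
  ... | inj₁ (_ , eq) = subst (_≤ 1) (sym eq) (<⇒strictEnergy≤1 (X l) (Y l) (X e) (Y e) Xl<Ye)
  ... | inj₂ (_ , eq) = subst (_≤ 1) (sym eq) (<⇒weakEnergy≤1 (X l) (Y l) (X e) (Y e) Xl<Ye)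

  H≤2 : ∀ s t → H {n} s t ≤ 2
  H≤2 ∅ ∅ = z≤n
  H≤2 ∅ (tile _) = s≤s z≤n
  H≤2 (tile _) ∅ = s≤s z≤n
  H≤2 (tile l) (tile e) with H-tiles e l
  ... | inj₁ (_ , eq) = subst (_≤ 2) (sym eq) (strictEnergy≤2 (X l) (Y l) (X e) (Y e))
  ... | inj₂ (_ , eq) = subst (_≤ 2) (sym eq) (weakEnergy≤2 (X l) (Y l) (X e) (Y e))

  special-unique : ∀ {p q} → Special p → Special q → p ⊒ q → q ≡ p
  special-unique {p} {q} sp sq (x≤ , y≤) = pair-≡ℕ (mirror-injˡ sq (subst (Mirror (X p)) (sym Yq≡Yp) sp)) Yq≡Yp
    where
    Yq≡Yp : Y q ≡ Y p
    Yq≡Yp = ℕP.≤-antisym y≤ (mirror-antitone sq sp x≤)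

  private
    sum-≤-cases : ∀ {a a′ c c′} → a ≤ a′ → c ≤ c′ → a′ + c′ ≤ a + c → a ≡ a′ × c ≡ c′
    sum-≤-cases {a} {a′} {c} {c′} a≤ c≤ h with ℕP.m≤n⇒m<n∨m≡n a≤ | ℕP.m≤n⇒m<n∨m≡n c≤
    ... | inj₂ e₁ | inj₂ e₂ = e₁ , e₂
    ... | inj₁ a< | _ = ⊥-elim (ℕP.<⇒≱ (ℕP.+-mono-<-≤ a< c≤) h)
    ... | inj₂ _ | inj₁ c< = ⊥-elim (ℕP.<⇒≱ (ℕP.+-mono-≤-< a≤ c<) h)

  ⊒special⇒Above : ∀ {b e} → Special b → e ⊒ b → e ≢ b → Above e
  ⊒special⇒Above {b} {e} (mirror s) (x≤ , y≤) e≢b = subst (_≤ X e + Y e) s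
    (ℕP.≰⇒> (λ h → let (x≡ , y≡) = sum-≤-cases x≤ y≤ h in e≢b (pair-≡ℕ (sym x≡) (sym y≡))))

  special⊒⇒¬Above : ∀ {b l} → Special b → b ⊒ l → ¬ Above l
  special⊒⇒¬Above {b} {l} (mirror s) (x≤ , y≤) ab =
    ℕP.<⇒≱ (subst (X b + Y b <_) s (ℕP.n<1+n _)) (ℕP.≤-trans ab (ℕP.+-mono-≤ x≤ y≤))

  special⊒⇒¬Special : ∀ {b l} → Special b → b ⊒ l → l ≢ b → ¬ Special l
  special⊒⇒¬Special sb bl l≢b sl = l≢b (special-unique sb sl bl)

  ⊳⇒≻ : ∀ {e l} → ¬ Special e → ¬ Special l → e ⊳ l → e ≻ l
  ⊳⇒≻ _ _ (strict s) = s
  ⊳⇒≻ {e} {l} ¬se ¬sl (mirrored m (x≤ , y≤)) =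
    ℕP.≤∧≢⇒< x≤ (λ x≡ → ¬se (subst (λ z → Mirror z (Y e)) x≡ m)) ,
    ℕP.≤∧≢⇒< y≤ (λ y≡ → ¬sl (subst (Mirror (X l)) (sym y≡) m))

  ⊳special : ∀ {e b} → Special b → e ⊳ b → e ≢ b → X b < X e × Y b ≤ Y e
  ⊳special _ (strict (x< , y<)) _ = x< , ℕP.<⇒≤ y<
  ⊳special {e} {b} sb (mirrored m (x≤ , y≤)) e≢b =
    ℕP.≤∧≢⇒< x≤ (λ x≡ → e≢b (pair-≡ℕ (sym x≡) (sym (mirror-injʳ sb m)))) , y≤

  special⊳ : ∀ {b l} → Special b → b ⊳ l → l ≢ b → X l ≤ X b × Y l < Y b
  special⊳ _ (strict (x< , y<)) _ = ℕP.<⇒≤ x< , y<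
  special⊳ {b} {l} sb (mirrored m (x≤ , y≤)) l≢b =
    x≤ , ℕP.≤∧≢⇒< y≤ (λ y≡ → l≢b (pair-≡ℕ (mirror-injˡ m sb) y≡))

  ⊳special-Y≡ : ∀ {e b} → Special b → e ⊳ b → e ≢ b → ¬ e ≻ b → Y b ≡ Y e
  ⊳special-Y≡ sb eb e≢b ¬s = let (x< , y≤) = ⊳special sb eb e≢b in
    ℕP.≤-antisym y≤ (ℕP.≮⇒≥ (λ y< → ¬s (x< , y<)))

  special⊳-X≡ : ∀ {b q} → Special b → b ⊳ q → q ≢ b → ¬ b ≻ q → X q ≡ X b
  special⊳-X≡ sb bq q≢b ¬s = let (x≤ , y<) = special⊳ sb bq q≢b in
    ℕP.≤-antisym x≤ (ℕP.≮⇒≥ (λ x< → ¬s (x< , y<)))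

  barY barX : P → ℕ
  barY e = toℕ (opposite (snd e))
  barX q = toℕ (opposite (fst q))

  mirror-barY : ∀ e → Mirror (barY e) (Y e)
  mirror-barY e = mirror-opposite (snd e)

  mirror-barX : ∀ q → Mirror (X q) (barX q)
  mirror-barX q = mirror-sym (mirror-opposite (fst q))

  mirrorPair : Letter n → P
  mirrorPair y with toℕ (opposite y) ℕP.≤? toℕ y
  ... | yes ȳ≤y = ⟨ opposite y , y ∣ ȳ≤y ⟩
  ... | no ȳ≰y = ⟨ y , opposite y ∣ ℕP.<⇒≤ (ℕP.≰⇒> ȳ≰y) ⟩

  mirrorPair-special : ∀ y → Special (mirrorPair y)
  mirrorPair-special y with toℕ (opposite y) ℕP.≤? toℕ y
  ... | yes _ = mirror-opposite y
  ... | no _ = mirror-sym (mirror-opposite y)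

  Above⇒barY<X : ∀ e → Above e → barY e < X e
  Above⇒barY<X e ab = ℕP.+-cancelʳ-≤ (Y e) (suc (barY e)) (X e) (subst (_≤ X e + Y e) (sym (mirror-sum (mirror-barY e))) ab)

  ¬Above⇒Y≤barX : ∀ q → ¬ Above q → Y q ≤ barX q
  ¬Above⇒Y≤barX q ¬ab = ℕP.+-cancelˡ-≤ (X q) (Y q) (barX q)
    (ℕP.≤-pred (ℕP.≤-trans (ℕP.≰⇒> ¬ab) (ℕP.≤-reflexive (sym (mirror-sum (mirror-barX q))))))

  mirrorPair-snd : ∀ e → Above e → X (mirrorPair (snd e)) ≡ barY e × Y (mirrorPair (snd e)) ≡ Y e
  mirrorPair-snd e ab with toℕ (opposite (snd e)) ℕP.≤? toℕ (snd e)
  ... | yes _ = refl , refl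
  ... | no ȳ≰y = ⊥-elim (ȳ≰y (ℕP.≤-trans (ℕP.<⇒≤ (Above⇒barY<X e ab)) (X≤Y e)))

  mirrorPair-fst : ∀ q → ¬ Above q → X (mirrorPair (fst q)) ≡ X q × Y (mirrorPair (fst q)) ≡ barX q
  mirrorPair-fst q ¬ab with toℕ (opposite (fst q)) ℕP.≤? toℕ (fst q)
  ... | no _ = refl , refl
  ... | yes x̄≤x =
    ⊥-elim (mirror-≢ (mirror-barX q) (ℕP.≤-antisym (ℕP.≤-trans (X≤Y q) (¬Above⇒Y≤barX q ¬ab)) x̄≤x))

  mirrorPair-snd-⊳ : ∀ e → Above e → e ⊳ mirrorPair (snd e)
  mirrorPair-snd-⊳ e ab with mirrorPair-snd e ab
  ... | x≡ , y≡ = mirrored (subst₂ Mirror (sym x≡) refl (mirror-barY e))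
                      (subst (_≤ X e) (sym x≡) (ℕP.<⇒≤ (Above⇒barY<X e ab)) , ℕP.≤-reflexive y≡)

  mirrorPair-fst-⊳ : ∀ q → ¬ Above q → mirrorPair (fst q) ⊳ q
  mirrorPair-fst-⊳ q ¬ab with mirrorPair-fst q ¬ab
  ... | x≡ , y≡ = mirrored (subst (Mirror (X q)) (sym y≡) (mirror-barX q))
                      (ℕP.≤-reflexive (sym x≡) , subst (Y q ≤_) (sym y≡) (¬Above⇒Y≤barX q ¬ab))

  mirrorPair-snd-≡ : ∀ e {b} → Above e → Special b → Y b ≡ Y e → mirrorPair (snd e) ≡ b
  mirrorPair-snd-≡ e {b} ab sb Yb≡Ye = pair-≡ℕ
    (trans (proj₁ (mirrorPair-snd e ab)) (mirror-injˡ (mirror-barY e) (subst (Mirror (X b)) Yb≡Ye sb)))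
    (trans (proj₂ (mirrorPair-snd e ab)) (sym Yb≡Ye))

  mirrorPair-fst-≡ : ∀ q {b} → ¬ Above q → Special b → X q ≡ X b → mirrorPair (fst q) ≡ b
  mirrorPair-fst-≡ q {b} ¬ab sb Xq≡Xb = pair-≡ℕ
    (trans (proj₁ (mirrorPair-fst q ¬ab)) Xq≡Xb)
    (trans (proj₂ (mirrorPair-fst q ¬ab)) (mirror-injʳ (mirror-barX q) (subst (λ z → Mirror z (Y b)) (sym Xq≡Xb) sb)))

-- Removing and re-inserting a special pair in a run

module RunBijection (n : ℕ) where

  open Coordinates n

  NonSpecial : P → Set
  NonSpecial = ¬_ ∘ Special

  Fits : List P → P → List P → Set
  Fits pre b post = LastRel _≻_ pre b × HeadRel _≻_ b post

  fits? : ∀ pre b post → Dec (Fits pre b post)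
  fits? pre b post = lastFits? pre ×-dec headFits? post
    where
    lastFits? : ∀ pre → Dec (LastRel _≻_ pre b)
    lastFits? [] = yes tt
    lastFits? (a ∷ as) = lastOf a as ≻? b
    headFits? : ∀ post → Dec (HeadRel _≻_ b post)
    headFits? [] = yes tt
    headFits? (q ∷ _) = b ≻? q

  keepOrDrop : ∀ pre b → ℕ → ∀ post → Dec (Fits pre b post) → List P × ℕ
  keepOrDrop pre b m post (yes _) = pre ++ b ∷ post , m
  keepOrDrop pre b m post (no _) = pre ++ post , suc m

  removeCopies : List P → P → List P × List P → List P × ℕ
  removeCopies pre b (copies , post) = keepOrDrop pre b (length copies) post (fits? pre b post)

  extractFrom : List P × List P → List P × ℕ
  extractFrom (pre , []) = pre , 0
  extractFrom (pre , b ∷ rest) = removeCopies pre b (span (_≟P b) rest)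

  extractSpecial : List P → List P × ℕ
  extractSpecial qs = extractFrom (break Special? qs)

  closerSpecial : ∀ e q → Dec (X q ≤ barY e) → P
  closerSpecial e q (yes _) = mirrorPair (snd e)
  closerSpecial e q (no _) = mirrorPair (fst q)

  specialBetween : List P → List P → Maybe P
  specialBetween [] [] = nothing
  specialBetween [] (q ∷ _) = just (mirrorPair (fst q))
  specialBetween (a ∷ as) [] = just (mirrorPair (snd (lastOf a as)))
  specialBetween (a ∷ as) (q ∷ _) = just (closerSpecial (lastOf a as) q (X q ℕP.≤? barY (lastOf a as)))

  copiesOf : ℕ → Maybe P → List P
  copiesOf k nothing = []
  copiesOf k (just b) = replicate k b

  insertBetween : List P × List P → ℕ → List P
  insertBetween (A , B) k = A ++ copiesOf k (specialBetween A B) ++ B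

  insertFrom : List P → List P × List P → ℕ → List P
  insertFrom ps (pre , b ∷ rest) k = pre ++ b ∷ replicate k b ++ rest
  insertFrom ps (_ , []) k = insertBetween (span Above? ps) k

  insertSpecial : List P → ℕ → List P
  insertSpecial ps zero = ps
  insertSpecial ps (suc r) = insertFrom ps (break Special? ps) (suc r)

  break-nonSpecial : ∀ qs → All NonSpecial qs → break Special? qs ≡ (qs , [])
  break-nonSpecial qs ns = trans (cong (break Special?) (sym (ListP.++-identityʳ qs))) (span-++ (¬? ∘ Special?) qs [] ns tt)

  break-special : ∀ pre b rest → All NonSpecial pre → Special b → break Special? (pre ++ b ∷ rest) ≡ (pre , b ∷ rest)
  break-special pre b rest ns sb = span-++ (¬? ∘ Special?) pre (b ∷ rest) ns (λ ¬sb → ¬sb sb)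

  extract-nonSpecial : ∀ qs → All NonSpecial qs → extractSpecial qs ≡ (qs , 0)
  extract-nonSpecial qs ns = cong extractFrom (break-nonSpecial qs ns)

  extract-special : ∀ pre b m post → All NonSpecial pre → Special b → HeadNot (_≟P b) post →
    extractSpecial (pre ++ b ∷ replicate m b ++ post) ≡ keepOrDrop pre b m post (fits? pre b post)
  extract-special pre b m post ns sb h = begin
    extractFrom (break Special? (pre ++ b ∷ replicate m b ++ post))
      ≡⟨ cong extractFrom (break-special pre b (replicate m b ++ post) ns sb) ⟩
    removeCopies pre b (span (_≟P b) (replicate m b ++ post))
      ≡⟨ cong (removeCopies pre b) (span-++ (_≟P b) (replicate m b) post (AllP.replicate⁺ m refl) h) ⟩
    keepOrDrop pre b (length (replicate m b)) post (fits? pre b post)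
      ≡⟨ cong (λ k → keepOrDrop pre b k post (fits? pre b post)) (ListP.length-replicate m) ⟩
    keepOrDrop pre b m post (fits? pre b post) ∎
    where open ≡-Reasoning

  keepOrDrop-fits : ∀ pre b m post d → Fits pre b post → keepOrDrop pre b m post d ≡ (pre ++ b ∷ post , m)
  keepOrDrop-fits pre b m post (yes _) _ = refl
  keepOrDrop-fits pre b m post (no ¬f) f = contradiction f ¬f

  keepOrDrop-¬fits : ∀ pre b m post d → ¬ Fits pre b post → keepOrDrop pre b m post d ≡ (pre ++ post , suc m)
  keepOrDrop-¬fits pre b m post (yes f) ¬f = contradiction f ¬f
  keepOrDrop-¬fits pre b m post (no _) _ = refl

  insert-special : ∀ pre b rest k → All NonSpecial pre → Special b →
    insertSpecial (pre ++ b ∷ rest) (suc k) ≡ pre ++ b ∷ replicate (suc k) b ++ rest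
  insert-special pre b rest k ns sb = cong (λ s → insertFrom (pre ++ b ∷ rest) s (suc k)) (break-special pre b rest ns sb)

  insert-nonSpecial : ∀ A B k → All NonSpecial (A ++ B) → All Above A → HeadNot Above? B →
    insertSpecial (A ++ B) (suc k) ≡ A ++ copiesOf (suc k) (specialBetween A B) ++ B
  insert-nonSpecial A B k ns ab h = trans
    (cong (λ s → insertFrom (A ++ B) s (suc k)) (break-nonSpecial (A ++ B) ns))
    (cong (λ s → insertBetween s (suc k)) (span-++ Above? A B ab h))

  ⊳⇒⊒-chain : ∀ {qs} → Linked _⊳_ qs → Linked _⊒_ qs
  ⊳⇒⊒-chain = Linked.map ⊳⇒⊒

  nonSpecial≢special : ∀ {e b} → NonSpecial e → Special b → e ≢ b
  nonSpecial≢special ¬se sb refl = ¬se sb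

  headNotAbove : ∀ {b} → Special b → ∀ post → All (b ⊒_) post → HeadNot Above? post
  headNotAbove sb [] _ = tt
  headNotAbove sb (q ∷ _) (b⊒q ∷ _) = special⊒⇒¬Above sb b⊒q

  nonSpecialAfter : ∀ {b} → Special b → ∀ post → All (b ⊒_) post → HeadNot (_≟P b) post → Linked _⊒_ post →
    All NonSpecial post
  nonSpecialAfter sb [] _ _ _ = []
  nonSpecialAfter sb (q ∷ qs) (b⊒q ∷ b⊒qs) q≢b lq =
    special⊒⇒¬Special sb b⊒q q≢b ∷
    All.zipWith (λ (b⊒w , q⊒w) sw → q≢b (⊒-antisym (subst (q ⊒_) (special-unique sb sw b⊒w) q⊒w) b⊒q))
      (b⊒qs , Linked⇒All-head ⊒-trans qs lq)

  data ExtractView (qs : List P) : Set where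
    noSpecial : All NonSpecial qs → ExtractView qs
    special : ∀ pre b m post → qs ≡ pre ++ b ∷ replicate m b ++ post → Special b →
      All Above pre → All NonSpecial post → HeadNot (_≟P b) post → HeadNot Above? post →
      Linked _⊳_ pre → LastRel _⊳_ pre b → HeadRel _⊳_ b post → Linked _⊳_ post → ExtractView qs

  extractView : ∀ qs → Linked _⊳_ qs → ExtractView qs
  extractView qs chain with span-decomposition (¬? ∘ Special?) qs
  ... | pre , [] , refl , ns , _ = noSpecial (subst (All NonSpecial) (sym (ListP.++-identityʳ pre)) ns)
  ... | pre , b ∷ rest , refl , ns , ¬¬sb with span-decomposition (_≟P b) rest
  ...   | copies , post , refl , eqs , post≢b =
      special pre b m post eq sb above nonSpecialPost post≢b postBelow l₁ lb hb lpost
    where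
    sb = decidable-stable (Special? b) ¬¬sb
    m = length copies
    eq : pre ++ b ∷ copies ++ post ≡ pre ++ b ∷ replicate m b ++ post
    eq = cong (λ c → pre ++ b ∷ c ++ post) (All≡⇒replicate copies eqs)
    chain′ = subst (Linked _⊳_) eq chain
    splitPre = Linked-split pre chain′
    l₁ = proj₁ splitPre
    lb = proj₁ (proj₂ splitPre)
    splitCopies = Linked-replicate-split m post (proj₂ (proj₂ splitPre))
    hb = proj₁ splitCopies
    lpost = proj₂ splitCopies
    above : All Above pre
    above = All.zipWith (λ {a} (a⊒b , ¬sa) → ⊒special⇒Above sb a⊒b (nonSpecial≢special {a} ¬sa sb))
      (Linked⇒All-before ⊒-trans pre (⊳⇒⊒-chain chain′) , ns)
    below : All (b ⊒_) post
    below = AllP.++⁻ʳ (replicate m b)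
      (Linked⇒All-head ⊒-trans (replicate m b ++ post) (⊳⇒⊒-chain (proj₂ (proj₂ splitPre))))
    postBelow = headNotAbove sb post below
    nonSpecialPost = nonSpecialAfter sb post below post≢b (⊳⇒⊒-chain lpost)

  ≻⇒≢ : ∀ {e l} → e ≻ l → l ≢ e
  ≻⇒≢ (x< , _) refl = ℕP.<-irrefl refl x<

  strictlyBelow⇒HeadNot : ∀ {b} rest → All (b ≻_) rest → HeadNot (_≟P b) rest
  strictlyBelow⇒HeadNot [] _ = tt
  strictlyBelow⇒HeadNot (q ∷ _) (b≻q ∷ _) = ≻⇒≢ b≻q

  data InsertView (ps : List P) : Set where
    special : ∀ pre b rest → ps ≡ pre ++ b ∷ rest → Special b → All NonSpecial pre →
      All NonSpecial rest → HeadNot (_≟P b) rest →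
      Linked _≻_ pre → LastRel _≻_ pre b → HeadRel _≻_ b rest → Linked _≻_ rest → InsertView ps
    noSpecial : ∀ A B → ps ≡ A ++ B → All NonSpecial (A ++ B) → All Above A → HeadNot Above? B →
      Cross _≻_ A B → Linked _≻_ A → Linked _≻_ B → InsertView ps

  insertView : ∀ ps → Linked _≻_ ps → InsertView ps
  insertView ps chain with span-decomposition (¬? ∘ Special?) ps
  ... | pre , b ∷ rest , refl , ns , ¬¬sb =
    special pre b rest refl sb ns nonSpecialRest restHead l₁ lb hb lrest
    where
    sb = decidable-stable (Special? b) ¬¬sb
    splitPre = Linked-split pre chain
    l₁ = proj₁ splitPre
    lb = proj₁ (proj₂ splitPre)
    hb = Linked-headRel rest (proj₂ (proj₂ splitPre))
    lrest = Linked.tail (proj₂ (proj₂ splitPre))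
    after : All (b ≻_) rest
    after = Linked⇒All-head ≻-trans rest (proj₂ (proj₂ splitPre))
    nonSpecialRest : All NonSpecial rest
    nonSpecialRest = All.map (λ {w} b≻w → special⊒⇒¬Special sb (≻⇒⊒ b≻w) (≻⇒≢ {b} {w} b≻w)) after
    restHead = strictlyBelow⇒HeadNot rest after
  ... | AB , [] , refl , ns , _ with span-decomposition Above? AB
  ...   | A , B , refl , ab , hB =
    noSpecial A B (ListP.++-identityʳ (A ++ B)) ns ab hB
      (Linked-cross A B chain′) (Linked-++⁻ˡ A chain′) (Linked-++⁻ʳ A chain′)
    where
    chain′ = subst (Linked _≻_) (ListP.++-identityʳ (A ++ B)) chain

  record Insertable (A B : List P) (k : P) : Set where
    field
      specialK : Special k
      afterA : LastRel _⊳_ A k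
      beforeB : HeadRel _⊳_ k B
      ¬fits : ¬ Fits A k B
      sameX : A ≡ [] → HeadRel (λ k q → X k ≡ X q) k B
      sameY : B ≡ [] → LastRel (λ e k → Y k ≡ Y e) A k

  closerSpecial-insertable : ∀ {a as q B} → All Above (a ∷ as) → ¬ Above q → lastOf a as ≻ q →
    ∀ d → Insertable (a ∷ as) (q ∷ B) (closerSpecial (lastOf a as) q d)
  closerSpecial-insertable {a} {as} {q} aboveA ¬ab e≻q (yes Xq≤barYe) = record
    { specialK = mirrorPair-special (snd e)
    ; afterA = mirrorPair-snd-⊳ e ab
    ; beforeB = k⊳q
    ; ¬fits = λ ((_ , y<) , _) → ℕP.<-irrefl y≡ y<
    ; sameX = λ ()
    ; sameY = λ () }
    where
    e = lastOf a as
    ab = All-lastOf a as aboveA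
    x≡ = proj₁ (mirrorPair-snd e ab)
    y≡ = proj₂ (mirrorPair-snd e ab)
    k⊳q : mirrorPair (snd e) ⊳ q
    k⊳q with ℕP.m≤n⇒m<n∨m≡n Xq≤barYe
    ... | inj₁ x< = strict (subst (X q <_) (sym x≡) x< , subst (Y q <_) (sym y≡) (_≻_.Y< e≻q))
    ... | inj₂ x≡′ = mirrored (subst₂ Mirror (sym x≡′) (sym y≡) (mirror-barY e))
                       (subst (X q ≤_) (sym x≡) Xq≤barYe , subst (Y q ≤_) (sym y≡) (ℕP.<⇒≤ (_≻_.Y< e≻q)))
  closerSpecial-insertable {a} {as} {q} _ ¬ab e≻q (no Xq≰barYe) = record
    { specialK = mirrorPair-special (fst q)
    ; afterA = strict (subst (_< X e) (sym x≡) (_≻_.X< e≻q) ,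
        subst (_< Y e) (sym y≡) (mirror-strictlyAntitone (mirror-barY e) (mirror-barX q) (ℕP.≰⇒> Xq≰barYe)))
    ; beforeB = mirrorPair-fst-⊳ q ¬ab
    ; ¬fits = λ (_ , (x< , _)) → ℕP.<-irrefl (sym x≡) x<
    ; sameX = λ ()
    ; sameY = λ () }
    where
    e = lastOf a as
    x≡ = proj₁ (mirrorPair-fst q ¬ab)
    y≡ = proj₂ (mirrorPair-fst q ¬ab)

  specialBetween-insertable : ∀ A B → All Above A → HeadNot Above? B → Cross _≻_ A B → (A ≡ [] → B ≢ []) →
    ∃ λ k → specialBetween A B ≡ just k × Insertable A B k
  specialBetween-insertable [] [] _ _ _ ne = ⊥-elim (ne refl refl)
  specialBetween-insertable [] (q ∷ B) _ ¬ab _ _ = mirrorPair (fst q) , refl , record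
    { specialK = mirrorPair-special (fst q)
    ; afterA = tt
    ; beforeB = mirrorPair-fst-⊳ q ¬ab
    ; ¬fits = λ (_ , (x< , _)) → ℕP.<-irrefl (sym (proj₁ (mirrorPair-fst q ¬ab))) x<
    ; sameX = λ _ → proj₁ (mirrorPair-fst q ¬ab)
    ; sameY = λ () }
  specialBetween-insertable (a ∷ as) [] aboveA _ _ _ = mirrorPair (snd e) , refl , record
    { specialK = mirrorPair-special (snd e)
    ; afterA = mirrorPair-snd-⊳ e ab
    ; beforeB = tt
    ; ¬fits = λ ((_ , y<) , _) → ℕP.<-irrefl (proj₂ (mirrorPair-snd e ab)) y<
    ; sameX = λ ()
    ; sameY = λ _ → proj₂ (mirrorPair-snd e ab) }
    where
    e = lastOf a as
    ab = All-lastOf a as aboveA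
  specialBetween-insertable (a ∷ as) (q ∷ B) aboveA ¬ab e≻q _ =
    closerSpecial (lastOf a as) q d , refl , closerSpecial-insertable aboveA ¬ab e≻q d
    where
    d = X q ℕP.≤? barY (lastOf a as)

  private
    ¬×-cases : ∀ {R S : Set} → Dec R → ¬ (R × S) → ¬ R ⊎ ¬ S
    ¬×-cases (yes r) ¬rs = inj₂ (λ s → ¬rs (r , s))
    ¬×-cases (no ¬r) _ = inj₁ ¬r

  closerSpecial-recovers : ∀ {e b q} → NonSpecial e → Special b → q ≢ b → e ⊳ b → b ⊳ q → ¬ (e ≻ b × b ≻ q) →
    ∀ d → closerSpecial e q d ≡ b
  closerSpecial-recovers {e} {b} {q} ¬se sb q≢b e⊳b b⊳q ¬f (yes Xq≤barYe) =
    mirrorPair-snd-≡ e (⊒special⇒Above sb (⊳⇒⊒ e⊳b) e≢b) sb Yb≡Ye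
    where
    e≢b = nonSpecial≢special {e} ¬se sb
    Yb≡Ye : Y b ≡ Y e
    Yb≡Ye with ¬×-cases (e ≻? b) ¬f
    ... | inj₁ ¬e≻b = ⊳special-Y≡ sb e⊳b e≢b ¬e≻b
    ... | inj₂ ¬b≻q = ℕP.≤-antisym (proj₂ (⊳special sb e⊳b e≢b))
            (mirror-antitone sb (mirror-barY e) (subst (_≤ barY e) (special⊳-X≡ sb b⊳q q≢b ¬b≻q) Xq≤barYe))
  closerSpecial-recovers {e} {b} {q} ¬se sb q≢b e⊳b b⊳q ¬f (no Xq≰barYe) =
    mirrorPair-fst-≡ q (special⊒⇒¬Above sb (⊳⇒⊒ b⊳q)) sb Xq≡Xb
    where
    e≢b = nonSpecial≢special {e} ¬se sb
    Xq≡Xb : X q ≡ X b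
    Xq≡Xb with ¬×-cases (e ≻? b) ¬f
    ... | inj₂ ¬b≻q = special⊳-X≡ sb b⊳q q≢b ¬b≻q
    ... | inj₁ ¬e≻b = ⊥-elim (ℕP.<⇒≱
            (subst (_< X q) (mirror-injˡ (mirror-barY e) (subst (Mirror (X b)) (⊳special-Y≡ sb e⊳b e≢b ¬e≻b) sb)) (ℕP.≰⇒> Xq≰barYe))
            (proj₁ (special⊳ sb b⊳q q≢b)))

  specialBetween-recovers : ∀ pre b post → All NonSpecial pre → Special b → HeadNot (_≟P b) post →
    LastRel _⊳_ pre b → HeadRel _⊳_ b post → ¬ Fits pre b post → specialBetween pre post ≡ just b
  specialBetween-recovers [] b [] _ _ _ _ _ ¬f = contradiction (tt , tt) ¬f
  specialBetween-recovers [] b (q ∷ post) _ sb q≢b _ b⊳q ¬f =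
    cong just (mirrorPair-fst-≡ q (special⊒⇒¬Above sb (⊳⇒⊒ b⊳q)) sb (special⊳-X≡ sb b⊳q q≢b (λ s → ¬f (tt , s))))
  specialBetween-recovers (a ∷ as) b [] ns sb _ e⊳b _ ¬f =
    cong just (mirrorPair-snd-≡ e (⊒special⇒Above sb (⊳⇒⊒ e⊳b) e≢b) sb (⊳special-Y≡ sb e⊳b e≢b (λ s → ¬f (s , tt))))
    where
    e = lastOf a as
    e≢b = nonSpecial≢special {e} (All-lastOf a as ns) sb
  specialBetween-recovers (a ∷ as) b (q ∷ post) ns sb q≢b e⊳b b⊳q ¬f =
    cong just (closerSpecial-recovers (All-lastOf a as ns) sb q≢b e⊳b b⊳q ¬f (X q ℕP.≤? barY (lastOf a as)))

  nonSpecial-chain : ∀ {qs} → All NonSpecial qs → Linked _⊳_ qs → Linked _≻_ qs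
  nonSpecial-chain _ [] = []
  nonSpecial-chain _ [-] = [-]
  nonSpecial-chain (¬se ∷ ns@(¬sl ∷ _)) (el ∷ l) = ⊳⇒≻ ¬se ¬sl el ∷ nonSpecial-chain ns l

  HeadNot-nonSpecial : ∀ {b} → Special b → ∀ qs → All NonSpecial qs → HeadNot (_≟P b) qs
  HeadNot-nonSpecial sb [] _ = tt
  HeadNot-nonSpecial {b} sb (q ∷ _) (¬sq ∷ _) = nonSpecial≢special {q} ¬sq sb

  ++-nonEmpty : ∀ (A B : List P) → A ++ B ≢ [] → A ≡ [] → B ≢ []
  ++-nonEmpty [] B ne refl = ne

  extract-insert : ∀ ps r → Linked _≻_ ps → ps ≢ [] → extractSpecial (insertSpecial ps r) ≡ (ps , r)
  extract-insert ps r chain ne with insertView ps chain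
  ... | special pre b rest refl sb nsPre nsRest rest≢b _ lb hb _ = extracted r
    where
    extracted : ∀ r → extractSpecial (insertSpecial (pre ++ b ∷ rest) r) ≡ (pre ++ b ∷ rest , r)
    extracted zero = trans (extract-special pre b 0 rest nsPre sb rest≢b) (keepOrDrop-fits pre b 0 rest _ (lb , hb))
    extracted (suc k) = begin
      extractSpecial (insertSpecial (pre ++ b ∷ rest) (suc k))
        ≡⟨ cong extractSpecial (insert-special pre b rest k nsPre sb) ⟩
      extractSpecial (pre ++ b ∷ replicate (suc k) b ++ rest)
        ≡⟨ extract-special pre b (suc k) rest nsPre sb rest≢b ⟩
      keepOrDrop pre b (suc k) rest (fits? pre b rest)
        ≡⟨ keepOrDrop-fits pre b (suc k) rest _ (lb , hb) ⟩
      (pre ++ b ∷ rest , suc k) ∎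
      where open ≡-Reasoning
  ... | noSpecial A B refl ns ab hB cr _ _ = extracted r
    where
    extracted : ∀ r → extractSpecial (insertSpecial (A ++ B) r) ≡ (A ++ B , r)
    extracted zero = extract-nonSpecial (A ++ B) ns
    extracted (suc k) with specialBetween-insertable A B ab hB cr (++-nonEmpty A B ne)
    ... | kb , eq , ins = begin
      extractSpecial (insertSpecial (A ++ B) (suc k))
        ≡⟨ cong extractSpecial (insert-nonSpecial A B k ns ab hB) ⟩
      extractSpecial (A ++ copiesOf (suc k) (specialBetween A B) ++ B)
        ≡⟨ cong (λ m → extractSpecial (A ++ copiesOf (suc k) m ++ B)) eq ⟩
      extractSpecial (A ++ kb ∷ replicate k kb ++ B)
        ≡⟨ extract-special A kb k B (AllP.++⁻ˡ A ns) sk (HeadNot-nonSpecial sk B (AllP.++⁻ʳ A ns)) ⟩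
      keepOrDrop A kb k B (fits? A kb B)
        ≡⟨ keepOrDrop-¬fits A kb k B _ (Insertable.¬fits ins) ⟩
      (A ++ B , suc k) ∎
      where
      open ≡-Reasoning
      sk = Insertable.specialK ins

  keepOrDrop-cases : ∀ pre b m post (d : Dec (Fits pre b post)) →
    (Fits pre b post × keepOrDrop pre b m post d ≡ (pre ++ b ∷ post , m)) ⊎
    (¬ Fits pre b post × keepOrDrop pre b m post d ≡ (pre ++ post , suc m))
  keepOrDrop-cases pre b m post (yes f) = inj₁ (f , refl)
  keepOrDrop-cases pre b m post (no ¬f) = inj₂ (¬f , refl)

  insert-extract : ∀ qs → Linked _⊳_ qs → uncurry insertSpecial (extractSpecial qs) ≡ qs
  insert-extract qs chain with extractView qs chain
  ... | noSpecial ns = cong (uncurry insertSpecial) (extract-nonSpecial qs ns)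
  ... | special pre b m post refl sb ab nsPost post≢b postBelow _ lb hb _
    with keepOrDrop-cases pre b m post (fits? pre b post)
  ...   | inj₁ (_ , eq) =
    trans (cong (uncurry insertSpecial) (trans (extract-special pre b m post nsPre sb post≢b) eq)) (reinsert m)
    where
    nsPre = All.map (λ {a} → Above⇒¬Special {a}) ab
    reinsert : ∀ m → insertSpecial (pre ++ b ∷ post) m ≡ pre ++ b ∷ replicate m b ++ post
    reinsert zero = refl
    reinsert (suc k) = insert-special pre b post k nsPre sb
  ...   | inj₂ (¬f , eq) = begin
    uncurry insertSpecial (extractSpecial (pre ++ b ∷ replicate m b ++ post))
      ≡⟨ cong (uncurry insertSpecial) (trans (extract-special pre b m post nsPre sb post≢b) eq) ⟩
    insertSpecial (pre ++ post) (suc m)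
      ≡⟨ insert-nonSpecial pre post m (AllP.++⁺ nsPre nsPost) ab postBelow ⟩
    pre ++ copiesOf (suc m) (specialBetween pre post) ++ post
      ≡⟨ cong (λ k → pre ++ copiesOf (suc m) k ++ post) (specialBetween-recovers pre b post nsPre sb post≢b lb hb ¬f) ⟩
    pre ++ b ∷ replicate m b ++ post ∎
    where
    open ≡-Reasoning
    nsPre = All.map (λ {a} → Above⇒¬Special {a}) ab

  extract-valid : ∀ qs → Linked _⊳_ qs → Linked _≻_ (proj₁ (extractSpecial qs))
  extract-valid qs chain with extractView qs chain
  ... | noSpecial ns = subst (λ r → Linked _≻_ (proj₁ r)) (sym (extract-nonSpecial qs ns)) (nonSpecial-chain ns chain)
  ... | special pre b m post refl sb ab nsPost post≢b _ lPre lb hb lPost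
    with keepOrDrop-cases pre b m post (fits? pre b post)
  ...   | inj₁ ((lb≻ , hb≻) , eq) =
    subst (λ r → Linked _≻_ (proj₁ r)) (sym (trans (extract-special pre b m post nsPre sb post≢b) eq))
          (Linked-join pre (nonSpecial-chain nsPre lPre) lb≻ (Linked-∷⁺ post hb≻ (nonSpecial-chain nsPost lPost)))
    where nsPre = All.map (λ {a} → Above⇒¬Special {a}) ab
  ...   | inj₂ (_ , eq) = subst (λ r → Linked _≻_ (proj₁ r)) (sym (trans (extract-special pre b m post nsPre sb post≢b) eq))
          (Linked-++⁺ pre post (nonSpecial-chain nsPre lPre) (bridge pre post nsPre lb post≢b hb) (nonSpecial-chain nsPost lPost))
    where
    nsPre = All.map (λ {a} → Above⇒¬Special {a}) ab
    bridge : ∀ pre post → All NonSpecial pre → LastRel _⊳_ pre b → HeadNot (_≟P b) post → HeadRel _⊳_ b post →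
      Cross _≻_ pre post
    bridge [] _ _ _ _ _ = tt
    bridge (_ ∷ _) [] _ _ _ _ = tt
    bridge (a ∷ as) (q ∷ _) ns e⊳b q≢b b⊳q =
      let (x<₁ , y≤₁) = ⊳special sb e⊳b (nonSpecial≢special {lastOf a as} (All-lastOf a as ns) sb)
          (x≤₂ , y<₂) = special⊳ sb b⊳q q≢b
      in ℕP.≤-<-trans x≤₂ x<₁ , ℕP.<-≤-trans y<₂ y≤₁

  insert-valid : ∀ ps r → Linked _≻_ ps → ps ≢ [] → Linked _⊳_ (insertSpecial ps r)
  insert-valid ps zero chain _ = Linked.map strict chain
  insert-valid ps (suc k) chain ne with insertView ps chain
  ... | special pre b rest refl sb nsPre _ _ lPre lb hb lRest =
    subst (Linked _⊳_) (sym (insert-special pre b rest k nsPre sb))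
      (Linked-join pre (Linked.map strict lPre) (LastRel-map strict pre lb)
        (Linked-replicate-join (suc k) rest (⊳-refl sb) (HeadRel-map strict rest hb) (Linked.map strict lRest)))
  ... | noSpecial A B refl ns ab hB cr lA lB with specialBetween-insertable A B ab hB cr (++-nonEmpty A B ne)
  ...   | kb , eq , ins =
    subst (Linked _⊳_) (sym (trans (insert-nonSpecial A B k ns ab hB) (cong (λ m → A ++ copiesOf (suc k) m ++ B) eq)))
      (Linked-join A (Linked.map strict lA) (Insertable.afterA ins)
        (Linked-replicate-join k B (⊳-refl (Insertable.specialK ins)) (Insertable.beforeB ins) (Linked.map strict lB)))

  -- Only used on nonempty lists; 0 on the empty one.
  firstX lastY : List P → ℕ
  firstX [] = 0
  firstX (q ∷ _) = X q
  lastY [] = 0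
  lastY (q ∷ qs) = Y (lastOf q qs)

  private
    firstX-++ : ∀ pre b xs ys → firstX (pre ++ b ∷ xs) ≡ firstX (pre ++ b ∷ ys)
    firstX-++ [] b xs ys = refl
    firstX-++ (_ ∷ _) b xs ys = refl

    lastY-++ : ∀ xs y ys → lastY (xs ++ y ∷ ys) ≡ Y (lastOf y ys)
    lastY-++ [] y ys = refl
    lastY-++ (x ∷ xs) y ys = cong Y (lastOf-++ x xs y ys)

    ++∷-nonEmpty : ∀ (xs : List P) y ys → xs ++ y ∷ ys ≢ []
    ++∷-nonEmpty [] _ _ ()
    ++∷-nonEmpty (_ ∷ _) _ _ ()

  insert-nonEmpty : ∀ ps r → Linked _≻_ ps → ps ≢ [] → insertSpecial ps r ≢ []
  insert-nonEmpty ps zero _ ne = ne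
  insert-nonEmpty ps (suc k) chain ne with insertView ps chain
  ... | special pre b rest refl sb nsPre _ _ _ _ _ _ =
    subst (_≢ []) (sym (insert-special pre b rest k nsPre sb)) (++∷-nonEmpty pre b _)
  ... | noSpecial A B refl ns ab hB cr _ _ with specialBetween-insertable A B ab hB cr (++-nonEmpty A B ne)
  ...   | kb , eq , _ =
    subst (_≢ []) (sym (trans (insert-nonSpecial A B k ns ab hB) (cong (λ m → A ++ copiesOf (suc k) m ++ B) eq)))
                          (++∷-nonEmpty A kb _)

  insert-firstX : ∀ ps r → Linked _≻_ ps → ps ≢ [] → firstX (insertSpecial ps r) ≡ firstX ps
  insert-firstX ps zero _ _ = refl
  insert-firstX ps (suc k) chain ne with insertView ps chain
  ... | special pre b rest refl sb nsPre _ _ _ _ _ _ =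
    trans (cong firstX (insert-special pre b rest k nsPre sb)) (firstX-++ pre b _ rest)
  ... | noSpecial A B refl ns ab hB cr _ _ with specialBetween-insertable A B ab hB cr (++-nonEmpty A B ne)
  ...   | kb , eq , ins =
    trans (cong firstX (trans (insert-nonSpecial A B k ns ab hB) (cong (λ m → A ++ copiesOf (suc k) m ++ B) eq)))
      (firstXOf A B (++-nonEmpty A B ne) (Insertable.sameX ins))
    where
    firstXOf : ∀ A B → (A ≡ [] → B ≢ []) → (A ≡ [] → HeadRel (λ k q → X k ≡ X q) kb B) →
      firstX (A ++ kb ∷ replicate k kb ++ B) ≡ firstX (A ++ B)
    firstXOf [] [] ne _ = ⊥-elim (ne refl refl)
    firstXOf [] (q ∷ B) _ h = h refl
    firstXOf (a ∷ A) B _ _ = refl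

  insert-lastY : ∀ ps r → Linked _≻_ ps → ps ≢ [] → lastY (insertSpecial ps r) ≡ lastY ps
  insert-lastY ps zero _ _ = refl
  insert-lastY ps (suc k) chain ne with insertView ps chain
  ... | special pre b rest refl sb nsPre _ _ _ _ _ _ = begin
    lastY (insertSpecial (pre ++ b ∷ rest) (suc k)) ≡⟨ cong lastY (insert-special pre b rest k nsPre sb) ⟩
    lastY (pre ++ b ∷ replicate (suc k) b ++ rest) ≡⟨ lastY-++ pre b _ ⟩
    Y (lastOf b (replicate (suc k) b ++ rest))     ≡⟨ cong Y (lastOf-replicate b (suc k) rest) ⟩
    Y (lastOf b rest)                              ≡⟨ lastY-++ pre b rest ⟨
    lastY (pre ++ b ∷ rest) ∎
    where open ≡-Reasoning
  ... | noSpecial A B refl ns ab hB cr _ _ with specialBetween-insertable A B ab hB cr (++-nonEmpty A B ne)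
  ...   | kb , eq , ins =
    trans (cong lastY (trans (insert-nonSpecial A B k ns ab hB) (cong (λ m → A ++ copiesOf (suc k) m ++ B) eq)))
      (lastYOf A B (++-nonEmpty A B ne) (Insertable.sameY ins))
    where
    lastYOf : ∀ A B → (A ≡ [] → B ≢ []) → (B ≡ [] → LastRel (λ e k → Y k ≡ Y e) A kb) →
      lastY (A ++ kb ∷ replicate k kb ++ B) ≡ lastY (A ++ B)
    lastYOf [] [] ne _ = ⊥-elim (ne refl refl)
    lastYOf (a ∷ A) [] _ h = begin
      lastY ((a ∷ A) ++ kb ∷ replicate k kb ++ []) ≡⟨ lastY-++ (a ∷ A) kb _ ⟩
      Y (lastOf kb (replicate k kb ++ []))         ≡⟨ cong Y (lastOf-replicate kb k []) ⟩
      Y kb                                         ≡⟨ h refl ⟩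
      Y (lastOf a A)                               ≡⟨ cong (λ z → lastY (a ∷ z)) (ListP.++-identityʳ A) ⟨
      lastY ((a ∷ A) ++ []) ∎
      where open ≡-Reasoning
    lastYOf A (q ∷ B) _ _ = begin
      lastY (A ++ kb ∷ replicate k kb ++ q ∷ B) ≡⟨ lastY-++ A kb _ ⟩
      Y (lastOf kb (replicate k kb ++ q ∷ B))   ≡⟨ cong Y (lastOf-replicate kb k (q ∷ B)) ⟩
      Y (lastOf q B)                            ≡⟨ lastY-++ A q B ⟨
      lastY (A ++ q ∷ B) ∎
      where open ≡-Reasoning

  data ExtractShape (qs : List P) : Set where
    unchanged : extractSpecial qs ≡ (qs , 0) → ExtractShape qs
    kept : ∀ pre b m post → qs ≡ pre ++ b ∷ replicate m b ++ post → Special b →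
      extractSpecial qs ≡ (pre ++ b ∷ post , m) → ExtractShape qs
    dropped : ∀ pre b m post → qs ≡ pre ++ b ∷ replicate m b ++ post → Special b →
      extractSpecial qs ≡ (pre ++ post , suc m) → ExtractShape qs

  extractShape : ∀ qs → Linked _⊳_ qs → ExtractShape qs
  extractShape qs chain with extractView qs chain
  ... | noSpecial ns = unchanged (extract-nonSpecial qs ns)
  ... | special pre b m post refl sb ab _ post≢b _ _ _ _ _
    with keepOrDrop-cases pre b m post (fits? pre b post)
  ...   | inj₁ (_ , eq) = kept pre b m post refl sb (trans (extract-special pre b m post nsPre sb post≢b) eq)
    where nsPre = All.map (λ {a} → Above⇒¬Special {a}) ab
  ...   | inj₂ (_ , eq) = dropped pre b m post refl sb (trans (extract-special pre b m post nsPre sb post≢b) eq)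
    where nsPre = All.map (λ {a} → Above⇒¬Special {a}) ab

  extract-All : ∀ {Q : Pred P 0ℓ} qs → Linked _⊳_ qs → All Q qs → All Q (proj₁ (extractSpecial qs))
  extract-All qs chain qq with extractShape qs chain
  ... | unchanged eq rewrite eq = qq
  ... | kept pre b m post refl _ eq rewrite eq with AllP.++⁻ pre qq
  ...   | qPre , qb ∷ qRest = AllP.++⁺ qPre (qb ∷ AllP.++⁻ʳ (replicate m b) qRest)
  extract-All qs chain qq | dropped pre b m post refl _ eq rewrite eq with AllP.++⁻ pre qq
  ...   | qPre , qb ∷ qRest = AllP.++⁺ qPre (AllP.++⁻ʳ (replicate m b) qRest)

  private
    length-run : ∀ pre (b : P) m post → length (pre ++ b ∷ replicate m b ++ post) ≡ suc m + length (pre ++ post)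
    length-run [] b m post = cong suc (trans (ListP.length-++ (replicate m b)) (cong (_+ length post) (ListP.length-replicate m)))
    length-run (_ ∷ pre) b m post = trans (cong suc (length-run pre b m post)) (sym (ℕP.+-suc (suc m) _))

    length-middle : ∀ pre (b : P) post → length (pre ++ b ∷ post) ≡ suc (length (pre ++ post))
    length-middle [] b post = refl
    length-middle (_ ∷ pre) b post = cong suc (length-middle pre b post)

  extract-length : ∀ qs → Linked _⊳_ qs → length qs ≡ length (proj₁ (extractSpecial qs)) + proj₂ (extractSpecial qs)
  extract-length qs chain with extractShape qs chain
  ... | unchanged eq rewrite eq = sym (ℕP.+-identityʳ (length qs))
  ... | kept pre b m post refl _ eq rewrite eq | length-middle pre b post =
    trans (length-run pre b m post) (cong suc (ℕP.+-comm m (length (pre ++ post))))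
  ... | dropped pre b m post refl _ eq rewrite eq =
    trans (length-run pre b m post) (ℕP.+-comm (suc m) (length (pre ++ post)))

  extract-nonEmpty : ∀ qs → Linked _⊳_ qs → qs ≢ [] → proj₁ (extractSpecial qs) ≢ []
  extract-nonEmpty qs chain ne with extractView qs chain
  ... | noSpecial ns = subst (λ r → proj₁ r ≢ []) (sym (extract-nonSpecial qs ns)) ne
  ... | special pre b m post refl sb ab _ post≢b _ _ _ _ _ =
    subst (λ r → proj₁ r ≢ []) (sym (extract-special pre b m post (All.map (λ {a} → Above⇒¬Special {a}) ab) sb post≢b))
      (keptOrDropped (fits? pre b post))
    where
    keptOrDropped : ∀ d → proj₁ (keepOrDrop pre b m post d) ≢ []
    keptOrDropped (yes _) = ++∷-nonEmpty pre b post
    keptOrDropped (no ¬f) = nonEmpty pre post ¬f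
      where
      nonEmpty : ∀ pre post → ¬ Fits pre b post → pre ++ post ≢ []
      nonEmpty [] [] ¬f _ = ¬f (tt , tt)

-- Runs of tiles

module TileRuns (n : ℕ) where

  open Coordinates n
  open RunBijection n

  ZeroEnergy : Tile n → Tile n → Set
  ZeroEnergy c c′ = H c′ c ≡ 0

  -- A run of λ splits into the pairs kept in μ and, as a list of tt, the parts moved to ν.
  Block : Set
  Block = These (List⁺ P) (List⁺ ⊤)

  -- The last clause of fromExtraction and of tilesOf are junk: on ⊳-chains, extractSpecial and
  -- insertSpecial never produce an empty list.
  fromExtraction : List P × ℕ → Block
  fromExtraction (q ∷ qs , zero) = this (q ∷ qs)
  fromExtraction (q ∷ qs , suc k) = these (q ∷ qs) (tt ∷ replicate k tt)
  fromExtraction ([] , k) = that (tt ∷ replicate k tt)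

  tilesOf : List P → List⁺ (Tile n)
  tilesOf (q ∷ qs) = tile q ∷ map tile qs
  tilesOf [] = ∅ ∷ []

  pairsOf : List (Tile n) → List P
  pairsOf [] = []
  pairsOf (∅ ∷ cs) = pairsOf cs
  pairsOf (tile q ∷ cs) = q ∷ pairsOf cs

  decomposeRun : List⁺ (Tile n) → Block
  decomposeRun (∅ ∷ cs) = that (List⁺.map (const tt) (∅ ∷ cs))
  decomposeRun (tile p ∷ cs) = fromExtraction (extractSpecial (p ∷ pairsOf cs))

  composeRun : Block → List⁺ (Tile n)
  composeRun (that ts) = List⁺.map (const ∅) ts
  composeRun (this ps) = tilesOf (toList ps)
  composeRun (these ps ts) = tilesOf (insertSpecial (toList ps) (List⁺.length ts))

  data RunShape : List⁺ (Tile n) → Set where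
    empties : ∀ cs → All (_≡ ∅) cs → RunShape (∅ ∷ cs)
    tiles : ∀ p ps → Linked _⊳_ (p ∷ ps) → RunShape (tile p ∷ map tile ps)

  runShape : ∀ c cs → Linked ZeroEnergy (c ∷ cs) → RunShape (c ∷ cs)
  runShape ∅ [] _ = empties [] []
  runShape (tile p) [] _ = tiles p [] [-]
  runShape ∅ (∅ ∷ cs) (_ ∷ l) with runShape ∅ cs l
  ... | empties .cs e = empties (∅ ∷ cs) (refl ∷ e)
  runShape (tile p) (tile q ∷ cs) (h ∷ l) with runShape (tile q) cs l
  ... | tiles .q ps chain = tiles p (q ∷ ps) (H≡0⇒⊳ p q h ∷ chain)
  runShape ∅ (tile _ ∷ _) (() ∷ _)
  runShape (tile _) (∅ ∷ _) (() ∷ _)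

  pairsOf-map : ∀ ps → pairsOf (map tile ps) ≡ ps
  pairsOf-map [] = refl
  pairsOf-map (q ∷ ps) = cong (q ∷_) (pairsOf-map ps)

  decompose-tilesOf : ∀ xs → xs ≢ [] → decomposeRun (tilesOf xs) ≡ fromExtraction (extractSpecial xs)
  decompose-tilesOf [] ne = ⊥-elim (ne refl)
  decompose-tilesOf (q ∷ qs) _ = cong (λ ps → fromExtraction (extractSpecial (q ∷ ps))) (pairsOf-map qs)

  compose-fromExtraction : ∀ qs r → qs ≢ [] → composeRun (fromExtraction (qs , r)) ≡ tilesOf (insertSpecial qs r)
  compose-fromExtraction [] r ne = ⊥-elim (ne refl)
  compose-fromExtraction (q ∷ qs) zero _ = refl
  compose-fromExtraction (q ∷ qs) (suc k) _ = cong (λ m → tilesOf (insertSpecial (q ∷ qs) (suc m))) (ListP.length-replicate k)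

  private
    map-const-∅ : ∀ (cs : List (Tile n)) → All (_≡ ∅) cs → map (const ∅) (map (const tt) cs) ≡ cs
    map-const-∅ [] _ = refl
    map-const-∅ (_ ∷ cs) (refl ∷ e) = cong (∅ ∷_) (map-const-∅ cs e)

    map-const-tt : ∀ (ts : List ⊤) → map (const tt) (map (const (∅ {n})) ts) ≡ ts
    map-const-tt [] = refl
    map-const-tt (tt ∷ ts) = cong (tt ∷_) (map-const-tt ts)

  compose-decompose : ∀ c cs → Linked ZeroEnergy (c ∷ cs) → composeRun (decomposeRun (c ∷ cs)) ≡ c ∷ cs
  compose-decompose c cs l with runShape c cs l
  ... | empties cs e = cong (∅ ∷_) (map-const-∅ cs e)
  ... | tiles p ps chain = begin
    composeRun (fromExtraction (extractSpecial (p ∷ pairsOf (map tile ps))))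
      ≡⟨ cong (λ qs → composeRun (fromExtraction (extractSpecial (p ∷ qs)))) (pairsOf-map ps) ⟩
    composeRun (fromExtraction (extractSpecial (p ∷ ps)))
      ≡⟨ compose-fromExtraction (proj₁ (extractSpecial (p ∷ ps))) (proj₂ (extractSpecial (p ∷ ps)))
           (extract-nonEmpty (p ∷ ps) chain (λ ())) ⟩
    tilesOf (uncurry insertSpecial (extractSpecial (p ∷ ps)))
      ≡⟨ cong tilesOf (insert-extract (p ∷ ps) chain) ⟩
    tile p ∷ map tile ps ∎
    where open ≡-Reasoning

  LeftChain : Block → Set
  LeftChain (that _) = ⊤
  LeftChain (this ps) = Linked _≻_ (toList ps)
  LeftChain (these ps _) = Linked _≻_ (toList ps)

  decompose-compose : ∀ t → LeftChain t → decomposeRun (composeRun t) ≡ t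
  decompose-compose (that (tt ∷ ts)) _ = cong (λ us → that (tt ∷ us)) (map-const-tt ts)
  decompose-compose (this (q ∷ qs)) chain =
    trans (decompose-tilesOf (q ∷ qs) (λ ())) (cong fromExtraction (extract-insert (q ∷ qs) 0 chain (λ ())))
  decompose-compose (these (q ∷ qs) (tt ∷ ts)) chain = begin
    decomposeRun (tilesOf (insertSpecial (q ∷ qs) (suc (length ts))))
      ≡⟨ decompose-tilesOf _ (insert-nonEmpty (q ∷ qs) (suc (length ts)) chain (λ ())) ⟩
    fromExtraction (extractSpecial (insertSpecial (q ∷ qs) (suc (length ts))))
      ≡⟨ cong fromExtraction (extract-insert (q ∷ qs) (suc (length ts)) chain (λ ())) ⟩
    these (q ∷ qs) (tt ∷ replicate (length ts) tt)
      ≡⟨ cong (λ us → these (q ∷ qs) (tt ∷ us)) (replicate-length ts) ⟩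
    these (q ∷ qs) (tt ∷ ts) ∎
    where open ≡-Reasoning

module Correspondence (n : ℕ) where

  open Coordinates n
  open RunBijection n
  open TileRuns n

  Φℕ : List (ℕ × Tile n) → List (ℕ × P) × List (ℕ × ⊤)
  Φℕ xs = ungroup (lefts blocks) , ungroup (rights blocks)
    where blocks = map (map₂ decomposeRun) (group xs)

  Ψℕ : List (ℕ × P) → List (ℕ × ⊤) → List (ℕ × Tile n)
  Ψℕ ys zs = ungroup (map (map₂ composeRun) (merge (group ys) (group zs)))

  map-compose-decompose : ∀ (rs : List (Run (Tile n))) → All (λ r → Linked ZeroEnergy (toList (proj₂ r))) rs →
    map (map₂ composeRun) (map (map₂ decomposeRun) rs) ≡ rs
  map-compose-decompose [] _ = refl
  map-compose-decompose ((v , c ∷ cs) ∷ rs) (l ∷ ls) =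
    cong₂ _∷_ (cong (λ r → (v , r)) (compose-decompose c cs l)) (map-compose-decompose rs ls)

  map-decompose-compose : ∀ (es : List (ℕ × Block)) → All (λ e → LeftChain (proj₂ e)) es →
    map (map₂ decomposeRun) (map (map₂ composeRun) es) ≡ es
  map-decompose-compose [] _ = refl
  map-decompose-compose ((v , t) ∷ es) (c ∷ cs) =
    cong₂ _∷_ (cong (λ r → (v , r)) (decompose-compose t c)) (map-decompose-compose es cs)

  Ψℕ-Φℕ : ∀ xs → Linked (Stacked ZeroEnergy) xs → uncurry Ψℕ (Φℕ xs) ≡ xs
  Ψℕ-Φℕ xs l = begin
    ungroup (map (map₂ composeRun) (merge (group (ungroup (lefts E))) (group (ungroup (rights E)))))
      ≡⟨ cong₂ (λ a c → ungroup (map (map₂ composeRun) (merge a c)))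
           (group-ungroup (lefts E) (lefts-descending E dE)) (group-ungroup (rights E) (rights-descending E dE)) ⟩
    ungroup (map (map₂ composeRun) (merge (lefts E) (rights E)))
      ≡⟨ cong (λ es → ungroup (map (map₂ composeRun) es)) (merge-lefts-rights E dE) ⟩
    ungroup (map (map₂ composeRun) E)
      ≡⟨ cong ungroup (map-compose-decompose (group xs) (proj₂ runs)) ⟩
    ungroup (group xs)
      ≡⟨ ungroup-group xs ⟩
    xs ∎
    where
    open ≡-Reasoning
    runs = stacked-runs xs l
    E = map (map₂ decomposeRun) (group xs)
    dE = Descending-map₂ {f = decomposeRun} (group xs) (proj₁ runs)

  private
    sides⇒LeftChain : ∀ (e : ℕ × Block) → Sides (λ r → Linked _≻_ (toList (proj₂ r))) (λ _ → ⊤) e →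
      LeftChain (proj₂ e)
    sides⇒LeftChain (_ , this _) c = c
    sides⇒LeftChain (_ , that _) _ = tt
    sides⇒LeftChain (_ , these _ _) (c , _) = c

  Φℕ-Ψℕ : ∀ ys zs → Linked (Stacked _≻_) ys → Linked (Stacked (λ (_ _ : ⊤) → ⊤)) zs →
    Φℕ (Ψℕ ys zs) ≡ (ys , zs)
  Φℕ-Ψℕ ys zs ly lz = cong₂ _,_
    (trans (cong (ungroup ∘ lefts) blocks≡M) (trans (cong ungroup (lefts-merge (group ys) (group zs))) (ungroup-group ys)))
    (trans (cong (ungroup ∘ rights) blocks≡M) (trans (cong ungroup (rights-merge (group ys) (group zs))) (ungroup-group zs)))
    where
    runsY = stacked-runs ys ly
    runsZ = stacked-runs zs lz
    M = merge (group ys) (group zs)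
    dM = merge-descending (group ys) (group zs) (proj₁ runsY) (proj₁ runsZ)
    chains : All (λ e → LeftChain (proj₂ e)) M
    chains = All.map (λ {e} → sides⇒LeftChain e) (merge-Sides (group ys) (group zs) (proj₂ runsY) (All.universal (λ _ → tt) _))
    blocks≡M : map (map₂ decomposeRun) (group (ungroup (map (map₂ composeRun) M))) ≡ M
    blocks≡M = trans (cong (map (map₂ decomposeRun)) (group-ungroup _ (Descending-map₂ {f = composeRun} M dM)))
                     (map-decompose-compose M chains)

-- Energy conditions and the final part

module Energies (n : ℕ) where

  open Coordinates n
  open TileRuns n

  OneEnergy : Tile n → Tile n → Set
  OneEnergy c c′ = H c′ c ≤ 1

  OneEnergy-∅ˡ : ∀ c → OneEnergy ∅ c
  OneEnergy-∅ˡ ∅ = z≤n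
  OneEnergy-∅ˡ (tile _) = ℕP.≤-refl

  OneEnergy-∅ʳ : ∀ c → OneEnergy c ∅
  OneEnergy-∅ʳ ∅ = z≤n
  OneEnergy-∅ʳ (tile _) = ℕP.≤-refl

  ZeroEnergy-trans : ∀ {a b c} → ZeroEnergy a b → ZeroEnergy b c → ZeroEnergy a c
  ZeroEnergy-trans {∅} {∅} {∅} _ _ = refl
  ZeroEnergy-trans {tile e} {tile d} {tile l} h h′ = ⊳⇒H≡0 e l (⊳-trans (H≡0⇒⊳ e d h) (H≡0⇒⊳ d l h′))

  ZeroEnergy-antisym : ∀ {a b} → ZeroEnergy a b → ZeroEnergy b a → a ≡ b
  ZeroEnergy-antisym {∅} {∅} _ _ = refl
  ZeroEnergy-antisym {tile e} {tile l} h h′ = cong tile (⊒-antisym (⊳⇒⊒ (H≡0⇒⊳ e l h)) (⊳⇒⊒ (H≡0⇒⊳ l e h′)))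

  ZeroEnergy-OneEnergy : ∀ {a b c} → ZeroEnergy a b → OneEnergy b c → OneEnergy a c
  ZeroEnergy-OneEnergy {∅} {_} {c} _ _ = OneEnergy-∅ˡ c
  ZeroEnergy-OneEnergy {tile e} {tile d} {∅} _ _ = OneEnergy-∅ʳ (tile e)
  ZeroEnergy-OneEnergy {tile e} {tile d} {tile l} h h′ =
    <⇒H≤1 e l (ℕP.<-≤-trans (H≤1⇒ d l h′) (_⊒_.Y≤ (⊳⇒⊒ (H≡0⇒⊳ e d h))))

  OneEnergy-ZeroEnergy : ∀ {a b c} → OneEnergy a b → ZeroEnergy b c → OneEnergy a c
  OneEnergy-ZeroEnergy {∅} {_} {c} _ _ = OneEnergy-∅ˡ c
  OneEnergy-ZeroEnergy {tile e} {∅} {∅} _ _ = OneEnergy-∅ʳ (tile e)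
  OneEnergy-ZeroEnergy {tile e} {tile d} {tile l} h h′ =
    <⇒H≤1 e l (ℕP.≤-<-trans (_⊒_.X≤ (⊳⇒⊒ (H≡0⇒⊳ d l h′))) (H≤1⇒ e d h))

  Step : ℕ × Tile n → ℕ × Tile n → Set
  Step (a , t) (a′ , t′) = H t′ t + a′ ≤ a

  m+n≤n⇒m≡0 : ∀ m k → m + k ≤ k → m ≡ 0
  m+n≤n⇒m≡0 m k h = ℕP.n≤0⇒n≡0 (ℕP.+-cancelʳ-≤ k m 0 h)

  EnergyDescent : ℕ × Tile n → ℕ × Tile n → Set
  EnergyDescent = Descent ZeroEnergy OneEnergy

  Step⇒EnergyDescent : ∀ {x y} → Step x y → EnergyDescent x y
  Step⇒EnergyDescent {a , t} {a′ , t′} h =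
    ℕP.m+n≤o⇒n≤o (H t′ t) h ,
    (λ { refl → m+n≤n⇒m≡0 (H t′ t) a h }) ,
    (λ { refl → ℕP.+-cancelʳ-≤ a′ (H t′ t) 1 h })

  EnergyDescent-trans : ∀ {x y z} → EnergyDescent x y → EnergyDescent y z → EnergyDescent x z
  EnergyDescent-trans {x} {y} {z} = Descent-trans {S = ZeroEnergy} {O = OneEnergy}
    (λ {a} {b} {c} → ZeroEnergy-trans {a} {b} {c}) (λ {a} {b} {c} → ZeroEnergy-OneEnergy {a} {b} {c})
    (λ {a} {b} {c} → OneEnergy-ZeroEnergy {a} {b} {c}) {x} {y} {z}

module SpecialPairs (n : ℕ) where

  open Coordinates n

  specialPair : Fin n → P
  specialPair k = ⟨ k ↑ˡ n , opposite (k ↑ˡ n) ∣ ordered ⟩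
    where
    ordered : toℕ (k ↑ˡ n) ≤ toℕ (opposite (k ↑ˡ n))
    ordered rewrite opposite-prop (k ↑ˡ n) | toℕ-↑ˡ k n =
      ℕP.≤-trans (ℕP.<⇒≤ (toℕ<n k)) (ℕP.m+n≤o⇒m≤o∸n n (ℕP.+-monoʳ-≤ n (toℕ<n k)))

  specialPair-special : ∀ k → Special (specialPair k)
  specialPair-special k = mirror-sym (mirror-opposite (k ↑ˡ n))

  specialPair-X<Y : ∀ k → X (specialPair k) < Y (specialPair k)
  specialPair-X<Y k = ℕP.≤∧≢⇒< (X≤Y (specialPair k)) (mirror-≢ (specialPair-special k))

  special⇒b : ∀ {p} → Special p → ∃ λ (k : Fin (suc n)) → tile p ≡ b k
  special⇒b {p} sp = Fin.suc k , cong tile (sym (pair-≡ℕ Xk≡Xp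
    (mirror-injʳ (subst (λ z → Mirror z (Y (specialPair k))) Xk≡Xp (specialPair-special k)) sp)))
    where
    Xp<n : X p < n
    Xp<n = ℕP.≰⇒> (λ n≤Xp → ℕP.<-irrefl refl
      (ℕP.≤-trans (s≤s (ℕP.+-mono-≤ n≤Xp (ℕP.≤-trans n≤Xp (X≤Y p)))) (ℕP.≤-reflexive (mirror-sum sp))))
    k = Fin.fromℕ< Xp<n
    Xk≡Xp : X (specialPair k) ≡ X p
    Xk≡Xp = trans (toℕ-↑ˡ k n) (toℕ-fromℕ< Xp<n)

module Terminal (n : ℕ) where

  open Coordinates n
  open RunBijection n
  open TileRuns n
  open Energies n
  open SpecialPairs n

  terminal : Fin (suc n) → ℕ × Tile n
  terminal i = 0 , b i

  module _ (i : Fin (suc n)) where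

    ρ≤2 : ∀ p → ρ i p nothing ≤ 2
    ρ≤2 p with tile p ≟T b i
    ... | yes _ = s≤s z≤n
    ... | no _ = H≤2 (b i) (tile p)

    OneEnergy⇒ρ≤1 : ∀ p → OneEnergy (tile p) (b i) → ρ i p nothing ≤ 1
    OneEnergy⇒ρ≤1 p h with tile p ≟T b i
    ... | yes _ = ℕP.≤-refl
    ... | no _ = h

    ZeroEnergy⇒ρ≤0 : ∀ p → ZeroEnergy (tile p) (b i) → tile p ≢ b i → ρ i p nothing ≤ 0
    ZeroEnergy⇒ρ≤0 p h p≢bi with tile p ≟T b i
    ... | yes p≡bi = contradiction p≡bi p≢bi
    ... | no _ = ℕP.≤-reflexive h

    -- What the final part 0_{c_{b_i}} forces on a part of λ.
    EndFacts : ℕ × Tile n → Set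
    EndFacts (v , ∅) = 1 ≤ v
    EndFacts (v , tile p) = ρ i p nothing ≤ v × (v ≡ 0 → NonSpecial p)

    zeroValued-≢terminal : ∀ c z → EnergyDescent (0 , c) (terminal i) → ((0 , c) ≡ z ⊎ EnergyDescent (0 , c) z) →
      EnergyDescent z (terminal i) → z ≢ terminal i → c ≢ b i
    zeroValued-≢terminal c z _ (inj₁ refl) _ z≢t refl = z≢t refl
    zeroValued-≢terminal c (v , d) _ (inj₂ (v≤0 , same , _)) (_ , same′ , _) z≢t refl with ℕP.n≤0⇒n≡0 v≤0
    ... | refl = z≢t (cong (0 ,_) (ZeroEnergy-antisym {d} {b i} (same′ refl) (same refl)))

  endFacts : ∀ i x z → EnergyDescent x (terminal i) → (x ≡ z ⊎ EnergyDescent x z) →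
    EnergyDescent z (terminal i) → z ≢ terminal i → EndFacts i x
  endFacts i (suc v , ∅) _ _ _ _ _ = s≤s z≤n
  endFacts i (suc (suc v) , tile p) _ _ _ _ _ = ℕP.≤-trans (ρ≤2 i p) (s≤s (s≤s z≤n)) , λ ()
  endFacts i (suc zero , tile p) _ (_ , _ , one) _ _ _ = OneEnergy⇒ρ≤1 i p (one refl) , λ ()
  endFacts Fin.zero (zero , ∅) z xt xz zt z≢t = contradiction refl (zeroValued-≢terminal Fin.zero ∅ z xt xz zt z≢t)
  endFacts (Fin.suc k) (zero , ∅) z (_ , same , _) _ _ _ with same refl
  ... | ()
  endFacts Fin.zero (zero , tile p) z (_ , same , _) _ _ _ with same refl
  ... | ()
  endFacts (Fin.suc k) (zero , tile p) z xt@(_ , same , _) xz zt z≢t =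
    ZeroEnergy⇒ρ≤0 (Fin.suc k) p (same refl) p≢bk , λ _ sp →
      p≢bk (cong tile (sym (special-unique sp (specialPair-special k) (⊳⇒⊒ (H≡0⇒⊳ p (specialPair k) (same refl))))))
    where p≢bk = zeroValued-≢terminal (Fin.suc k) (tile p) z xt xz zt z≢t

  tile-injective : ∀ {p q : P} → tile p ≡ tile q → p ≡ q
  tile-injective refl = refl

  ρ-cases : ∀ (j : Fin (suc n)) (e : P) →
    (tile e ≡ b j × ρ j e nothing ≡ 1) ⊎ (tile e ≢ b j × ρ j e nothing ≡ H (b j) (tile e))
  ρ-cases j e with tile e ≟T b j
  ... | yes eq = inj₁ (eq , refl)
  ... | no ne = inj₂ (ne , refl)

  ρ≤0⇒ : ∀ (k : Fin n) (e : P) → ρ (Fin.suc k) e nothing ≤ 0 → e ⊳ specialPair k × e ≢ specialPair k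
  ρ≤0⇒ k e h with ρ-cases (Fin.suc k) e
  ... | inj₁ (_ , ρ≡1) = ⊥-elim (ℕP.<-irrefl refl (subst (_≤ 0) ρ≡1 h))
  ... | inj₂ (e≢bk , ρ≡H) =
    H≡0⇒⊳ e (specialPair k) (ℕP.n≤0⇒n≡0 (subst (_≤ 0) ρ≡H h)) , λ eq → e≢bk (cong tile eq)

  ρ₀≰0 : ∀ (e : P) → ¬ ρ Fin.zero e nothing ≤ 0
  ρ₀≰0 e h with ρ-cases Fin.zero e
  ... | inj₁ (_ , ρ≡1) = ℕP.<-irrefl refl (subst (_≤ 0) ρ≡1 h)
  ... | inj₂ (_ , ρ≡H) = ℕP.<-irrefl refl (subst (_≤ 0) ρ≡H h)

  ρ≤1⇒ : ∀ (k : Fin n) (e : P) → ρ (Fin.suc k) e nothing ≤ 1 → X (specialPair k) < Y e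
  ρ≤1⇒ k e h with ρ-cases (Fin.suc k) e
  ... | inj₁ (eq , _) = subst (λ q → X (specialPair k) < Y q) (tile-injective (sym eq)) (specialPair-X<Y k)
  ... | inj₂ (_ , ρ≡H) = H≤1⇒ e (specialPair k) (subst (_≤ 1) ρ≡H h)

  MuDescent : ℕ × P → ℕ × P → Set
  MuDescent = Descent _≻_ (λ e l → X l < Y e)

  MuDescent-trans : ∀ {x y z} → MuDescent x y → MuDescent y z → MuDescent x z
  MuDescent-trans {x} {y} {z} = Descent-trans {S = _≻_} {O = λ e l → X l < Y e} ≻-trans
    (λ (_ , y<) x< → ℕP.<-trans x< y<) (λ x< (x<′ , _) → ℕP.<-trans x<′ x<) {x} {y} {z}

  -- What the final part 0_{c_∞} forces on a part of μ.
  TermFacts : Fin (suc n) → ℕ × P → Set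
  TermFacts i (zero , e) = ZeroEnergy (tile e) (b i) × tile e ≢ b i
  TermFacts i (suc (suc _) , e) = ⊤
  TermFacts Fin.zero (suc zero , e) = ⊤
  TermFacts (Fin.suc k) (suc zero , e) = X (specialPair k) < Y e

  termFacts : ∀ i y z → (y ≡ z ⊎ MuDescent y z) → ρ i (proj₂ z) nothing ≤ proj₁ z → TermFacts i y
  termFacts i (suc (suc v) , e) _ _ _ = tt
  termFacts Fin.zero (suc zero , e) _ _ _ = tt
  termFacts (Fin.suc k) (suc zero , e) _ (inj₁ refl) h = ρ≤1⇒ k e h
  termFacts (Fin.suc k) (suc zero , e) (suc zero , e′) (inj₂ (_ , same , _)) h =
    ℕP.<-trans (ρ≤1⇒ k e′ h) (_≻_.Y< (same refl))
  termFacts (Fin.suc k) (suc zero , e) (zero , e′) (inj₂ (_ , _ , one)) h =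
    ℕP.≤-<-trans (_⊒_.X≤ (⊳⇒⊒ (proj₁ (ρ≤0⇒ k e′ h)))) (one refl)
  termFacts (Fin.suc k) (suc zero , e) (suc (suc _) , _) (inj₂ (s≤s () , _)) _
  termFacts Fin.zero (zero , e) z (inj₁ refl) h = ⊥-elim (ρ₀≰0 e h)
  termFacts Fin.zero (zero , e) (zero , e′) (inj₂ _) h = ⊥-elim (ρ₀≰0 e′ h)
  termFacts i (zero , e) (suc _ , _) (inj₂ (() , _)) _
  termFacts (Fin.suc k) (zero , e) _ (inj₁ refl) h =
    let (e⊳bk , e≢bk) = ρ≤0⇒ k e h in ⊳⇒H≡0 e (specialPair k) e⊳bk , λ eq → e≢bk (tile-injective eq)
  termFacts (Fin.suc k) (zero , e) (zero , e′) (inj₂ (_ , same , _)) h =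
    ⊳⇒H≡0 e (specialPair k) (⊳-trans (strict (same refl)) e′⊳bk) ,
    λ eq → ℕP.<-irrefl (cong X (sym (tile-injective eq))) (ℕP.≤-<-trans (_⊒_.X≤ (⊳⇒⊒ e′⊳bk)) (_≻_.X< (same refl)))
    where e′⊳bk = proj₁ (ρ≤0⇒ k e′ h)

module Validity (n : ℕ) (i : Fin (suc n)) where

  open Coordinates n
  open RunBijection n
  open TileRuns n
  open Correspondence n
  open Energies n
  open SpecialPairs n
  open Terminal n

  -- The ℕ-valued form of IsGg (all parts of λ are nonnegative).
  ValidParts : List (ℕ × Tile n) → Set
  ValidParts xs = Linked Step (xs ∷ʳ terminal i) × (∀ zs z → xs ≡ zs ∷ʳ z → z ≢ terminal i)

  allEndFacts : ∀ xs → ValidParts xs → All (EndFacts i) xs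
  allEndFacts xs (chain , lastOK) with initLast xs
  ... | [] = []
  ... | zs ∷ʳ′ z = AllP.++⁺
    (All.zipWith (λ {x} (xz , xt) → endFacts i x z xt (inj₂ xz) zt z≢t) (beforeZ , AllP.++⁻ˡ zs beforeT))
    (endFacts i z z zt (inj₁ refl) zt z≢t ∷ [])
    where
    descents : Linked EnergyDescent ((zs ∷ʳ z) ∷ʳ terminal i)
    descents = Linked.map (λ {x} {y} → Step⇒EnergyDescent {x} {y}) chain
    beforeT : All (λ x → EnergyDescent x (terminal i)) (zs ∷ʳ z)
    beforeT = Linked⇒All-before (λ {x} {y} {z} → EnergyDescent-trans {x} {y} {z}) (zs ∷ʳ z) descents
    beforeZ : All (λ x → EnergyDescent x z) zs
    beforeZ = Linked⇒All-before (λ {x} {y} {z} → EnergyDescent-trans {x} {y} {z}) zs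
                (subst (Linked EnergyDescent) (ListP.++-assoc zs (z ∷ []) (terminal i ∷ [])) descents)
    zt = All-∷ʳ⁻ zs beforeT
    z≢t = lastOK zs z refl

  ρEnd : ℕ × P → Set
  ρEnd (v , p) = ρ i p nothing ≤ v

  MuRun : ℕ × List⁺ P → Set
  MuRun (v , ps) = Linked _≻_ (toList ps) × All (λ p → ρEnd (v , p)) (toList ps)

  NuRun : ℕ × List⁺ ⊤ → Set
  NuRun (v , _) = 1 ≤ v

  private
    fromExtraction-facts : ∀ v qs r → qs ≢ [] → Linked _≻_ qs → All (λ p → ρEnd (v , p)) qs → (r ≢ 0 → 1 ≤ v) →
      Sides MuRun NuRun (v , fromExtraction (qs , r))
    fromExtraction-facts v [] r ne _ _ _ = ⊥-elim (ne refl)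
    fromExtraction-facts v (q ∷ qs) zero _ chain ends _ = chain , ends
    fromExtraction-facts v (q ∷ qs) (suc k) _ chain ends pos = (chain , ends) , pos (λ ())

  extracted⇒positive : ∀ v qs → All (λ q → EndFacts i (v , tile q)) qs → proj₂ (extractSpecial qs) ≢ 0 → 1 ≤ v
  extracted⇒positive (suc _) _ _ _ = s≤s z≤n
  extracted⇒positive zero qs ends r≢0 = ⊥-elim (r≢0 (cong proj₂ (extract-nonSpecial qs (All.map (λ e → proj₂ e refl) ends))))

  decomposeRun-facts : ∀ v c cs → Linked ZeroEnergy (c ∷ cs) → All (λ c → EndFacts i (v , c)) (c ∷ cs) →
    Sides MuRun NuRun (v , decomposeRun (c ∷ cs))
  decomposeRun-facts v c cs l ends with runShape c cs l
  ... | empties cs _ with ends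
  ...   | 1≤v ∷ _ = 1≤v
  decomposeRun-facts v c cs l ends | tiles p ps chain =
    subst (λ qs → Sides MuRun NuRun (v , fromExtraction (extractSpecial (p ∷ qs)))) (sym (pairsOf-map ps))
      (fromExtraction-facts v _ _ (extract-nonEmpty (p ∷ ps) chain (λ ())) (extract-valid (p ∷ ps) chain)
        (extract-All (p ∷ ps) chain (All.map proj₁ tileEnds)) (extracted⇒positive v (p ∷ ps) tileEnds))
    where
    tileEnds : All (λ q → EndFacts i (v , tile q)) (p ∷ ps)
    tileEnds = AllP.map⁻ ends

  lastY≤ : ∀ p ps → Linked _⊳_ (p ∷ ps) → All (λ q → Y (lastOf p ps) ≤ Y q) (p ∷ ps)
  lastY≤ p [] _ = ℕP.≤-refl ∷ []
  lastY≤ p (q ∷ qs) (p⊳q ∷ chain) with lastY≤ q qs chain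
  ... | h ∷ hs = ℕP.≤-trans h (_⊒_.Y≤ (⊳⇒⊒ p⊳q)) ∷ h ∷ hs

  Joins : List⁺ P → List⁺ P → Set
  Joins ps ps′ = firstX (toList ps′) < lastY (toList ps)

  private
    All⇒firstX≤ : ∀ {u} qs → All (λ q → X q ≤ u) qs → firstX qs ≤ u
    All⇒firstX≤ [] _ = z≤n
    All⇒firstX≤ (_ ∷ _) (h ∷ _) = h

    All⇒≤lastY : ∀ {u} qs → qs ≢ [] → All (λ q → u ≤ Y q) qs → u ≤ lastY qs
    All⇒≤lastY [] ne _ = ⊥-elim (ne refl)
    All⇒≤lastY (q ∷ qs) _ h = All-lastOf q qs h

    X≤head : ∀ p ps → Linked _⊳_ (p ∷ ps) → All (λ q → X q ≤ X p) (p ∷ ps)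
    X≤head p ps chain = ℕP.≤-refl ∷ All.map _⊒_.X≤ (Linked⇒All-head ⊒-trans ps (⊳⇒⊒-chain chain))


    onLefts-fromExtraction : ∀ qs r qs′ r′ → qs ≢ [] → qs′ ≢ [] → firstX qs′ < lastY qs →
      OnLefts Joins (fromExtraction (qs , r)) (fromExtraction (qs′ , r′))
    onLefts-fromExtraction [] _ _ _ ne _ _ = ⊥-elim (ne refl)
    onLefts-fromExtraction (_ ∷ _) _ [] _ _ ne _ = ⊥-elim (ne refl)
    onLefts-fromExtraction (_ ∷ _) zero (_ ∷ _) zero _ _ j = j
    onLefts-fromExtraction (_ ∷ _) zero (_ ∷ _) (suc _) _ _ j = j
    onLefts-fromExtraction (_ ∷ _) (suc _) (_ ∷ _) zero _ _ j = j
    onLefts-fromExtraction (_ ∷ _) (suc _) (_ ∷ _) (suc _) _ _ j = j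

  decomposeRun-gap : ∀ v c cs v′ c′ cs′ → Linked ZeroEnergy (c ∷ cs) → Linked ZeroEnergy (c′ ∷ cs′) → v′ < v →
    Step (v , lastOf c cs) (v′ , c′) → Gap (OnLefts Joins) (v , decomposeRun (c ∷ cs)) (v′ , decomposeRun (c′ ∷ cs′))
  decomposeRun-gap v c cs v′ c′ cs′ l l′ v′<v step with runShape c cs l | runShape c′ cs′ l′
  ... | empties _ _ | _ = v′<v , λ _ → tt
  ... | tiles p ps chain | empties cs₀ _ =
    v′<v , λ _ → OnLefts-thatʳ {C = Joins} (decomposeRun (tile p ∷ map tile ps)) (List⁺.map (λ _ → tt) (∅ ∷ cs₀))
  ... | tiles p ps chain | tiles p′ ps′ chain′ rewrite pairsOf-map ps | pairsOf-map ps′ = v′<v , joins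
    where
    e = extractSpecial (p ∷ ps)
    e′ = extractSpecial (p′ ∷ ps′)
    joins : v ≡ suc v′ → OnLefts Joins (fromExtraction e) (fromExtraction e′)
    joins refl = onLefts-fromExtraction (proj₁ e) (proj₂ e) (proj₁ e′) (proj₂ e′)
      (extract-nonEmpty (p ∷ ps) chain (λ ())) (extract-nonEmpty (p′ ∷ ps′) chain′ (λ ()))
      (ℕP.≤-<-trans (All⇒firstX≤ (proj₁ e′) (extract-All (p′ ∷ ps′) chain′ (X≤head p′ ps′ chain′)))
        (ℕP.<-≤-trans (H≤1⇒ (lastOf p ps) p′ h≤1)
          (All⇒≤lastY (proj₁ e) (extract-nonEmpty (p ∷ ps) chain (λ ())) (extract-All (p ∷ ps) chain (lastY≤ p ps chain)))))
      where
      h≤1 : H (tile p′) (tile (lastOf p ps)) ≤ 1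
      h≤1 = subst (λ t → H (tile p′) t ≤ 1) (lastOf-map tile p ps) (ℕP.+-cancelʳ-≤ v′ _ 1 step)

  ρStep : ℕ × P → ℕ × P → Set
  ρStep (a , e) (a′ , l) = ρ i e (just l) + a′ ≤ a

  -- The ℕ-valued form of IsTilde.
  ρLink : ℕ × Maybe P → ℕ × Maybe P → Set
  ρLink (a , nothing) _ = ⊥
  ρLink (a , just e) (a′ , c′) = ρ i e c′ + a′ ≤ a

  ValidMu : List (ℕ × P) → Set
  ValidMu ys = Linked ρLink (map (map₂ just) ys ∷ʳ (0 , nothing))

  ValidNu : List (ℕ × ⊤) → Set
  ValidNu zs = Linked (λ x y → proj₁ y ≤ proj₁ x) zs × All (λ z → 1 ≤ proj₁ z) zs

  validMu : ∀ ys → Linked ρStep ys → All ρEnd ys → ValidMu ys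
  validMu ys chain ends = Linked-∷ʳ⁺ (map (map₂ just) ys) (LinkedP.map⁺ chain)
    (AllP.map⁺ (All.map (λ {y} e → subst (_≤ proj₁ y) (sym (ℕP.+-identityʳ _)) e) ends))

  private
    within⇒ZeroEnergy : ∀ r → Within Step r → Linked ZeroEnergy (toList (proj₂ r))
    within⇒ZeroEnergy (v , c ∷ cs) w = Linked.map (λ {x} {y} h → m+n≤n⇒m≡0 (H y x) v h) w

    descendingRuns : ∀ xs → Linked Step xs → Descending (group xs)
    descendingRuns xs l = group-descending xs (Linked.map (λ {x} {y} h → ℕP.m+n≤o⇒n≤o (H (proj₂ y) (proj₂ x)) h) l)

    blocksGap : ∀ rs → Descending rs → Linked (Between Step) rs → All (λ r → Linked ZeroEnergy (toList (proj₂ r))) rs →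
      Linked (Gap (OnLefts Joins)) (map (map₂ decomposeRun) rs)
    blocksGap [] _ _ _ = []
    blocksGap (_ ∷ []) _ _ _ = [-]
    blocksGap ((v , c ∷ cs) ∷ (v′ , c′ ∷ cs′) ∷ rs) (v′<v ∷ d) (step ∷ bs) (l ∷ ls) =
      decomposeRun-gap v c cs v′ c′ cs′ l (All.head ls) v′<v step ∷ blocksGap ((v′ , c′ ∷ cs′) ∷ rs) d bs ls

    ≻⇒ρStep : ∀ v {e l} → e ≻ l → ρStep (v , e) (v , l)
    ≻⇒ρStep v {e} {l} (x< , y<) = ℕP.≤-reflexive (cong (_+ v) (<×<⇒weakEnergy≡0 (X l) (Y l) (X e) (Y e) x< y<))

    gap⇒ρStep : ∀ r r′ → Gap Joins r r′ → Between ρStep r r′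
    gap⇒ρStep (v , p ∷ ps) (v′ , p′ ∷ ps′) (v′<v , joins) with ℕP.m≤n⇒m<n∨m≡n v′<v
    ... | inj₂ refl = ℕP.+-monoˡ-≤ v′ (<⇒weakEnergy≤1 (X p′) (Y p′) (X e) (Y e) (joins refl))
      where e = lastOf p ps
    ... | inj₁ 1+v′<v = ℕP.≤-trans (ℕP.+-monoˡ-≤ v′ (weakEnergy≤2 (X p′) (Y p′) (X e) (Y e))) 1+v′<v
      where e = lastOf p ps

  Φℕ-valid : ∀ xs → ValidParts xs → ValidMu (proj₁ (Φℕ xs)) × ValidNu (proj₂ (Φℕ xs))
  Φℕ-valid xs valid = validMu (ungroup μruns) μchain (All-ungroup⁺ μruns (All.map proj₂ μfacts)) ,
    ungroup-nonIncreasing νruns (rights-descending E dE) , All-ungroup⁺ νruns (All.map (λ {r} → positiveRun r) νfacts)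
    where
    steps : Linked Step xs
    steps = Linked-++⁻ˡ xs (proj₁ valid)
    rs = group xs
    runSteps = Linked-ungroup⁻ rs (subst (Linked Step) (sym (ungroup-group xs)) steps)
    zeroRuns = All.map (λ {r} → within⇒ZeroEnergy r) (proj₁ runSteps)
    ends : All (RunAll (EndFacts i)) rs
    ends = All-ungroup⁻ rs (subst (All (EndFacts i)) (sym (ungroup-group xs)) (allEndFacts xs valid))
    E = map (map₂ decomposeRun) rs
    dE = Descending-map₂ rs (descendingRuns xs steps)
    sides : All (Sides MuRun NuRun) E
    sides = AllP.map⁺ (All.zipWith (λ {(v , c ∷ cs)} (l , e) → decomposeRun-facts v c cs l e) (zeroRuns , ends))
    μruns = lefts E
    μfacts = lefts-Sides E sides
    μchain : Linked ρStep (ungroup μruns)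
    μchain = Linked-ungroup⁺ μruns (All.map (λ {(v , ps)} f → Linked.map (≻⇒ρStep v) (proj₁ f)) μfacts)
      (Linked.map (λ {r} {r′} → gap⇒ρStep r r′) (lefts-Gap E (blocksGap rs (descendingRuns xs steps) (proj₂ runSteps) zeroRuns)))
    νruns = rights E
    νfacts = rights-Sides E sides
    positiveRun : ∀ r → NuRun r → RunAll (λ z → 1 ≤ proj₁ z) r
    positiveRun (v , ts) 1≤v = All.universal (λ _ → 1≤v) (toList ts)

  private
    ρStep⇒MuDescent : ∀ {x y} → ρStep x y → MuDescent x y
    ρStep⇒MuDescent {a , e} {a′ , l} h =
      ℕP.m+n≤o⇒n≤o _ h ,
      (λ { refl → let (x< , y<) = weakEnergy≡0⇒ (X l) (Y l) (X e) (Y e) (m+n≤n⇒m≡0 _ a h) in x< , y< }) ,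
      (λ { refl → weakEnergy≤1⇒ (X l) (Y l) (X e) (Y e) (ℕP.+-cancelʳ-≤ a′ _ 1 h) (X≤Y e) (X≤Y l) })

  record MuChain (ys : List (ℕ × P)) : Set where
    field
      steps : Linked ρStep ys
      terminalFacts : All (TermFacts i) ys

  validMu⁻ : ∀ ys → ValidMu ys → MuChain ys
  validMu⁻ ys valid with initLast ys
  ... | [] = record { steps = [] ; terminalFacts = [] }
  ... | zs ∷ʳ′ z = record
    { steps = steps
    ; terminalFacts = AllP.++⁺ (All.map (λ {y} yz → termFacts i y z (inj₂ yz) zEnd) beforeZ) (termFacts i z z (inj₁ refl) zEnd ∷ []) }
    where
    f = map₂ (just {A = P})
    steps : Linked ρStep (zs ∷ʳ z)
    steps = LinkedP.map⁻ (Linked-++⁻ˡ (map f (zs ∷ʳ z)) valid)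
    rearranged : Linked ρLink (map f zs ++ f z ∷ (0 , nothing) ∷ [])
    rearranged = subst (Linked ρLink)
      (trans (cong (_∷ʳ (0 , nothing)) (ListP.map-++ f zs (z ∷ []))) (ListP.++-assoc (map f zs) (f z ∷ []) ((0 , nothing) ∷ [])))
      valid
    zEnd : ρEnd z
    zEnd = subst (_≤ proj₁ z) (ℕP.+-identityʳ (ρ i (proj₂ z) nothing)) (Linked.head (Linked-++⁻ʳ (map f zs) rearranged))
    beforeZ : All (λ y → MuDescent y z) zs
    beforeZ = Linked⇒All-before (λ {x} {y} {z} → MuDescent-trans {x} {y} {z}) zs {ys = []}
      (Linked.map (λ {x} {y} → ρStep⇒MuDescent {x} {y}) steps)

  TermOK : ℕ × Tile n → Set
  TermOK x = Step x (terminal i) × x ≢ terminal i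

  MuRunTerm : ℕ × List⁺ P → Set
  MuRunTerm (v , ps) = Linked _≻_ (toList ps) × All (λ p → TermFacts i (v , p)) (toList ps)

  private
    emptyRun-steps : ∀ v (ts : List ⊤) → Linked (λ x y → Step (v , x) (v , y)) (∅ ∷ map (λ _ → ∅) ts)
    emptyRun-steps v [] = [-]
    emptyRun-steps v (_ ∷ ts) = ℕP.≤-refl ∷ emptyRun-steps v ts

    lastOf-empties : ∀ (ts : List ⊤) → lastOf ∅ (map (λ _ → ∅ {n}) ts) ≡ ∅
    lastOf-empties [] = refl
    lastOf-empties (_ ∷ ts) = lastOf-empties ts

    ⊳⇒Step : ∀ v {e l} → e ⊳ l → Step (v , tile e) (v , tile l)
    ⊳⇒Step v {e} {l} e⊳l = ℕP.≤-reflexive (cong (_+ v) (⊳⇒H≡0 e l e⊳l))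

    tilesOf-within : ∀ v xs → Linked _⊳_ xs → Within Step (v , tilesOf xs)
    tilesOf-within v [] _ = [-]
    tilesOf-within v (q ∷ qs) chain = LinkedP.map⁺ (Linked.map (⊳⇒Step v) chain)

    step≤ : ∀ {v v′} c c′ → v′ < v → (v ≡ suc v′ → H c′ c ≤ 1) → H c′ c + v′ ≤ v
    step≤ {v} {v′} c c′ v′<v one with ℕP.m≤n⇒m<n∨m≡n v′<v
    ... | inj₂ refl = ℕP.+-monoˡ-≤ v′ (one refl)
    ... | inj₁ 1+v′<v = ℕP.≤-trans (ℕP.+-monoˡ-≤ v′ (H≤2 c′ c)) 1+v′<v

  composeRun-within : ∀ v t → LeftChain t → Within Step (v , composeRun t)
  composeRun-within v (that (_ ∷ ts)) _ = emptyRun-steps v ts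
  composeRun-within v (this ps) chain = tilesOf-within v (toList ps) (Linked.map strict chain)
  composeRun-within v (these ps ts) chain =
    tilesOf-within v (insertSpecial (toList ps) (List⁺.length ts)) (insert-valid (toList ps) _ chain (λ ()))

  private
    tilesOf-OneEnergy : ∀ xs xs′ → xs ≢ [] → xs′ ≢ [] → firstX xs′ < lastY xs →
      OneEnergy (lastOf⁺ (tilesOf xs)) (List⁺.head (tilesOf xs′))
    tilesOf-OneEnergy [] _ ne _ _ = ⊥-elim (ne refl)
    tilesOf-OneEnergy (_ ∷ _) [] _ ne _ = ⊥-elim (ne refl)
    tilesOf-OneEnergy (q ∷ qs) (q′ ∷ qs′) _ _ x<y =
      subst (λ c → OneEnergy c (tile q′)) (sym (lastOf-map tile q qs)) (<⇒H≤1 (lastOf q qs) q′ x<y)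

    inserted-OneEnergy : ∀ ps k ps′ k′ → Linked _≻_ (toList ps) → Linked _≻_ (toList ps′) → Joins ps ps′ →
      OneEnergy (lastOf⁺ (tilesOf (insertSpecial (toList ps) k))) (List⁺.head (tilesOf (insertSpecial (toList ps′) k′)))
    inserted-OneEnergy ps k ps′ k′ c c′ j =
      tilesOf-OneEnergy _ _ (insert-nonEmpty (toList ps) k c (λ ())) (insert-nonEmpty (toList ps′) k′ c′ (λ ()))
      (subst₂ _<_ (sym (insert-firstX (toList ps′) k′ c′ (λ ()))) (sym (insert-lastY (toList ps) k c (λ ()))) j)

    composed-OneEnergy : ∀ t t′ → LeftChain t → LeftChain t′ → OnLefts Joins t t′ →
      OneEnergy (lastOf⁺ (composeRun t)) (List⁺.head (composeRun t′))
    composed-OneEnergy (that (_ ∷ ts)) t′ _ _ _ =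
      subst (λ c → OneEnergy c (List⁺.head (composeRun t′))) (sym (lastOf-empties ts)) (OneEnergy-∅ˡ (List⁺.head (composeRun t′)))
    composed-OneEnergy (this ps) (that _) _ _ _ = OneEnergy-∅ʳ (lastOf⁺ (composeRun (this ps)))
    composed-OneEnergy (these ps ts) (that _) _ _ _ = OneEnergy-∅ʳ (lastOf⁺ (composeRun (these ps ts)))
    composed-OneEnergy (this ps) (this ps′) c c′ j = inserted-OneEnergy ps 0 ps′ 0 c c′ j
    composed-OneEnergy (this ps) (these ps′ ts′) c c′ j = inserted-OneEnergy ps 0 ps′ (List⁺.length ts′) c c′ j
    composed-OneEnergy (these ps ts) (this ps′) c c′ j = inserted-OneEnergy ps (List⁺.length ts) ps′ 0 c c′ j
    composed-OneEnergy (these ps ts) (these ps′ ts′) c c′ j =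
      inserted-OneEnergy ps (List⁺.length ts) ps′ (List⁺.length ts′) c c′ j

  composeRun-between : ∀ v t v′ t′ → LeftChain t → LeftChain t′ → Gap (OnLefts Joins) (v , t) (v′ , t′) →
    Between Step (v , composeRun t) (v′ , composeRun t′)
  composeRun-between v t v′ t′ c c′ (v′<v , joins) =
    step≤ (lastOf⁺ (composeRun t)) (List⁺.head (composeRun t′)) v′<v (λ eq → composed-OneEnergy t t′ c c′ (joins eq))

  private
    valueOne-energy : ∀ j u w → TermFacts j (1 , u) → Y u ≤ Y w → H (b j) (tile w) ≤ 1
    valueOne-energy Fin.zero u w _ _ = ℕP.≤-refl
    valueOne-energy (Fin.suc k) u w Xbk<Yu Yu≤Yw = <⇒H≤1 w (specialPair k) (ℕP.<-≤-trans Xbk<Yu Yu≤Yw)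

    positive-TermOK : ∀ v c → H (b i) c ≤ suc v → TermOK (suc v , c)
    positive-TermOK v c h = subst (_≤ suc v) (sym (ℕP.+-identityʳ (H (b i) c))) h , λ ()

    positiveRun-TermOK : ∀ v xs ps → Linked _⊳_ xs → xs ≢ [] → lastY xs ≡ lastY (toList ps) →
      All (λ p → TermFacts i (suc v , p)) (toList ps) → All (λ c → TermOK (suc v , c)) (toList (tilesOf xs))
    positiveRun-TermOK v [] _ _ ne _ _ = ⊥-elim (ne refl)
    positiveRun-TermOK (suc v) (q ∷ qs) _ _ _ _ _ =
      All.universal (λ c → positive-TermOK (suc v) c (ℕP.≤-trans (H≤2 (b i) c) (s≤s (s≤s z≤n)))) _
    positiveRun-TermOK zero (q ∷ qs) (p ∷ ps′) chain _ lastY≡ facts =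
      AllP.map⁺ (All.map (λ {w} Yu≤Yw → positive-TermOK zero (tile w)
          (valueOne-energy i u w lastFacts (ℕP.≤-trans (ℕP.≤-reflexive (sym lastY≡)) Yu≤Yw)))
        (lastY≤ q qs chain))
      where
      u = lastOf p ps′
      lastFacts = All-lastOf p ps′ facts

  composeRun-terminal : ∀ v t → Sides MuRunTerm NuRun (v , t) → RunAll TermOK (v , composeRun t)
  composeRun-terminal zero (that _) ()
  composeRun-terminal (suc v) (that (_ ∷ ts)) _ = term∅ ∷ AllP.map⁺ (All.universal (λ _ → term∅) ts)
    where term∅ = positive-TermOK v ∅ (ℕP.≤-trans (OneEnergy-∅ˡ (b i)) (s≤s z≤n))
  composeRun-terminal zero (this ps) (_ , facts) =
    AllP.map⁺ (All.map (λ {p} (h≡0 , p≢bi) → ℕP.≤-reflexive (trans (ℕP.+-identityʳ _) h≡0) , λ eq → p≢bi (cong proj₂ eq))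
      facts)
  composeRun-terminal (suc v) (this ps) (chain , facts) =
    positiveRun-TermOK v (toList ps) ps (Linked.map strict chain) (λ ()) refl facts
  composeRun-terminal zero (these ps ts) (_ , ())
  composeRun-terminal (suc v) (these ps ts) ((chain , facts) , _) =
    positiveRun-TermOK v (insertSpecial (toList ps) k) ps (insert-valid (toList ps) k chain (λ ()))
      (insert-nonEmpty (toList ps) k chain (λ ())) (insert-lastY (toList ps) k chain (λ ())) facts
    where k = List⁺.length ts

  private
    sides⇒LeftChain : ∀ e → Sides MuRunTerm NuRun e → LeftChain (proj₂ e)
    sides⇒LeftChain (_ , this _) (c , _) = c
    sides⇒LeftChain (_ , that _) _ = tt
    sides⇒LeftChain (_ , these _ _) ((c , _) , _) = c

    ρStep⇒≻ : ∀ v {e l} → ρStep (v , e) (v , l) → e ≻ l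
    ρStep⇒≻ v {e} {l} h = let (x< , y<) = weakEnergy≡0⇒ (X l) (Y l) (X e) (Y e) (m+n≤n⇒m≡0 _ v h) in x< , y<

    between⇒Gap : ∀ r r′ → proj₁ r′ < proj₁ r → Between ρStep r r′ → Gap Joins r r′
    between⇒Gap (v , p ∷ ps) (v′ , p′ ∷ ps′) v′<v h = v′<v , λ { refl →
      weakEnergy≤1⇒ (X p′) (Y p′) (X e) (Y e) (ℕP.+-cancelʳ-≤ v′ _ 1 h) (X≤Y e) (X≤Y p′) }
      where e = lastOf p ps

    gapChain : ∀ rs → Descending rs → Linked (Between ρStep) rs → Linked (Gap Joins) rs
    gapChain [] _ _ = []
    gapChain (_ ∷ []) _ _ = [-]
    gapChain (r ∷ r′ ∷ rs) (v′<v ∷ d) (h ∷ bs) = between⇒Gap r r′ v′<v h ∷ gapChain (r′ ∷ rs) d bs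

    composedSteps : ∀ es → All (Sides MuRunTerm NuRun) es → Linked (Gap (OnLefts Joins)) es →
      Linked (Between Step) (map (map₂ composeRun) es)
    composedSteps [] _ _ = []
    composedSteps (_ ∷ []) _ _ = [-]
    composedSteps ((v , t) ∷ (v′ , t′) ∷ es) (s ∷ ss@(s′ ∷ _)) (g ∷ gs) =
      composeRun-between v t v′ t′ (sides⇒LeftChain (v , t) s) (sides⇒LeftChain (v′ , t′) s′) g ∷
      composedSteps ((v′ , t′) ∷ es) ss gs

  Ψℕ-valid : ∀ ys zs → ValidMu ys → ValidNu zs → ValidParts (Ψℕ ys zs)
  Ψℕ-valid ys zs vμ (νDec , νPos) =
    Linked-∷ʳ⁺ λs steps (All.map proj₁ terms) , λ us u eq → proj₂ (All-∷ʳ⁻ us (subst (All TermOK) eq terms))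
    where
    mc = validMu⁻ ys vμ
    μSteps = MuChain.steps mc
    runsY = group ys
    dY = group-descending ys (Linked.map (λ {x} {y} h → ℕP.m+n≤o⇒n≤o _ h) μSteps)
    runStepsY = Linked-ungroup⁻ runsY (subst (Linked ρStep) (sym (ungroup-group ys)) μSteps)
    μFacts : All MuRunTerm runsY
    μFacts = All.zipWith (λ {(v , ps)} (w , t) → Linked.map (ρStep⇒≻ v) w , t)
      (proj₁ runStepsY , All-ungroup⁻ runsY (subst (All (TermFacts i)) (sym (ungroup-group ys)) (MuChain.terminalFacts mc)))
    runsZ = group zs
    dZ = group-descending zs νDec
    νFacts : All NuRun runsZ
    νFacts = All.map (λ {(v , _)} → All.head) (All-ungroup⁻ runsZ (subst (All (λ z → 1 ≤ proj₁ z)) (sym (ungroup-group zs)) νPos))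
    M = merge runsY runsZ
    sides = merge-Sides runsY runsZ μFacts νFacts
    gaps : Linked (Gap (OnLefts Joins)) M
    gaps = Gap-onLefts M (merge-descending runsY runsZ dY dZ)
      (subst (Linked (Gap Joins)) (sym (lefts-merge runsY runsZ)) (gapChain runsY dY (proj₂ runStepsY)))
    λs = Ψℕ ys zs
    steps : Linked Step λs
    steps = Linked-ungroup⁺ (map (map₂ composeRun) M)
      (AllP.map⁺ (All.map (λ {(v , t)} s → composeRun-within v t (sides⇒LeftChain (v , t) s)) sides))
      (composedSteps M sides gaps)
    terms : All TermOK λs
    terms = All-ungroup⁺ (map (map₂ composeRun) M) (AllP.map⁺ (All.map (λ {(v , t)} → composeRun-terminal v t) sides))

  validParts⇒stacked : ∀ xs → ValidParts xs → Linked (Stacked ZeroEnergy) xs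
  validParts⇒stacked xs (chain , _) = Linked.map (λ {x} {y} → stacked {x} {y}) (Linked-++⁻ˡ xs chain)
    where
    stacked : ∀ {x y} → Step x y → Stacked ZeroEnergy x y
    stacked {x} {y} s = Descent⇒Stacked {S = ZeroEnergy} {O = OneEnergy} {x} {y} (Step⇒EnergyDescent {x} {y} s)

  validMu⇒stacked : ∀ ys → ValidMu ys → Linked (Stacked _≻_) ys
  validMu⇒stacked ys valid = Linked.map (λ {x} {y} → stacked {x} {y}) (MuChain.steps (validMu⁻ ys valid))
    where
    stacked : ∀ {x y} → ρStep x y → Stacked _≻_ x y
    stacked {x} {y} s = Descent⇒Stacked {S = _≻_} {O = λ e l → X l < Y e} {x} {y} (ρStep⇒MuDescent {x} {y} s)

  validNu⇒stacked : ∀ zs → ValidNu zs → Linked (Stacked (λ (_ _ : ⊤) → ⊤)) zs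
  validNu⇒stacked zs (dec , _) = Linked.map (λ le → le , λ _ → tt) dec

-- Sizes, lengths and colours

module Statistics (n : ℕ) where

  open Coordinates n
  open RunBijection n
  open TileRuns n
  open Correspondence n
  open SpecialPairs n

  leftList : Block → List P
  leftList (this ps) = toList ps
  leftList (that _) = []
  leftList (these ps _) = toList ps

  rightList : Block → List ⊤
  rightList (this _) = []
  rightList (that ts) = toList ts
  rightList (these _ ts) = toList ts

  ungroup-lefts-∷ : ∀ v t es → ungroup (lefts ((v , t) ∷ es)) ≡ keyed v (leftList t) ++ ungroup (lefts es)
  ungroup-lefts-∷ v (this _) es = refl
  ungroup-lefts-∷ v (that _) es = refl
  ungroup-lefts-∷ v (these _ _) es = refl

  ungroup-rights-∷ : ∀ v t es → ungroup (rights ((v , t) ∷ es)) ≡ keyed v (rightList t) ++ ungroup (rights es)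
  ungroup-rights-∷ v (this _) es = refl
  ungroup-rights-∷ v (that _) es = refl
  ungroup-rights-∷ v (these _ _) es = refl

  private
    leftList-fromExtraction : ∀ qs r → qs ≢ [] → leftList (fromExtraction (qs , r)) ≡ qs
    leftList-fromExtraction [] _ ne = ⊥-elim (ne refl)
    leftList-fromExtraction (_ ∷ _) zero _ = refl
    leftList-fromExtraction (_ ∷ _) (suc _) _ = refl

    length-fromExtraction : ∀ qs r → qs ≢ [] →
      length qs + r ≡ length (leftList (fromExtraction (qs , r))) + length (rightList (fromExtraction (qs , r)))
    length-fromExtraction [] _ ne = ⊥-elim (ne refl)
    length-fromExtraction (q ∷ qs) zero _ = refl
    length-fromExtraction (q ∷ qs) (suc k) _ = cong (λ m → length (q ∷ qs) + suc m) (sym (ListP.length-replicate k))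

  decomposeRun-length : ∀ c cs → Linked ZeroEnergy (c ∷ cs) →
    suc (length cs) ≡ length (leftList (decomposeRun (c ∷ cs))) + length (rightList (decomposeRun (c ∷ cs)))
  decomposeRun-length c cs l with runShape c cs l
  ... | empties cs _ = cong suc (sym (ListP.length-map _ cs))
  ... | tiles p ps chain rewrite pairsOf-map ps = begin
    suc (length (map tile ps)) ≡⟨ cong suc (ListP.length-map tile ps) ⟩
    length (p ∷ ps) ≡⟨ extract-length (p ∷ ps) chain ⟩
    length (proj₁ e) + proj₂ e ≡⟨ length-fromExtraction (proj₁ e) (proj₂ e) (extract-nonEmpty (p ∷ ps) chain (λ ())) ⟩
    length (leftList (fromExtraction e)) + length (rightList (fromExtraction e)) ∎
    where
    open ≡-Reasoning
    e = extractSpecial (p ∷ ps)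

  keys-Φ : ∀ rs → All (λ r → Linked ZeroEnergy (toList (proj₂ r))) rs →
    keys (ungroup rs) ↭ keys (ungroup (lefts (map (map₂ decomposeRun) rs))) ++ keys (ungroup (rights (map (map₂ decomposeRun) rs)))
  keys-Φ [] _ = ↭-reflexive refl
  keys-Φ ((v , c ∷ cs) ∷ rs) (l ∷ ls) = begin
    keys (runList (v , c ∷ cs) ++ ungroup rs)
      ≡⟨ ListP.map-++ proj₁ (runList (v , c ∷ cs)) (ungroup rs) ⟩
    keys (keyed v (c ∷ cs)) ++ keys (ungroup rs)
      ↭⟨ Perm.++⁺ (↭-reflexive runKeys) (keys-Φ rs ls) ⟩
    (keys (keyed v L) ++ keys (keyed v R)) ++ (keys (ungroup (lefts E)) ++ keys (ungroup (rights E)))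
      ↭⟨ interchange (keys (keyed v L)) (keys (keyed v R)) _ _ ⟩
    (keys (keyed v L) ++ keys (ungroup (lefts E))) ++ (keys (keyed v R) ++ keys (ungroup (rights E)))
      ≡⟨ cong₂ _++_ (sym (trans (cong keys (ungroup-lefts-∷ v t E)) (ListP.map-++ proj₁ (keyed v L) _)))
                    (sym (trans (cong keys (ungroup-rights-∷ v t E)) (ListP.map-++ proj₁ (keyed v R) _))) ⟩
    keys (ungroup (lefts ((v , t) ∷ E))) ++ keys (ungroup (rights ((v , t) ∷ E))) ∎
    where
    open Data.List.Relation.Binary.Permutation.Propositional.PermutationReasoning
    t = decomposeRun (c ∷ cs)
    L = leftList t
    R = rightList t
    E = map (map₂ decomposeRun) rs
    runKeys : keys (keyed v (c ∷ cs)) ≡ keys (keyed v L) ++ keys (keyed v R)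
    runKeys = trans (keys-keyed v (c ∷ cs)) (trans (cong (λ m → replicate m v) (decomposeRun-length c cs l))
      (trans (replicate-+ (length L) (length R) v) (sym (cong₂ _++_ (keys-keyed v L) (keys-keyed v R)))))

  nonSpecial : List (Tile n) → List (Tile n)
  nonSpecial = filter (λ t → ¬? (isSpecial? t))

  private
    nonSpecial-∷ : ∀ {t} ts → ∃ (λ k → t ≡ b k) → nonSpecial (t ∷ ts) ≡ nonSpecial ts
    nonSpecial-∷ ts sp = ListP.filter-reject (λ t → ¬? (isSpecial? t)) (λ ¬sp → ¬sp sp)

    nonSpecial-++ : ∀ xs ys → nonSpecial (xs ++ ys) ≡ nonSpecial xs ++ nonSpecial ys
    nonSpecial-++ = ListP.filter-++ (λ t → ¬? (isSpecial? t))

    nonSpecial-empties : ∀ cs → All (_≡ ∅) cs → nonSpecial cs ≡ []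
    nonSpecial-empties [] _ = refl
    nonSpecial-empties (_ ∷ cs) (refl ∷ e) = trans (nonSpecial-∷ cs (Fin.zero , refl)) (nonSpecial-empties cs e)

    nonSpecial-copies : ∀ {q} m ys → Special q → nonSpecial (map tile (replicate m q) ++ ys) ≡ nonSpecial ys
    nonSpecial-copies zero ys _ = refl
    nonSpecial-copies (suc m) ys sq = trans (nonSpecial-∷ _ (special⇒b sq)) (nonSpecial-copies m ys sq)

    nonSpecial-removed : ∀ pre q m post → Special q →
      nonSpecial (map tile (pre ++ q ∷ replicate m q ++ post)) ≡ nonSpecial (map tile pre) ++ nonSpecial (map tile post)
    nonSpecial-removed pre q m post sq = begin
      nonSpecial (map tile (pre ++ q ∷ replicate m q ++ post))
        ≡⟨ cong nonSpecial (ListP.map-++ tile pre (q ∷ replicate m q ++ post)) ⟩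
      nonSpecial (map tile pre ++ tile q ∷ map tile (replicate m q ++ post))
        ≡⟨ nonSpecial-++ (map tile pre) _ ⟩
      nonSpecial (map tile pre) ++ nonSpecial (tile q ∷ map tile (replicate m q ++ post))
        ≡⟨ cong (nonSpecial (map tile pre) ++_) (nonSpecial-∷ _ (special⇒b sq)) ⟩
      nonSpecial (map tile pre) ++ nonSpecial (map tile (replicate m q ++ post))
        ≡⟨ cong (λ z → nonSpecial (map tile pre) ++ nonSpecial z) (ListP.map-++ tile (replicate m q) post) ⟩
      nonSpecial (map tile pre) ++ nonSpecial (map tile (replicate m q) ++ map tile post)
        ≡⟨ cong (nonSpecial (map tile pre) ++_) (nonSpecial-copies m (map tile post) sq) ⟩
      nonSpecial (map tile pre) ++ nonSpecial (map tile post) ∎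
      where open ≡-Reasoning

    nonSpecial-split : ∀ pre post → nonSpecial (map tile (pre ++ post)) ≡ nonSpecial (map tile pre) ++ nonSpecial (map tile post)
    nonSpecial-split pre post = trans (cong nonSpecial (ListP.map-++ tile pre post)) (nonSpecial-++ (map tile pre) (map tile post))

  extract-nonSpecial-colours : ∀ qs → Linked _⊳_ qs → nonSpecial (map tile qs) ≡ nonSpecial (map tile (proj₁ (extractSpecial qs)))
  extract-nonSpecial-colours qs chain with extractShape qs chain
  ... | unchanged eq rewrite eq = refl
  ... | kept pre q m post refl sq eq rewrite eq =
    trans (nonSpecial-removed pre q m post sq) (sym (nonSpecial-removed pre q 0 post sq))
  ... | dropped pre q m post refl sq eq rewrite eq =
    trans (nonSpecial-removed pre q m post sq) (sym (nonSpecial-split pre post))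

  decomposeRun-colours : ∀ c cs → Linked ZeroEnergy (c ∷ cs) →
    nonSpecial (c ∷ cs) ≡ nonSpecial (map tile (leftList (decomposeRun (c ∷ cs))))
  decomposeRun-colours c cs l with runShape c cs l
  ... | empties cs e = nonSpecial-empties (∅ ∷ cs) (refl ∷ e)
  ... | tiles p ps chain rewrite pairsOf-map ps =
    trans (extract-nonSpecial-colours (p ∷ ps) chain)
      (cong (nonSpecial ∘ map tile) (sym (leftList-fromExtraction (proj₁ e) (proj₂ e) (extract-nonEmpty (p ∷ ps) chain (λ ())))))
    where e = extractSpecial (p ∷ ps)

  colours-Φ : ∀ rs → All (λ r → Linked ZeroEnergy (toList (proj₂ r))) rs →
    nonSpecial (map proj₂ (ungroup rs)) ≡ nonSpecial (map tile (map proj₂ (ungroup (lefts (map (map₂ decomposeRun) rs)))))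
  colours-Φ [] _ = refl
  colours-Φ ((v , c ∷ cs) ∷ rs) (l ∷ ls) = begin
    nonSpecial (map proj₂ (keyed v (c ∷ cs) ++ ungroup rs))
      ≡⟨ cong nonSpecial (ListP.map-++ proj₂ (keyed v (c ∷ cs)) (ungroup rs)) ⟩
    nonSpecial (map proj₂ (keyed v (c ∷ cs)) ++ map proj₂ (ungroup rs))
      ≡⟨ nonSpecial-++ (map proj₂ (keyed v (c ∷ cs))) (map proj₂ (ungroup rs)) ⟩
    nonSpecial (map proj₂ (keyed v (c ∷ cs))) ++ nonSpecial (map proj₂ (ungroup rs))
      ≡⟨ cong₂ _++_ (trans (cong nonSpecial (colours-keyed v (c ∷ cs))) (decomposeRun-colours c cs l)) (colours-Φ rs ls) ⟩
    nonSpecial (map tile L) ++ nonSpecial (map tile (map proj₂ (ungroup (lefts E))))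
      ≡⟨ nonSpecial-++ (map tile L) (map tile (map proj₂ (ungroup (lefts E)))) ⟨
    nonSpecial (map tile L ++ map tile (map proj₂ (ungroup (lefts E))))
      ≡⟨ cong nonSpecial (trans (ListP.map-++ tile (map proj₂ (keyed v L)) _) (cong (λ z → map tile z ++ _) (colours-keyed v L))) ⟨
    nonSpecial (map tile (map proj₂ (keyed v L) ++ map proj₂ (ungroup (lefts E))))
      ≡⟨ cong (nonSpecial ∘ map tile) (trans (cong (map proj₂) (ungroup-lefts-∷ v t E)) (ListP.map-++ proj₂ (keyed v L) _)) ⟨
    nonSpecial (map tile (map proj₂ (ungroup (lefts ((v , t) ∷ E))))) ∎
    where
    open ≡-Reasoning
    t = decomposeRun (c ∷ cs)
    L = leftList t
    E = map (map₂ decomposeRun) rs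

-- Integer parts

module _ {A : Set} where

  toℤ : List (ℕ × A) → List (ℤ × A)
  toℤ = map (map₁ (λ a → + a))

  magnitudes : List (ℤ × A) → List (ℕ × A)
  magnitudes = map (map₁ ∣_∣)

  magnitudes-toℤ : ∀ xs → magnitudes (toℤ xs) ≡ xs
  magnitudes-toℤ [] = refl
  magnitudes-toℤ (x ∷ xs) = cong (x ∷_) (magnitudes-toℤ xs)

  NonNegative : ℤ × A → Set
  NonNegative x = + 0 ℤ.≤ proj₁ x

  toℤ-magnitudes : ∀ xs → All NonNegative xs → toℤ (magnitudes xs) ≡ xs
  toℤ-magnitudes [] _ = refl
  toℤ-magnitudes ((k , a) ∷ xs) (0≤k ∷ nn) = cong₂ _∷_ (cong (_, a) (ℤP.0≤i⇒+∣i∣≡i 0≤k)) (toℤ-magnitudes xs nn)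

  toℤ-∷ʳ : ∀ xs (z : ℕ × A) → toℤ (xs ∷ʳ z) ≡ toℤ xs ∷ʳ map₁ (λ a → + a) z
  toℤ-∷ʳ xs z = ListP.map-++ (map₁ (λ a → + a)) xs (z ∷ [])

  magnitudes-∷ʳ : ∀ xs (z : ℤ × A) → magnitudes (xs ∷ʳ z) ≡ magnitudes xs ∷ʳ map₁ ∣_∣ z
  magnitudes-∷ʳ xs z = ListP.map-++ (map₁ ∣_∣) xs (z ∷ [])

  Linked-toℤ : ∀ {R : Rel (ℤ × A) 0ℓ} {R′ : Rel (ℕ × A) 0ℓ} →
    (∀ {x y} → R′ x y → R (map₁ (λ a → + a) x) (map₁ (λ a → + a) y)) → ∀ {xs} → Linked R′ xs → Linked R (toℤ xs)
  Linked-toℤ f l = LinkedP.map⁺ (Linked.map f l)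

  Linked-fromℤ : ∀ {R : Rel (ℤ × A) 0ℓ} {R′ : Rel (ℕ × A) 0ℓ} →
    (∀ {x y} → R (map₁ (λ a → + a) x) (map₁ (λ a → + a) y) → R′ x y) → ∀ {xs} → Linked R (toℤ xs) → Linked R′ xs
  Linked-fromℤ f l = Linked.map f (LinkedP.map⁻ l)

  nonNegative : ∀ {R : Rel (ℤ × A) 0ℓ} → (∀ {x y} → R x y → proj₁ y ℤ.≤ proj₁ x) →
    ∀ xs {z} → proj₁ z ≡ + 0 → Linked R (xs ∷ʳ z) → All NonNegative xs
  nonNegative R⇒≥ xs {z} z≡0 l =
    All.map (subst (ℤ._≤ _) z≡0) (Linked⇒All-before (λ b≤a c≤b → ℤP.≤-trans c≤b b≤a) xs {ys = []} (Linked.map R⇒≥ l))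

+-gap⇒ : ∀ h a a′ → + h ℤ.≤ + a ℤ.- + a′ → h + a′ ≤ a
+-gap⇒ h a a′ p =
  ℕP.m≤o∸n⇒m+n≤o h a′≤a (ℤP.drop‿+≤+ (subst (+ h ℤ.≤_) (trans (ℤP.m-n≡m⊖n a a′) (ℤP.⊖-≥ a′≤a)) p))
  where
  a′≤a : a′ ≤ a
  a′≤a = ℤP.drop‿+≤+ (ℤP.0≤i-j⇒j≤i (ℤP.≤-trans (ℤ.+≤+ z≤n) p))

+-gap⇐ : ∀ h a a′ → h + a′ ≤ a → + h ℤ.≤ + a ℤ.- + a′
+-gap⇐ h a a′ p =
  subst (+ h ℤ.≤_) (sym (trans (ℤP.m-n≡m⊖n a a′) (ℤP.⊖-≥ (ℕP.m+n≤o⇒n≤o h p)))) (ℤ.+≤+ (ℕP.m+n≤o⇒m≤o∸n h p))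

+-gap⇒≥ : ∀ h k k′ → + h ℤ.≤ k ℤ.- k′ → k′ ℤ.≤ k
+-gap⇒≥ h k k′ p = ℤP.0≤i-j⇒j≤i (ℤP.≤-trans (ℤ.+≤+ z≤n) p)

module Conversion (n : ℕ) (i : Fin (suc n)) where

  open Coordinates n
  open TileRuns n
  open Energies n
  open Terminal n
  open Validity n i

  terminalℤ : CInt n
  terminalℤ = + 0 , b i

  front-nonNegative : (π : Pgg i) → All NonNegative (IsGg.front (proj₂ π))
  front-nonNegative (π , g) = nonNegative (λ {x} {y} → +-gap⇒≥ _ (proj₁ x) (proj₁ y)) (IsGg.front g) refl
    (subst (Linked GgRel) (IsGg.ends g) (IsGg.chain g))

  front-toℤ : (π : Pgg i) → toℤ (magnitudes (IsGg.front (proj₂ π))) ≡ IsGg.front (proj₂ π)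
  front-toℤ π = toℤ-magnitudes _ (front-nonNegative π)

  gg⇒validParts : (π : Pgg i) → ValidParts (magnitudes (IsGg.front (proj₂ π)))
  gg⇒validParts π@(_ , g) = steps , penultimate
    where
    xs = magnitudes (IsGg.front g)
    steps : Linked Step (xs ∷ʳ terminal i)
    steps = Linked-fromℤ (λ {x} {y} → +-gap⇒ (H (proj₂ y) (proj₂ x)) (proj₁ x) (proj₁ y))
      (subst (Linked GgRel) (trans (IsGg.ends g) (trans (cong (_∷ʳ terminalℤ) (sym (front-toℤ π))) (sym (toℤ-∷ʳ xs (terminal i)))))
        (IsGg.chain g))
    penultimate : ∀ zs z → xs ≡ zs ∷ʳ z → z ≢ terminal i
    penultimate zs z eq refl = IsGg.penult g (toℤ zs) terminalℤ
      (trans (sym (front-toℤ π)) (trans (cong toℤ eq) (toℤ-∷ʳ zs z))) refl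

  validParts⇒gg : ∀ xs → ValidParts xs → IsGg i (toℤ xs ∷ʳ terminalℤ)
  validParts⇒gg xs (steps , penultimate) = record
    { front = toℤ xs
    ; ends = refl
    ; penult = λ zs z eq z≡t → penultimate (magnitudes zs) (map₁ ∣_∣ z)
        (trans (sym (magnitudes-toℤ xs)) (trans (cong magnitudes eq) (magnitudes-∷ʳ zs z))) (cong (map₁ ∣_∣) z≡t)
    ; chain = subst (Linked GgRel) (toℤ-∷ʳ xs (terminal i))
        (Linked-toℤ (λ {x} {y} → +-gap⇐ (H (proj₂ y) (proj₂ x)) (proj₁ x) (proj₁ y)) steps) }

  private
    ρLink⇒ρRel : ∀ {x y} → ρLink x y → ρRel i (map₁ (λ a → + a) x) (map₁ (λ a → + a) y)
    ρLink⇒ρRel {a , just e} {a′ , c} h = +-gap⇐ (ρ i e c) a a′ h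

    ρRel⇒ρLink : ∀ {x y} → ρRel i (map₁ (λ a → + a) x) (map₁ (λ a → + a) y) → ρLink x y
    ρRel⇒ρLink {a , just e} {a′ , c} h = +-gap⇒ (ρ i e c) a a′ h

    ρRel⇒≥ : ∀ {x y} → ρRel i x y → proj₁ y ℤ.≤ proj₁ x
    ρRel⇒≥ {k , just e} {k′ , c} h = +-gap⇒≥ (ρ i e c) k k′ h

    tildeSeq-toℤ : ∀ (ys : List (ℕ × P)) → tildeSeq (toℤ ys) ≡ toℤ (map (map₂ just) ys ∷ʳ (0 , nothing))
    tildeSeq-toℤ [] = refl
    tildeSeq-toℤ (y ∷ ys) = cong (_ ∷_) (tildeSeq-toℤ ys)

  tilde-nonNegative : ∀ (ys : List (ℤ × P)) → IsTilde i ys → All NonNegative ys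
  tilde-nonNegative ys t = AllP.map⁻ (nonNegative (λ {x} {y} → ρRel⇒≥ {x} {y}) (map (λ { (k , p) → k , just p }) ys) refl t)

  tilde⇒validMu : ∀ (ys : List (ℤ × P)) → IsTilde i ys → ValidMu (magnitudes ys)
  tilde⇒validMu ys t = Linked-fromℤ (λ {x} {y} → ρRel⇒ρLink {x} {y})
    (subst (Linked (ρRel i)) (trans (cong tildeSeq (sym (toℤ-magnitudes ys (tilde-nonNegative ys t)))) (tildeSeq-toℤ (magnitudes ys))) t)

  validMu⇒tilde : ∀ (ys : List (ℕ × P)) → ValidMu ys → IsTilde i (toℤ ys)
  validMu⇒tilde ys v = subst (Linked (ρRel i)) (sym (tildeSeq-toℤ ys)) (Linked-toℤ (λ {x} {y} → ρLink⇒ρRel {x} {y}) v)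

  withUnits : List ℕ → List (ℕ × ⊤)
  withUnits = map (_, tt)

  keys-withUnits : ∀ ν → keys (withUnits ν) ≡ ν
  keys-withUnits [] = refl
  keys-withUnits (a ∷ ν) = cong (a ∷_) (keys-withUnits ν)

  withUnits-keys : ∀ zs → withUnits (keys zs) ≡ zs
  withUnits-keys [] = refl
  withUnits-keys ((a , tt) ∷ zs) = cong ((a , tt) ∷_) (withUnits-keys zs)

  partition⇒validNu : ∀ ν → IsPartition ν → ValidNu (withUnits ν)
  partition⇒validNu ν (dec , pos) = LinkedP.map⁺ dec , AllP.map⁺ pos

  validNu⇒partition : ∀ zs → ValidNu zs → IsPartition (keys zs)
  validNu⇒partition zs (dec , pos) = LinkedP.map⁺ dec , AllP.map⁺ pos

  open Correspondence n

  Φ : Pgg i → Pρ i × Partition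
  Φ π = (replaceSeq i (toℤ ys) , toℤ ys , validMu⇒tilde ys (proj₁ valid) , refl) , (keys zs , validNu⇒partition zs (proj₂ valid))
    where
    xs = magnitudes (IsGg.front (proj₂ π))
    ys = proj₁ (Φℕ xs)
    zs = proj₂ (Φℕ xs)
    valid = Φℕ-valid xs (gg⇒validParts π)

  Ψ : Pρ i × Partition → Pgg i
  Ψ ((_ , ys , t , _) , (ν , pν)) = toℤ λs ∷ʳ terminalℤ , validParts⇒gg λs
    (Ψℕ-valid (magnitudes ys) (withUnits ν) (tilde⇒validMu ys t) (partition⇒validNu ν pν))
    where λs = Ψℕ (magnitudes ys) (withUnits ν)

  Ψ∘Φ : ∀ λ′ → proj₁ (Ψ (Φ λ′)) ≡ proj₁ λ′
  Ψ∘Φ π@(_ , g) = begin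
    toℤ (Ψℕ (magnitudes (toℤ ys)) (withUnits (keys zs))) ∷ʳ terminalℤ
      ≡⟨ cong₂ (λ a c → toℤ (Ψℕ a c) ∷ʳ terminalℤ) (magnitudes-toℤ ys) (withUnits-keys zs) ⟩
    toℤ (uncurry Ψℕ (Φℕ xs)) ∷ʳ terminalℤ
      ≡⟨ cong (λ a → toℤ a ∷ʳ terminalℤ) (Ψℕ-Φℕ xs (validParts⇒stacked xs (gg⇒validParts π))) ⟩
    toℤ xs ∷ʳ terminalℤ
      ≡⟨ cong (_∷ʳ terminalℤ) (front-toℤ π) ⟩
    IsGg.front g ∷ʳ terminalℤ
      ≡⟨ IsGg.ends g ⟨
    proj₁ π ∎
    where
    open ≡-Reasoning
    xs = magnitudes (IsGg.front g)
    ys = proj₁ (Φℕ xs)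
    zs = proj₂ (Φℕ xs)

  Φ∘Ψ : ∀ μν → proj₁ (proj₁ (Φ (Ψ μν))) ≡ proj₁ (proj₁ μν) × proj₁ (proj₂ (Φ (Ψ μν))) ≡ proj₁ (proj₂ μν)
  Φ∘Ψ ((μ , ys , t , μ≡) , (ν , pν)) =
    trans (cong (λ a → replaceSeq i (toℤ (proj₁ a))) inverse)
      (trans (cong (replaceSeq i) (toℤ-magnitudes ys (tilde-nonNegative ys t))) (sym μ≡)) ,
    trans (cong (keys ∘ proj₂) inverse) (keys-withUnits ν)
    where
    vμ = tilde⇒validMu ys t
    vν = partition⇒validNu ν pν
    λs = Ψℕ (magnitudes ys) (withUnits ν)
    inverse : Φℕ (magnitudes (toℤ λs)) ≡ (magnitudes ys , withUnits ν)
    inverse = trans (cong Φℕ (magnitudes-toℤ λs))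
      (Φℕ-Ψℕ (magnitudes ys) (withUnits ν) (validMu⇒stacked _ vμ) (validNu⇒stacked _ vν))

  open Statistics n

  private
    size-terminated : ∀ {A : Set} xs (a : A) → size (toℤ xs ∷ʳ (+ 0 , a)) ≡ + sumℕ (keys xs)
    size-terminated [] a = refl
    size-terminated ((k , _) ∷ xs) a =
      trans (cong (λ s → + k ℤ.+ s) (size-terminated xs a)) (sym (ℤP.pos-+ k (sumℕ (keys xs))))

    length-terminated : ∀ {A : Set} (ws : List (ℕ × A)) z → length (toℤ ws ∷ʳ z) ≡ length ws + 1
    length-terminated ws z = trans (ListP.length-++ (toℤ ws)) (cong (_+ 1) (ListP.length-map _ ws))

    colours-toℤ : ∀ {A : Set} (xs : List (ℕ × A)) → map proj₂ (toℤ xs) ≡ map proj₂ xs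
    colours-toℤ [] = refl
    colours-toℤ (x ∷ xs) = cong (_ ∷_) (colours-toℤ xs)

    colours-terminated : ∀ (ws : List (ℕ × Tile n)) →
      nonSpecialColours (toℤ ws ∷ʳ terminalℤ) ≡ nonSpecial (map proj₂ ws) ++ nonSpecial (b i ∷ [])
    colours-terminated ws = begin
      nonSpecial (map proj₂ (toℤ ws ∷ʳ terminalℤ))
        ≡⟨ cong nonSpecial (ListP.map-++ proj₂ (toℤ ws) (terminalℤ ∷ [])) ⟩
      nonSpecial (map proj₂ (toℤ ws) ++ b i ∷ [])
        ≡⟨ ListP.filter-++ _ (map proj₂ (toℤ ws)) (b i ∷ []) ⟩
      nonSpecial (map proj₂ (toℤ ws)) ++ nonSpecial (b i ∷ [])
        ≡⟨ cong (λ cs → nonSpecial cs ++ nonSpecial (b i ∷ [])) (colours-toℤ ws) ⟩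
      nonSpecial (map proj₂ ws) ++ nonSpecial (b i ∷ []) ∎
      where open ≡-Reasoning

    replaceSeq-toℤ : ∀ (ys : List (ℕ × P)) → replaceSeq i (toℤ ys) ≡ toℤ (map (map₂ tile) ys) ∷ʳ terminalℤ
    replaceSeq-toℤ [] = refl
    replaceSeq-toℤ (y ∷ ys) = cong (_ ∷_) (replaceSeq-toℤ ys)

    keys-tiles : ∀ (ys : List (ℕ × P)) → keys (map (map₂ tile) ys) ≡ keys ys
    keys-tiles [] = refl
    keys-tiles (y ∷ ys) = cong (_ ∷_) (keys-tiles ys)

    colours-tiles : ∀ (ys : List (ℕ × P)) → map proj₂ (map (map₂ tile) ys) ≡ map tile (map proj₂ ys)
    colours-tiles [] = refl
    colours-tiles (y ∷ ys) = cong (_ ∷_) (colours-tiles ys)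

  replaceSeq-size : ∀ ys → size (replaceSeq i (toℤ ys)) ≡ + sumℕ (keys ys)
  replaceSeq-size ys = trans (cong size (replaceSeq-toℤ ys))
    (trans (size-terminated (map (map₂ tile) ys) (b i)) (cong (λ ks → + sumℕ ks) (keys-tiles ys)))

  replaceSeq-length : ∀ ys → length (replaceSeq i (toℤ ys)) ≡ length ys + 1
  replaceSeq-length ys = trans (cong length (replaceSeq-toℤ ys))
    (trans (length-terminated (map (map₂ tile) ys) terminalℤ) (cong (_+ 1) (ListP.length-map _ ys)))

  replaceSeq-colours : ∀ ys → nonSpecialColours (replaceSeq i (toℤ ys)) ≡ nonSpecial (map tile (map proj₂ ys)) ++ nonSpecial (b i ∷ [])
  replaceSeq-colours ys = trans (cong nonSpecialColours (replaceSeq-toℤ ys))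
    (trans (colours-terminated (map (map₂ tile) ys)) (cong (λ cs → nonSpecial cs ++ nonSpecial (b i ∷ [])) (colours-tiles ys)))

  π-shape : (π : Pgg i) → proj₁ π ≡ toℤ (magnitudes (IsGg.front (proj₂ π))) ∷ʳ terminalℤ
  π-shape π@(_ , g) = trans (IsGg.ends g) (cong (_∷ʳ terminalℤ) (sym (front-toℤ π)))

  Φℕ-keys : ∀ xs → ValidParts xs → keys xs ↭ keys (proj₁ (Φℕ xs)) ++ keys (proj₂ (Φℕ xs))
  Φℕ-keys xs valid = subst (λ l → keys l ↭ keys (proj₁ (Φℕ xs)) ++ keys (proj₂ (Φℕ xs))) (ungroup-group xs)
    (keys-Φ (group xs) (proj₂ (stacked-runs xs (validParts⇒stacked xs valid))))

  Φℕ-colours : ∀ xs → ValidParts xs → nonSpecial (map proj₂ xs) ≡ nonSpecial (map tile (map proj₂ (proj₁ (Φℕ xs))))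
  Φℕ-colours xs valid =
    subst (λ l → nonSpecial (map proj₂ l) ≡ nonSpecial (map tile (map proj₂ (proj₁ (Φℕ xs))))) (ungroup-group xs)
      (colours-Φ (group xs) (proj₂ (stacked-runs xs (validParts⇒stacked xs valid))))

  module _ (π : Pgg i) where

    private
      xs = magnitudes (IsGg.front (proj₂ π))
      ys = proj₁ (Φℕ xs)
      zs = proj₂ (Φℕ xs)
      valid = gg⇒validParts π
      keys↭ = Φℕ-keys xs valid

    Φ-size : size (proj₁ π) ≡ size (proj₁ (proj₁ (Φ π))) ℤ.+ + sumℕ (proj₁ (proj₂ (Φ π)))
    Φ-size = begin
      size (proj₁ π)                                     ≡⟨ cong size (π-shape π) ⟩
      size (toℤ xs ∷ʳ terminalℤ)                         ≡⟨ size-terminated xs (b i) ⟩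
      + sumℕ (keys xs)                                   ≡⟨ cong (λ s → + s) (ListAction.sum-↭ keys↭) ⟩
      + sumℕ (keys ys ++ keys zs)                        ≡⟨ cong (λ s → + s) (ListAction.sum-++ (keys ys) (keys zs)) ⟩
      + (sumℕ (keys ys) + sumℕ (keys zs))                ≡⟨ ℤP.pos-+ (sumℕ (keys ys)) (sumℕ (keys zs)) ⟩
      + sumℕ (keys ys) ℤ.+ + sumℕ (keys zs)              ≡⟨ cong (ℤ._+ + sumℕ (keys zs)) (replaceSeq-size ys) ⟨
      size (replaceSeq i (toℤ ys)) ℤ.+ + sumℕ (keys zs)  ∎
      where open ≡-Reasoning

    Φ-length : length (proj₁ π) ≡ length (proj₁ (proj₁ (Φ π))) + length (proj₁ (proj₂ (Φ π)))
    Φ-length = begin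
      length (proj₁ π)                                   ≡⟨ cong length (π-shape π) ⟩
      length (toℤ xs ∷ʳ terminalℤ)                       ≡⟨ length-terminated xs terminalℤ ⟩
      length xs + 1                                      ≡⟨ cong (_+ 1) (ListP.length-map proj₁ xs) ⟨
      length (keys xs) + 1                               ≡⟨ cong (_+ 1) (Perm.↭-length keys↭) ⟩
      length (keys ys ++ keys zs) + 1                    ≡⟨ cong (_+ 1) (ListP.length-++ (keys ys)) ⟩
      (length (keys ys) + length (keys zs)) + 1          ≡⟨ cong (λ l → (l + length (keys zs)) + 1) (ListP.length-map proj₁ ys) ⟩
      (length ys + length (keys zs)) + 1                 ≡⟨ ℕP.+-assoc (length ys) _ 1 ⟩
      length ys + (length (keys zs) + 1)                 ≡⟨ cong (λ l → length ys + l) (ℕP.+-comm (length (keys zs)) 1) ⟩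
      length ys + (1 + length (keys zs))                 ≡⟨ ℕP.+-assoc (length ys) 1 _ ⟨
      (length ys + 1) + length (keys zs)                 ≡⟨ cong (_+ length (keys zs)) (replaceSeq-length ys) ⟨
      length (replaceSeq i (toℤ ys)) + length (keys zs)  ∎
      where open ≡-Reasoning

    Φ-colours : nonSpecialColours (proj₁ π) ≡ nonSpecialColours (proj₁ (proj₁ (Φ π)))
    Φ-colours = begin
      nonSpecialColours (proj₁ π)                                    ≡⟨ cong nonSpecialColours (π-shape π) ⟩
      nonSpecialColours (toℤ xs ∷ʳ terminalℤ)                        ≡⟨ colours-terminated xs ⟩
      nonSpecial (map proj₂ xs) ++ nonSpecial (b i ∷ [])             ≡⟨ cong (_++ nonSpecial (b i ∷ [])) (Φℕ-colours xs valid) ⟩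
      nonSpecial (map tile (map proj₂ ys)) ++ nonSpecial (b i ∷ [])  ≡⟨ replaceSeq-colours ys ⟨
      nonSpecialColours (replaceSeq i (toℤ ys))                      ∎
      where open ≡-Reasoning

theorem1p9 : (n : ℕ) (i : Fin (suc n)) →
  Σ (Pgg i → Pρ i × Partition) λ Φ →
  Σ (Pρ i × Partition → Pgg i) λ Ψ →
    (∀ λ′ → proj₁ (Ψ (Φ λ′)) ≡ proj₁ λ′)
    × (∀ μν → proj₁ (proj₁ (Φ (Ψ μν))) ≡ proj₁ (proj₁ μν)
            × proj₁ (proj₂ (Φ (Ψ μν))) ≡ proj₁ (proj₂ μν))
    × (∀ λ′ → size (proj₁ λ′) ≡ size (proj₁ (proj₁ (Φ λ′))) ℤ.+ + sumℕ (proj₁ (proj₂ (Φ λ′)))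
            × length (proj₁ λ′) ≡ length (proj₁ (proj₁ (Φ λ′))) Data.Nat.+ length (proj₁ (proj₂ (Φ λ′)))
            × nonSpecialColours (proj₁ λ′) ↭ nonSpecialColours (proj₁ (proj₁ (Φ λ′))))
theorem1p9 n i = Φ , Ψ , Ψ∘Φ , Φ∘Ψ , λ π → Φ-size π , Φ-length π , ↭-reflexive (Φ-colours π)
  where open Conversion n i
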